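{- Let $n\ge1$ and $\mathrm{CS}_n=\{(c_n,\dots,c_1):1\le c_k\le k\text{ for }1\le k\le n\}$ (so $|\mathrm{CS}_n|=n!$). (a) For each $\lambda\in P(n)$, let $\mathrm{Surv}_\lambda$ be the set of triples $(S,S,\sigma)$ such that, for some $\beta\in C(n)$, $S\in\mathrm{RHT}(\lambda,\beta)$, $\sigma\in S_n$ and $\mathrm{cycC}(\sigma)=\beta$. Then there is a bijection $F_\lambda:\mathrm{CS}_n\to\mathrm{Surv}_\lambda$. (b) Let $\mu\in P(n)$ and let $\rho$ be a fixed rim-hook such that $\mathrm{dg}(\mu)\setminus\rho$ is the diagram of a partition. Let $\mathrm{Surv}_{\mu,\rho}$ be the set of pairs $(T,\sigma)$ where $T\in\mathrm{RHT}(\mu,\beta)$ for some $\beta\in C(n)$, the cells of $T$ containing its largest label $\ell(\beta)$ are exactly $\rho$, $\sigma\in S_n$, and $\mathrm{cycC}(\sigma)=\beta$. Then there is a bijection $F_{\mu,\rho}:\mathrm{CS}_{n-1}\to\mathrm{Surv}_{\mu,\rho}$.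
   Context: $P(n)$, $C(n)$: partitions and compositions of $n$; $\mathrm{dg}(\mu)$ is the diagram of left-justified rows of boxes, row $i$ from the top having $\mu_i$ boxes. A rim-hook is a set of boxes that can be traversed starting at some box and successively moving one step right or one step up. $\mathrm{RHT}(\lambda,\beta)$ is the set of fillings of $\mathrm{dg}(\lambda)$ such that for each $k$ the cells containing $k$ form a rim-hook of size $\beta_k$, and the cells containing $1,\dots,k$ form a partition diagram. For $\sigma\in S_n$, the canonical cycle notation writes each cycle starting at its minimum element and lists cycles with their minimum elements in decreasing order; $\mathrm{cycC}(\sigma)$ is the list of cycle lengths (including 1-cycles) in this notation, left to right. $\mathrm{CS}_0$ is the one-element set containing the empty sequence. -}

module Defs where

open import Data.Bool using (Bool; not)
open import Data.Nat using (ℕ; zero; suc; _≤_; _<_; _≥_; _∸_; _≤ᵇ_)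
open import Data.Fin as Fin using (Fin; toℕ)
open import Data.Nat.ListAction using (sum)
open import Data.Bool.ListAction using (all)
open import Data.List as L using (List; []; _∷_; length; map; reverse; upTo; allFin; takeWhileᵇ; filterᵇ)
open import Data.List.Membership.Propositional using (_∈_)
open import Data.List.Relation.Unary.All using (All)
open import Data.List.Relation.Unary.Linked using (Linked)
open import Data.Vec as V using (Vec)
open import Data.Product using (Σ; _×_; _,_)
open import Data.Sum using (_⊎_)
open import Data.Maybe using (Maybe; just; nothing)
open import Relation.Nullary using (¬_; does)
open import Relation.Binary.PropositionalEquality using (_≡_)
open import Function.Bundles using (_⇔_)

-- A subset of A: an element together with an (irrelevant) proof of membership.
-- Equality of elements of Sub A P is equality of the underlying values.
record Sub (A : Set) (P : A → Set) : Set where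
  constructor ⟨_,_⟩
  field
    val : A
    .prop : P val

IsComposition : ℕ → List ℕ → Set
IsComposition n β = All (λ b → 1 ≤ b) β × sum β ≡ n

IsPartitionShape : List ℕ → Set
IsPartitionShape μ = All (λ b → 1 ≤ b) μ × Linked _≥_ μ

IsPartition : ℕ → List ℕ → Set
IsPartition n μ = IsComposition n μ × Linked _≥_ μ

-- cells (row i, column j), 0-based, row 0 is the top row
Cell : Set
Cell = ℕ × ℕ

lookupM : {A : Set} → List A → ℕ → Maybe A
lookupM []       _       = nothing
lookupM (x ∷ xs) zero    = just x
lookupM (x ∷ xs) (suc i) = lookupM xs i

InDg : List ℕ → Cell → Set
InDg μ (i , j) = Σ ℕ λ r → lookupM μ i ≡ just r × j < r

IsPartitionDiagram : (Cell → Set) → Set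
IsPartitionDiagram S = Σ (List ℕ) λ ν → IsPartitionShape ν × (∀ c → S c ⇔ InDg ν c)

Step : Cell → Cell → Set
Step (i , j) (i' , j') = (i' ≡ i × j' ≡ suc j) ⊎ (suc i' ≡ i × j' ≡ j)

RimHookPath : (Cell → Set) → List Cell → Set
RimHookPath S p = 1 ≤ length p × Linked Step p × (∀ c → S c ⇔ (c ∈ p))

IsRimHook : (Cell → Set) → Set
IsRimHook S = Σ (List Cell) λ p → RimHookPath S p

-- rim-hook of size m (steps are monotone, so boxes of a path are distinct)
IsRimHookOfSize : (Cell → Set) → ℕ → Set
IsRimHookOfSize S m = Σ (List Cell) λ p → RimHookPath S p × length p ≡ m

entry : List (List ℕ) → Cell → Maybe ℕ
entry T (i , j) with lookupM T i
... | nothing  = nothing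
... | just row = lookupM row j

IsRHT : List ℕ → List ℕ → List (List ℕ) → Set
IsRHT la β T =
  map length T ≡ la
  × (∀ c v → entry T c ≡ just v → 1 ≤ v × v ≤ length β)
  × (∀ (k : Fin (length β)) →
       IsRimHookOfSize (λ c → entry T c ≡ just (suc (toℕ k))) (L.lookup β k))
  × (∀ (k : Fin (length β)) →
       IsPartitionDiagram (λ c → Σ ℕ λ v → entry T c ≡ just v × 1 ≤ v × v ≤ suc (toℕ k)))

-- S_n: permutations of Fin n (0-based stand-in for {1..n}), as one-line notation
IsPerm : (n : ℕ) → Vec (Fin n) n → Set
IsPerm n σ = ∀ i j → V.lookup σ i ≡ V.lookup σ j → i ≡ j

iter : {n : ℕ} → (Fin n → Fin n) → ℕ → Fin n → Fin n
iter f zero    x = x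
iter f (suc k) x = f (iter f k x)

-- length of the cycle through x: least k ≥ 1 with f^k x = x (searched up to n)
cycLen : {n : ℕ} → (Fin n → Fin n) → Fin n → ℕ
cycLen {n} f x = suc (length (takeWhileᵇ (λ k → not (does (iter f (suc k) x Fin.≟ x))) (upTo n)))

isCycleMin : {n : ℕ} → (Fin n → Fin n) → Fin n → Bool
isCycleMin f x = all (λ j → toℕ x ≤ᵇ toℕ (iter f j x)) (upTo (cycLen f x))

-- cycC(σ): cycle lengths, cycles listed with minimum elements in decreasing order
cycC : {n : ℕ} → Vec (Fin n) n → List ℕ
cycC {n} σ = map (cycLen f) (filterᵇ (isCycleMin f) (reverse (allFin n)))
  where f = V.lookup σ

-- CS_n = {(c_n,…,c_1) : 1 ≤ c_k ≤ k}; position i (0-based) of the vector holds c_{n-i}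
CS : ℕ → Set
CS n = Sub (Vec ℕ n) (λ v → ∀ (i : Fin n) → 1 ≤ V.lookup v i × V.lookup v i ≤ n ∸ toℕ i)

Surv : (n : ℕ) → List ℕ → Set
Surv n la = Sub (List (List ℕ) × List (List ℕ) × Vec (Fin n) n)
  (λ { (S₁ , S₂ , σ) → S₁ ≡ S₂ × IsPerm n σ ×
        Σ (List ℕ) λ β → IsComposition n β × IsRHT la β S₁ × cycC σ ≡ β })

SurvR : (n : ℕ) → List ℕ → List Cell → Set
SurvR n mu rho = Sub (List (List ℕ) × Vec (Fin n) n)
  (λ { (T , σ) → IsPerm n σ ×
        Σ (List ℕ) λ β → IsComposition n β × IsRHT mu β T
          × (∀ c → (entry T c ≡ just (length β)) ⇔ (c ∈ rho))
          × cycC σ ≡ β })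

-- Both bijections come from counting. In a pair (T , σ) of Surv, the largest label of T occupies a
-- rim hook R whose removal leaves a partition, and the last cycle of σ in canonical notation is the
-- cycle of 0, whose length must be |R| = c + 1. Such a σ is the same as the c elements that follow 0
-- in its cycle, in order, together with a permutation of the remaining m elements, whose cycle type
-- is the rest of cycC σ. So with R fixed, (T , σ) splits into (n - 1)(n - 2)⋯(m + 1) choices and a
-- pair of Surv for the smaller shape: by induction there are (n - 1)! of them, which is part (b).
-- A removable rim hook is determined by its top row and leftmost column, and each cell (i , j)
-- of λ arises from exactly one, the border strip of its hook. Hence |Surv_λ| = n · (n - 1)! = |CS_n|.

module Submission where

open import Defs
open Sub
open import Data.Bool using (Bool; true; false; not; _∧_; if_then_else_; T)
open import Data.Bool.ListAction using (all)
open import Data.Empty using (⊥; ⊥-elim; ⊥-elim-irr)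
open import Data.Fin as F using (Fin; toℕ)
import Data.Fin.Properties as FP
open import Data.Fin.Permutation using (↔⇒≡)
open import Data.List as L using (List; []; _∷_; _++_; _∷ʳ_; map; length; reverse; upTo; allFin; takeWhileᵇ; filterᵇ; applyUpTo; take; replicate)
import Data.List.Properties as LP
open import Data.List.Membership.Propositional using (_∈_)
open import Data.List.Membership.Propositional.Properties using (∈-filter⁻; ∈-map⁻)
open import Data.List.Membership.DecPropositional using (_∈?_)
open import Data.List.Relation.Unary.All as All using (All; []; _∷_)
import Data.List.Relation.Unary.All.Properties as AllP
open import Data.List.Relation.Unary.Any using (here; there)
import Data.List.Relation.Unary.Any.Properties as AnyP
open import Data.List.Relation.Unary.Linked as Linked using (Linked; []; [-]; _∷_)
import Data.List.Relation.Unary.Linked.Properties as LinkedP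
open import Data.List.Relation.Unary.AllPairs as AllPairs using (AllPairs; []; _∷_)
open import Data.Maybe using (just; nothing)
import Data.Maybe.Properties as MP
open import Data.Nat using (ℕ; zero; suc; _+_; _*_; _∸_; _≤_; _<_; _≥_; z≤n; s≤s; pred; _⊓_; _≤ᵇ_; _<ᵇ_; _<?_; _!)
open import Data.Nat.ListAction using (sum)
import Data.Nat.ListAction.Properties as SumP
open import Data.Nat.Properties
open import Data.Product using (Σ; _×_; _,_; proj₁; proj₂)
import Data.Product.Properties as ProdP
open import Data.Product.Function.NonDependent.Propositional using (_×-↔_)
open import Data.Sum using (_⊎_; inj₁; inj₂)
open import Data.Sum.Function.Propositional using (_⊎-↔_)
open import Data.Vec as V using (Vec)
import Data.Vec.Properties as VP
open import Function using (_∘_; id; case_of_)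
open import Function.Bundles using (_↔_; _⤖_; Inverse; mk↔ₛ′; _⇔_; mk⇔; Equivalence)
open import Function.Construct.Symmetry using (⇔-sym)
open import Function.Properties.Inverse using (↔-trans; ↔-sym; ↔-refl; ↔⇒⤖)
open import Relation.Binary.Definitions using (DecidableEquality; tri<; tri≈; tri>)
open import Relation.Binary.PropositionalEquality
open import Relation.Nullary
open import Relation.Nullary.Decidable using (recompute; T?; _→-dec_)


IsInjective : {A B : Set} → (A → B) → Set
IsInjective f = ∀ a b → f a ≡ f b → a ≡ b

irrEq : ∀ {A : Set} → DecidableEquality A → {x y : A} → .(x ≡ y) → x ≡ y
irrEq _≟_ {x} {y} = recompute (x ≟ y)

Sub≡ : ∀ {A : Set} {P : A → Set} {a b : A} .{p : P a} .{q : P b} → a ≡ b → ⟨ a , p ⟩ ≡ ⟨ b , q ⟩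
Sub≡ refl = refl


-- Cycle lengths

iter-sucʳ : ∀ {n} (f : Fin n → Fin n) k x → iter f (suc k) x ≡ iter f k (f x)
iter-sucʳ f zero    x = refl
iter-sucʳ f (suc k) x = cong f (iter-sucʳ f k x)

iter-+ : ∀ {n} (f : Fin n → Fin n) j k x → iter f (j + k) x ≡ iter f j (iter f k x)
iter-+ f zero    k x = refl
iter-+ f (suc j) k x = cong f (iter-+ f j k x)

iter-cong : ∀ {n} {f g : Fin n → Fin n} → (∀ x → f x ≡ g x) → ∀ k x → iter f k x ≡ iter g k x
iter-cong f≗g zero    x = refl
iter-cong {f = f} f≗g (suc k) x = trans (cong f (iter-cong f≗g k x)) (f≗g _)

iter-injective : ∀ {n} (f : Fin n → Fin n) → IsInjective f → ∀ k {x y} → iter f k x ≡ iter f k y → x ≡ y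
iter-injective f inj zero    e = e
iter-injective f inj (suc k) e = iter-injective f inj k (inj _ _ e)

iter-returns : ∀ {n} (f : Fin n → Fin n) → IsInjective f → ∀ x → Σ ℕ λ m → m < n × iter f (suc m) x ≡ x
iter-returns {n} f inj x with FP.pigeonhole (n<1+n n) (λ i → iter f (toℕ i) x)
... | i , j , i<j , fⁱ≡fʲ = d , d<n , sym (iter-injective f inj (toℕ i) fⁱx≡fⁱfᵈx)
  where
  d = toℕ j ∸ suc (toℕ i)
  i+d≡j : toℕ i + suc d ≡ toℕ j
  i+d≡j = trans (+-comm (toℕ i) (suc d)) (trans (sym (+-suc d (toℕ i))) (m∸n+n≡m i<j))
  d<n : d < n
  d<n = ≤-trans (subst (suc d ≤_) i+d≡j (m≤n+m (suc d) (toℕ i))) (FP.toℕ≤pred[n] j)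
  fⁱx≡fⁱfᵈx : iter f (toℕ i) x ≡ iter f (toℕ i) (iter f (suc d) x)
  fⁱx≡fⁱfᵈx = trans fⁱ≡fʲ (trans (cong (λ k → iter f k x) (sym i+d≡j)) (iter-+ f (toℕ i) (suc d) x))

prefixLength : (ℕ → Bool) → (ℕ → ℕ) → ℕ → ℕ
prefixLength p f n = length (takeWhileᵇ p (applyUpTo f n))

prefixLength-holds : ∀ p f n k → k < prefixLength p f n → p (f k) ≡ true
prefixLength-holds p f (suc n) k k< with p (f 0) in eq
prefixLength-holds p f (suc n) zero    k<       | true = eq
prefixLength-holds p f (suc n) (suc k) (s≤s k<) | true = prefixLength-holds p (f ∘ suc) n k k<

prefixLength-stops : ∀ p f n → prefixLength p f n < n → p (f (prefixLength p f n)) ≡ false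
prefixLength-stops p f (suc n) lt with p (f 0) in eq
... | true  = prefixLength-stops p (f ∘ suc) n (≤-pred lt)
... | false = eq

not-does-false : ∀ {n} (a b : Fin n) → not (does (a F.≟ b)) ≡ false → a ≡ b
not-does-false a b _ with a F.≟ b
... | yes a≡b = a≡b

not-does-true : ∀ {n} (a b : Fin n) → not (does (a F.≟ b)) ≡ true → a ≢ b
not-does-true a b _ with a F.≟ b
... | no a≢b = a≢b

notYetReturned : ∀ {n} → (Fin n → Fin n) → Fin n → ℕ → Bool
notYetReturned f x k = not (does (iter f (suc k) x F.≟ x))

-- cycLen f x is definitionally suc (cycLenPred f x).
cycLenPred : ∀ {n} → (Fin n → Fin n) → Fin n → ℕ
cycLenPred {n} f x = prefixLength (notYetReturned f x) id n

module _ {n} (f : Fin n → Fin n) (inj : IsInjective f) (x : Fin n) where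

  cycLen≤n : cycLen f x ≤ n
  cycLen≤n with iter-returns f inj x
  ... | m , m<n , fᵐ⁺¹x≡x with m <? cycLenPred f x
  ...   | yes m<ℓ = ⊥-elim (not-does-true _ _ (prefixLength-holds (notYetReturned f x) id n m m<ℓ) fᵐ⁺¹x≡x)
  ...   | no  m≮ℓ = ≤-<-trans (≮⇒≥ m≮ℓ) m<n

  iter-cycLen : iter f (cycLen f x) x ≡ x
  iter-cycLen = not-does-false _ _ (prefixLength-stops (notYetReturned f x) id n cycLen≤n)

  iter-below-cycLen : ∀ k → suc k < cycLen f x → iter f (suc k) x ≢ x
  iter-below-cycLen k (s≤s k<ℓ) = not-does-true _ _ (prefixLength-holds (notYetReturned f x) id n k k<ℓ)

  cycLen-unique : ∀ m → iter f (suc m) x ≡ x → (∀ k → k < m → iter f (suc k) x ≢ x) → cycLen f x ≡ suc m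
  cycLen-unique m returns minimal with <-cmp (cycLenPred f x) m
  ... | tri< ℓ<m _ _ = ⊥-elim (minimal _ ℓ<m iter-cycLen)
  ... | tri≈ _ ℓ≡m _ = cong suc ℓ≡m
  ... | tri> _ _ m<ℓ = ⊥-elim (iter-below-cycLen m (s≤s m<ℓ) returns)

  iter-mod-cycLen : ∀ k → Σ ℕ λ j → j < cycLen f x × iter f j x ≡ iter f k x
  iter-mod-cycLen zero = 0 , s≤s z≤n , refl
  iter-mod-cycLen (suc k) with iter-mod-cycLen k
  ... | j , j<ℓ , e with suc j <? cycLen f x
  ...   | yes j+1<ℓ = suc j , j+1<ℓ , cong f e
  ...   | no  j+1≮ℓ = 0 , s≤s z≤n , trans (sym iter-cycLen) (trans (cong (λ z → iter f z x) j+1≡ℓ) (cong f e))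
    where j+1≡ℓ = sym (≤-antisym j<ℓ (≮⇒≥ j+1≮ℓ))

all-applyUpTo⁻ : ∀ (p : ℕ → Bool) (g : ℕ → ℕ) m j → all p (applyUpTo g m) ≡ true → j < m → p (g j) ≡ true
all-applyUpTo⁻ p g (suc m) j e j<m with p (g 0) in eq
all-applyUpTo⁻ p g (suc m) zero    e _         | true = eq
all-applyUpTo⁻ p g (suc m) (suc j) e (s≤s j<m) | true = all-applyUpTo⁻ p (g ∘ suc) m j e j<m

all-applyUpTo⁺ : ∀ (p : ℕ → Bool) (g : ℕ → ℕ) m → (∀ j → j < m → p (g j) ≡ true) → all p (applyUpTo g m) ≡ true
all-applyUpTo⁺ p g zero    h = refl
all-applyUpTo⁺ p g (suc m) h rewrite h 0 (s≤s z≤n) = all-applyUpTo⁺ p (g ∘ suc) m (λ j j<m → h (suc j) (s≤s j<m))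

all-cong : ∀ {A : Set} {p q : A → Bool} → (∀ a → p a ≡ q a) → ∀ xs → all p xs ≡ all q xs
all-cong e []       = refl
all-cong e (x ∷ xs) = cong₂ _∧_ (e x) (all-cong e xs)

≤⇒≤ᵇ≡true : ∀ {a b} → a ≤ b → (a ≤ᵇ b) ≡ true
≤⇒≤ᵇ≡true {a} {b} a≤b with a ≤ᵇ b in eq
... | true  = refl
... | false = ⊥-elim (subst T eq (≤⇒≤ᵇ a≤b))

≤ᵇ≡true⇒≤ : ∀ a b → (a ≤ᵇ b) ≡ true → a ≤ b
≤ᵇ≡true⇒≤ a b e = ≤ᵇ⇒≤ a b (subst T (sym e) _)

≤ᵇ-cong : ∀ a b c d → (a ≤ b → c ≤ d) → (c ≤ d → a ≤ b) → (a ≤ᵇ b) ≡ (c ≤ᵇ d)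
≤ᵇ-cong a b c d ⇒ ⇐ with a ≤ᵇ b in ab | c ≤ᵇ d in cd
... | true  | true  = refl
... | false | false = refl
... | true  | false = ⊥-elim (subst T cd (≤⇒≤ᵇ (⇒ (≤ᵇ≡true⇒≤ a b ab))))
... | false | true  = ⊥-elim (subst T ab (≤⇒≤ᵇ (⇐ (≤ᵇ≡true⇒≤ c d cd))))

isCycleMin-zero : ∀ {n} (f : Fin (suc n) → Fin (suc n)) → isCycleMin f F.zero ≡ true
isCycleMin-zero f = all-applyUpTo⁺ (λ j → 0 ≤ᵇ toℕ (iter f j F.zero)) id (cycLen f F.zero) (λ j _ → ≤⇒≤ᵇ≡true {b = toℕ (iter f j F.zero)} z≤n)

isCycleMin-false : ∀ {n} (f : Fin n → Fin n) → IsInjective f → ∀ x k → toℕ (iter f k x) < toℕ x → isCycleMin f x ≡ false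
isCycleMin-false f inj x k fᵏx<x with isCycleMin f x in isMin
... | false = refl
... | true with iter-mod-cycLen f inj x k
...   | j , j<ℓ , fʲx≡fᵏx = ⊥-elim (<⇒≱ fᵏx<x (subst (λ z → toℕ x ≤ toℕ z) fʲx≡fᵏx x≤fʲx))
  where x≤fʲx = ≤ᵇ≡true⇒≤ _ _ (all-applyUpTo⁻ (λ j → toℕ x ≤ᵇ toℕ (iter f j x)) id _ j isMin j<ℓ)

module _ {N n} {f : Fin N → Fin N} {g : Fin n → Fin n} (injf : IsInjective f) (injg : IsInjective g)
         {ι : Fin n → Fin N} (injι : IsInjective ι) {y : Fin n}
         (orbit : ∀ k → iter f k (ι y) ≡ ι (iter g k y)) where

  cycLen-embed : cycLen f (ι y) ≡ cycLen g y
  cycLen-embed = cycLen-unique f injf (ι y) (cycLenPred g y)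
    (trans (orbit (cycLen g y)) (cong ι (iter-cycLen g injg y)))
    (λ k k<ℓ fᵏ⁺¹≡ → iter-below-cycLen g injg y k (s≤s k<ℓ) (injι _ _ (trans (sym (orbit (suc k))) fᵏ⁺¹≡)))

  isCycleMin-embed : (∀ a b → (toℕ (ι a) ≤ᵇ toℕ (ι b)) ≡ (toℕ a ≤ᵇ toℕ b)) → isCycleMin f (ι y) ≡ isCycleMin g y
  isCycleMin-embed mono = trans (cong (λ ℓ → all (λ j → toℕ (ι y) ≤ᵇ toℕ (iter f j (ι y))) (upTo ℓ)) cycLen-embed)
    (all-cong (λ j → trans (cong (λ z → toℕ (ι y) ≤ᵇ toℕ z) (orbit j)) (mono y (iter g j y))) (upTo (cycLen g y)))


-- Cycle types of functions on Fin n

module _ {A : Set} where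

  filterᵇ-cong : {p q : A → Bool} → (∀ a → p a ≡ q a) → ∀ xs → filterᵇ p xs ≡ filterᵇ q xs
  filterᵇ-cong e [] = refl
  filterᵇ-cong {p} {q} e (x ∷ xs) with p x | q x | e x
  ... | true  | .true  | refl = cong (x ∷_) (filterᵇ-cong e xs)
  ... | false | .false | refl = filterᵇ-cong e xs

  takeWhileᵇ-cong : {p q : A → Bool} → (∀ a → p a ≡ q a) → ∀ xs → takeWhileᵇ p xs ≡ takeWhileᵇ q xs
  takeWhileᵇ-cong e [] = refl
  takeWhileᵇ-cong {p} {q} e (x ∷ xs) with p x | q x | e x
  ... | true  | .true  | refl = cong (x ∷_) (takeWhileᵇ-cong e xs)
  ... | false | .false | refl = refl

  filterᵇ-accept : (p : A → Bool) {x : A} (xs : List A) → p x ≡ true → filterᵇ p (x ∷ xs) ≡ x ∷ filterᵇ p xs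
  filterᵇ-accept p xs px rewrite px = refl

  filterᵇ-reject : (p : A → Bool) {x : A} (xs : List A) → p x ≡ false → filterᵇ p (x ∷ xs) ≡ filterᵇ p xs
  filterᵇ-reject p xs px rewrite px = refl

  filterᵇ-++ : (p : A → Bool) → ∀ xs ys → filterᵇ p (xs ++ ys) ≡ filterᵇ p xs ++ filterᵇ p ys
  filterᵇ-++ p = LP.filter-++ (T? ∘ p)

  filterᵇ-reverse : (p : A → Bool) → ∀ xs → filterᵇ p (reverse xs) ≡ reverse (filterᵇ p xs)
  filterᵇ-reverse p [] = refl
  filterᵇ-reverse p (x ∷ xs) = begin
    filterᵇ p (reverse (x ∷ xs))                  ≡⟨ cong (filterᵇ p) (LP.unfold-reverse x xs) ⟩
    filterᵇ p (reverse xs ∷ʳ x)                   ≡⟨ filterᵇ-++ p (reverse xs) L.[ x ] ⟩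
    filterᵇ p (reverse xs) ++ filterᵇ p L.[ x ]   ≡⟨ cong (_++ filterᵇ p L.[ x ]) (filterᵇ-reverse p xs) ⟩
    reverse (filterᵇ p xs) ++ filterᵇ p L.[ x ]   ≡⟨ lastStep ⟩
    reverse (filterᵇ p (x ∷ xs))                  ∎
    where
    open ≡-Reasoning
    lastStep : reverse (filterᵇ p xs) ++ filterᵇ p L.[ x ] ≡ reverse (filterᵇ p (x ∷ xs))
    lastStep with p x
    ... | true  = sym (LP.unfold-reverse x (filterᵇ p xs))
    ... | false = LP.++-identityʳ _

filterᵇ-map : ∀ {A B : Set} (p : B → Bool) (h : A → B) xs → filterᵇ p (map h xs) ≡ map h (filterᵇ (p ∘ h) xs)
filterᵇ-map p h [] = refl
filterᵇ-map p h (x ∷ xs) with p (h x)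
... | true  = cong (h x ∷_) (filterᵇ-map p h xs)
... | false = filterᵇ-map p h xs

allFin-suc : ∀ n → allFin (suc n) ≡ F.zero ∷ map F.suc (allFin n)
allFin-suc n = cong (F.zero ∷_) (sym (LP.map-tabulate id F.suc))

filterᵇ-allFin-punchIn : ∀ n (p : Fin (suc n) → Bool) (a : Fin (suc n)) → p a ≡ false →
  filterᵇ p (allFin (suc n)) ≡ map (F.punchIn a) (filterᵇ (p ∘ F.punchIn a) (allFin n))
filterᵇ-allFin-punchIn n p F.zero pa = begin
  filterᵇ p (allFin (suc n))                  ≡⟨ cong (filterᵇ p) (allFin-suc n) ⟩
  filterᵇ p (F.zero ∷ map F.suc (allFin n))   ≡⟨ filterᵇ-reject p _ pa ⟩
  filterᵇ p (map F.suc (allFin n))            ≡⟨ filterᵇ-map p F.suc (allFin n) ⟩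
  map F.suc (filterᵇ (p ∘ F.suc) (allFin n))  ∎
  where open ≡-Reasoning
filterᵇ-allFin-punchIn (suc n) p (F.suc a) pa = begin
  filterᵇ p (allFin (suc (suc n)))
    ≡⟨ cong (filterᵇ p) (allFin-suc (suc n)) ⟩
  filterᵇ p (F.zero ∷ map F.suc (allFin (suc n)))
    ≡⟨ headStep ⟩
  map ι (filterᵇ (p ∘ ι) (F.zero ∷ map F.suc (allFin n)))
    ≡⟨ cong (map ι ∘ filterᵇ (p ∘ ι)) (sym (allFin-suc n)) ⟩
  map ι (filterᵇ (p ∘ ι) (allFin (suc n))) ∎
  where
  open ≡-Reasoning
  ι = F.punchIn (F.suc a)
  tailStep : filterᵇ p (map F.suc (allFin (suc n))) ≡ map ι (filterᵇ (p ∘ ι) (map F.suc (allFin n)))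
  tailStep = begin
    filterᵇ p (map F.suc (allFin (suc n)))
      ≡⟨ filterᵇ-map p F.suc (allFin (suc n)) ⟩
    map F.suc (filterᵇ (p ∘ F.suc) (allFin (suc n)))
      ≡⟨ cong (map F.suc) (filterᵇ-allFin-punchIn n (p ∘ F.suc) a pa) ⟩
    map F.suc (map (F.punchIn a) (filterᵇ (p ∘ ι ∘ F.suc) (allFin n)))
      ≡⟨ sym (LP.map-∘ (filterᵇ (p ∘ ι ∘ F.suc) (allFin n))) ⟩
    map (ι ∘ F.suc) (filterᵇ (p ∘ ι ∘ F.suc) (allFin n))
      ≡⟨ LP.map-∘ (filterᵇ (p ∘ ι ∘ F.suc) (allFin n)) ⟩
    map ι (map F.suc (filterᵇ (p ∘ ι ∘ F.suc) (allFin n)))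
      ≡⟨ cong (map ι) (sym (filterᵇ-map (p ∘ ι) F.suc (allFin n))) ⟩
    map ι (filterᵇ (p ∘ ι) (map F.suc (allFin n))) ∎
  headStep : filterᵇ p (F.zero ∷ map F.suc (allFin (suc n))) ≡ map ι (filterᵇ (p ∘ ι) (F.zero ∷ map F.suc (allFin n)))
  headStep with p F.zero
  ... | true  = cong (F.zero ∷_) tailStep
  ... | false = tailStep

-- cycC on functions rather than vectors: cycC σ is definitionally cycType (V.lookup σ).
cycType : ∀ {n} → (Fin n → Fin n) → List ℕ
cycType {n} f = map (cycLen f) (filterᵇ (isCycleMin f) (reverse (allFin n)))

module _ {n} {f g : Fin n → Fin n} (f≗g : ∀ x → f x ≡ g x) where

  cycLen-cong : ∀ x → cycLen f x ≡ cycLen g x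
  cycLen-cong x = cong (suc ∘ length) (takeWhileᵇ-cong (λ k → cong (λ z → not (does (z F.≟ x))) (iter-cong f≗g (suc k) x)) (upTo n))

  isCycleMin-cong : ∀ x → isCycleMin f x ≡ isCycleMin g x
  isCycleMin-cong x = trans (cong (λ ℓ → all (λ j → toℕ x ≤ᵇ toℕ (iter f j x)) (upTo ℓ)) (cycLen-cong x))
     (all-cong (λ j → cong (λ z → toℕ x ≤ᵇ toℕ z) (iter-cong f≗g j x)) (upTo (cycLen g x)))

  cycType-cong : cycType f ≡ cycType g
  cycType-cong = trans (cong (map (cycLen f)) (filterᵇ-cong isCycleMin-cong (reverse (allFin n))))
                       (LP.map-cong cycLen-cong (filterᵇ (isCycleMin g) (reverse (allFin n))))

module _ {n} {f : Fin (suc n) → Fin (suc n)} {g : Fin n → Fin n} (injf : IsInjective f) (injg : IsInjective g)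
  (f0≡0 : f F.zero ≡ F.zero) (f∘suc≗suc∘g : ∀ x → f (F.suc x) ≡ F.suc (g x)) where
  open ≡-Reasoning

  private
    orbit : ∀ y k → iter f k (F.suc y) ≡ F.suc (iter g k y)
    orbit y zero    = refl
    orbit y (suc k) = trans (cong f (orbit y k)) (f∘suc≗suc∘g _)

    suc-mono : ∀ a b → (toℕ (F.suc {n} a) ≤ᵇ toℕ (F.suc {n} b)) ≡ (toℕ a ≤ᵇ toℕ b)
    suc-mono a b = ≤ᵇ-cong _ _ (toℕ a) (toℕ b) ≤-pred s≤s

    R = reverse (allFin n)

    cycType-suc : map (cycLen f) (filterᵇ (isCycleMin f) (map F.suc R)) ≡ cycType g
    cycType-suc = begin
      map (cycLen f) (filterᵇ (isCycleMin f) (map F.suc R))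
        ≡⟨ cong (map (cycLen f)) (filterᵇ-map (isCycleMin f) F.suc R) ⟩
      map (cycLen f) (map F.suc (filterᵇ (isCycleMin f ∘ F.suc) R))
        ≡⟨ sym (LP.map-∘ (filterᵇ (isCycleMin f ∘ F.suc) R)) ⟩
      map (cycLen f ∘ F.suc) (filterᵇ (isCycleMin f ∘ F.suc) R)
        ≡⟨ LP.map-cong (λ y → cycLen-embed injf injg (λ _ _ → FP.suc-injective) (orbit y)) _ ⟩
      map (cycLen g) (filterᵇ (isCycleMin f ∘ F.suc) R)
        ≡⟨ cong (map (cycLen g)) (filterᵇ-cong (λ y → isCycleMin-embed injf injg (λ _ _ → FP.suc-injective) (orbit y) suc-mono) R) ⟩
      cycType g ∎

  cycType-fixesZero : cycType f ≡ cycType g ∷ʳ 1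
  cycType-fixesZero = begin
    map (cycLen f) (filterᵇ (isCycleMin f) (reverse (allFin (suc n))))
      ≡⟨ cong (map (cycLen f) ∘ filterᵇ (isCycleMin f) ∘ reverse) (allFin-suc n) ⟩
    map (cycLen f) (filterᵇ (isCycleMin f) (reverse (F.zero ∷ map F.suc (allFin n))))
      ≡⟨ cong (map (cycLen f) ∘ filterᵇ (isCycleMin f)) (trans (LP.unfold-reverse F.zero (map F.suc (allFin n))) (cong (_∷ʳ F.zero) (sym (LP.reverse-map F.suc (allFin n))))) ⟩
    map (cycLen f) (filterᵇ (isCycleMin f) (map F.suc R ∷ʳ F.zero))
      ≡⟨ cong (map (cycLen f)) (filterᵇ-++ (isCycleMin f) (map F.suc R) L.[ F.zero ]) ⟩
    map (cycLen f) (filterᵇ (isCycleMin f) (map F.suc R) ++ filterᵇ (isCycleMin f) L.[ F.zero ])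
      ≡⟨ cong (λ l → map (cycLen f) (filterᵇ (isCycleMin f) (map F.suc R) ++ l)) (filterᵇ-accept (isCycleMin f) [] (isCycleMin-zero f)) ⟩
    map (cycLen f) (filterᵇ (isCycleMin f) (map F.suc R) ∷ʳ F.zero)
      ≡⟨ LP.map-++ (cycLen f) (filterᵇ (isCycleMin f) (map F.suc R)) L.[ F.zero ] ⟩
    map (cycLen f) (filterᵇ (isCycleMin f) (map F.suc R)) ∷ʳ cycLen f F.zero
      ≡⟨ cong₂ _∷ʳ_ cycType-suc (cycLen-unique f injf F.zero 0 f0≡0 (λ _ ())) ⟩
    cycType g ∷ʳ 1 ∎

-- f sends 0 to a = suc s, and g is f with a spliced out of the cycle of 0 (relabelled by ι = punchIn a).
-- Then the cycle of 0 grows by one and every other cycle is carried over by ι.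
module _ {m} {f : Fin (suc (suc m)) → Fin (suc (suc m))} {g : Fin (suc m) → Fin (suc m)}
  (injf : IsInjective f) (injg : IsInjective g) {s : Fin (suc m)}
  (f0≡a : f F.zero ≡ F.suc s)
  (ι∘g0≡fa : F.punchIn (F.suc s) (g F.zero) ≡ f (F.suc s))
  (ι∘g∘suc≗f∘ι∘suc : ∀ y → F.punchIn (F.suc s) (g (F.suc y)) ≡ f (F.punchIn (F.suc s) (F.suc y))) where
  open ≡-Reasoning

  private
    ι : Fin (suc m) → Fin (suc (suc m))
    ι = F.punchIn (F.suc s)

    ι⁻¹0 : ∀ y → ι y ≡ F.zero → y ≡ F.zero
    ι⁻¹0 F.zero _ = refl

    ι-injective : IsInjective ι
    ι-injective = FP.punchIn-injective (F.suc s)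

    f∘ι≗ι∘g : ∀ y → y ≢ F.zero → f (ι y) ≡ ι (g y)
    f∘ι≗ι∘g F.zero    y≢0 = ⊥-elim (y≢0 refl)
    f∘ι≗ι∘g (F.suc y) _   = sym (ι∘g∘suc≗f∘ι∘suc y)

    ι-mono : ∀ a b → (toℕ (ι a) ≤ᵇ toℕ (ι b)) ≡ (toℕ a ≤ᵇ toℕ b)
    ι-mono a b = ≤ᵇ-cong _ _ (toℕ a) (toℕ b) (FP.punchIn-cancel-≤ (F.suc s) a b) (FP.punchIn-mono-≤ (F.suc s) a b)

    orbit0 : ∀ k → (∀ j → j < k → iter g (suc j) F.zero ≢ F.zero) → iter f (suc (suc k)) F.zero ≡ ι (iter g (suc k) F.zero)
    orbit0 zero    _ = trans (cong f f0≡a) (sym ι∘g0≡fa)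
    orbit0 (suc k) h = trans (cong f (orbit0 k (λ j j<k → h j (m≤n⇒m≤1+n j<k)))) (f∘ι≗ι∘g _ (h k (n<1+n k)))

    g-below-cycLen : ∀ {ℓ} → cycLen g F.zero ≡ suc ℓ → ∀ j → j < ℓ → iter g (suc j) F.zero ≢ F.zero
    g-below-cycLen ℓ≡ j j<ℓ = iter-below-cycLen g injg F.zero j (subst (suc j <_) (sym ℓ≡) (s≤s j<ℓ))

    orbit : ∀ y → (∀ k → iter g k y ≢ F.zero) → ∀ k → iter f k (ι y) ≡ ι (iter g k y)
    orbit y avoids0 zero    = refl
    orbit y avoids0 (suc k) = trans (cong f (orbit y avoids0 k)) (f∘ι≗ι∘g _ (avoids0 k))

    reaches0 : ∀ k y → iter g k y ≡ F.zero → Σ ℕ λ k′ → iter f k′ (ι y) ≡ F.zero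
    reaches0 zero y gᵏy≡0 = 0 , cong ι gᵏy≡0
    reaches0 (suc k) y gᵏy≡0 with y F.≟ F.zero
    ... | yes y≡0 = 0 , cong ι y≡0
    ... | no  y≢0 with reaches0 k (g y) (trans (sym (iter-sucʳ g k y)) gᵏy≡0)
    ...   | k′ , e = suc k′ , trans (iter-sucʳ f k′ (ι y)) (trans (cong (iter f k′) (f∘ι≗ι∘g y y≢0)) e)

    avoids0 : ∀ y → ¬ (Σ (Fin (suc m)) λ i → iter g (toℕ i) y ≡ F.zero) → ∀ k → iter g k y ≢ F.zero
    avoids0 y never k gᵏy≡0 with iter-mod-cycLen g injg y k
    ... | j , j<ℓ , e = never (F.fromℕ< j<m+1 , trans (cong (λ z → iter g z y) (FP.toℕ-fromℕ< j<m+1)) (trans e gᵏy≡0))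
      where j<m+1 = ≤-trans j<ℓ (cycLen≤n g injg y)

    0<toℕ : ∀ (x : Fin (suc m)) → x ≢ F.zero → 0 < toℕ x
    0<toℕ F.zero    x≢0 = ⊥-elim (x≢0 refl)
    0<toℕ (F.suc x) _   = s≤s z≤n

  cycLen-f0 : cycLen f F.zero ≡ suc (cycLen g F.zero)
  cycLen-f0 = cycLen-unique f injf F.zero (cycLen g F.zero) returns minimal
    where
    ℓ = cycLenPred g F.zero
    returns : iter f (suc (suc ℓ)) F.zero ≡ F.zero
    returns = trans (orbit0 ℓ (g-below-cycLen refl)) (cong ι (iter-cycLen g injg F.zero))
    minimal : ∀ k → k < suc ℓ → iter f (suc k) F.zero ≢ F.zero
    minimal zero    _         e = case trans (sym f0≡a) e of λ ()
    minimal (suc k) (s≤s k<ℓ) e = g-below-cycLen refl k k<ℓ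
      (ι⁻¹0 _ (trans (sym (orbit0 k (λ j j<k → g-below-cycLen refl j (<-trans j<k k<ℓ)))) e))

  private
    isCycleMin-a : isCycleMin f (F.suc s) ≡ false
    isCycleMin-a = isCycleMin-false f injf (F.suc s) (cycLen g F.zero) (subst (λ z → toℕ z < toℕ (F.suc s)) (sym fᵏa≡0) (s≤s z≤n))
      where
      fᵏa≡0 : iter f (cycLen g F.zero) (F.suc s) ≡ F.zero
      fᵏa≡0 = begin
        iter f (cycLen g F.zero) (F.suc s)   ≡⟨ cong (iter f (cycLen g F.zero)) (sym f0≡a) ⟩
        iter f (cycLen g F.zero) (f F.zero)  ≡⟨ sym (iter-sucʳ f (cycLen g F.zero) F.zero) ⟩
        iter f (suc (cycLen g F.zero)) F.zero ≡⟨ cong (λ z → iter f z F.zero) (sym cycLen-f0) ⟩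
        iter f (cycLen f F.zero) F.zero      ≡⟨ iter-cycLen f injf F.zero ⟩
        F.zero ∎

    isCycleMin-ι : ∀ y → isCycleMin f (ι y) ≡ isCycleMin g y
    isCycleMin-ι F.zero = trans (isCycleMin-zero f) (sym (isCycleMin-zero g))
    isCycleMin-ι (F.suc y) with FP.any? (λ i → iter g (toℕ i) (F.suc y) F.≟ F.zero)
    ... | yes (i , gⁱy≡0) = trans
          (isCycleMin-false f injf (ι (F.suc y)) (proj₁ (reaches0 (toℕ i) (F.suc y) gⁱy≡0))
             (subst (λ z → toℕ z < toℕ (ι (F.suc y))) (sym (proj₂ (reaches0 (toℕ i) (F.suc y) gⁱy≡0))) (s≤s z≤n)))
          (sym (isCycleMin-false g injg (F.suc y) (toℕ i) (subst (λ z → toℕ z < suc (toℕ y)) (sym gⁱy≡0) (s≤s z≤n))))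
    ... | no never = isCycleMin-embed injf injg ι-injective (orbit (F.suc y) (avoids0 (F.suc y) never)) ι-mono

    otherMins : List (Fin (suc m))
    otherMins = filterᵇ (isCycleMin g) (map F.suc (allFin m))

    cycLen-ι : ∀ {x} → x ∈ otherMins → cycLen f (ι x) ≡ cycLen g x
    cycLen-ι {x} x∈ = cycLen-embed injf injg ι-injective (orbit x avoids)
      where
      x∈suc = proj₁ (∈-filter⁻ (T? ∘ isCycleMin g) {xs = map F.suc (allFin m)} x∈)
      isMin = proj₂ (∈-filter⁻ (T? ∘ isCycleMin g) {xs = map F.suc (allFin m)} x∈)
      x≢0 : x ≢ F.zero
      x≢0 x≡0 with ∈-map⁻ F.suc x∈suc
      ... | _ , _ , x≡suc = case trans (sym x≡0) x≡suc of λ ()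
      avoids : ∀ k → iter g k x ≢ F.zero
      avoids k gᵏx≡0 = subst T (isCycleMin-false g injg x k (subst (λ z → toℕ z < toℕ x) (sym gᵏx≡0) (0<toℕ x x≢0))) isMin

    filter-g : filterᵇ (isCycleMin g) (allFin (suc m)) ≡ F.zero ∷ otherMins
    filter-g = trans (cong (filterᵇ (isCycleMin g)) (allFin-suc m)) (filterᵇ-accept (isCycleMin g) _ (isCycleMin-zero g))

    Γ : List ℕ
    Γ = map (cycLen g) (reverse otherMins)

    otherCycles : map (cycLen f ∘ ι) (reverse otherMins) ≡ Γ
    otherCycles = begin
      map (cycLen f ∘ ι) (reverse otherMins)   ≡⟨ LP.reverse-map (cycLen f ∘ ι) otherMins ⟩
      reverse (map (cycLen f ∘ ι) otherMins)   ≡⟨ cong reverse (LP.map-cong-local (All.tabulate cycLen-ι)) ⟩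
      reverse (map (cycLen g) otherMins)       ≡⟨ sym (LP.reverse-map (cycLen g) otherMins) ⟩
      Γ ∎

    cycType-g : cycType g ≡ Γ ∷ʳ cycLen g F.zero
    cycType-g = begin
      map (cycLen g) (filterᵇ (isCycleMin g) (reverse (allFin (suc m))))
        ≡⟨ cong (map (cycLen g)) (trans (filterᵇ-reverse (isCycleMin g) (allFin (suc m))) (cong reverse filter-g)) ⟩
      map (cycLen g) (reverse (F.zero ∷ otherMins))
        ≡⟨ cong (map (cycLen g)) (LP.unfold-reverse F.zero otherMins) ⟩
      map (cycLen g) (reverse otherMins ∷ʳ F.zero)
        ≡⟨ LP.map-++ (cycLen g) (reverse otherMins) L.[ F.zero ] ⟩
      Γ ∷ʳ cycLen g F.zero ∎

    cycType-f : cycType f ≡ Γ ∷ʳ suc (cycLen g F.zero)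
    cycType-f = begin
      map (cycLen f) (filterᵇ (isCycleMin f) (reverse (allFin (suc (suc m)))))
        ≡⟨ cong (map (cycLen f)) (filterᵇ-reverse (isCycleMin f) (allFin (suc (suc m)))) ⟩
      map (cycLen f) (reverse (filterᵇ (isCycleMin f) (allFin (suc (suc m)))))
        ≡⟨ cong (map (cycLen f) ∘ reverse) (filterᵇ-allFin-punchIn (suc m) (isCycleMin f) (F.suc s) isCycleMin-a) ⟩
      map (cycLen f) (reverse (map ι (filterᵇ (isCycleMin f ∘ ι) (allFin (suc m)))))
        ≡⟨ cong (map (cycLen f) ∘ reverse ∘ map ι) (trans (filterᵇ-cong isCycleMin-ι (allFin (suc m))) filter-g) ⟩
      map (cycLen f) (reverse (map ι (F.zero ∷ otherMins)))
        ≡⟨ cong (map (cycLen f)) (sym (LP.reverse-map ι (F.zero ∷ otherMins))) ⟩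
      map (cycLen f) (map ι (reverse (F.zero ∷ otherMins)))
        ≡⟨ sym (LP.map-∘ (reverse (F.zero ∷ otherMins))) ⟩
      map (cycLen f ∘ ι) (reverse (F.zero ∷ otherMins))
        ≡⟨ cong (map (cycLen f ∘ ι)) (LP.unfold-reverse F.zero otherMins) ⟩
      map (cycLen f ∘ ι) (reverse otherMins ∷ʳ F.zero)
        ≡⟨ LP.map-++ (cycLen f ∘ ι) (reverse otherMins) L.[ F.zero ] ⟩
      map (cycLen f ∘ ι) (reverse otherMins) ∷ʳ cycLen f F.zero
        ≡⟨ cong₂ _∷ʳ_ otherCycles cycLen-f0 ⟩
      Γ ∷ʳ suc (cycLen g F.zero) ∎

  cycType-splice : Σ (List ℕ) λ γ → cycType g ≡ γ ∷ʳ cycLen g F.zero × cycType f ≡ γ ∷ʳ suc (cycLen g F.zero)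
  cycType-splice = Γ , cycType-g , cycType-f


-- Permutations sorted by their last cycle

punchOutOr : ∀ {n} → Fin (suc n) → Fin (suc n) → Fin n → Fin n
punchOutOr a v d with a F.≟ v
... | yes _   = d
... | no a≢v = F.punchOut a≢v

punchIn-punchOutOr : ∀ {n} {a v : Fin (suc n)} d → a ≢ v → F.punchIn a (punchOutOr a v d) ≡ v
punchIn-punchOutOr {a = a} {v} d a≢v with a F.≟ v
... | yes a≡v  = ⊥-elim (a≢v a≡v)
... | no  a≢v′ = FP.punchIn-punchOut a≢v′

punchOutOr-punchIn : ∀ {n} (a : Fin (suc n)) y d → punchOutOr a (F.punchIn a y) d ≡ y
punchOutOr-punchIn a y d with a F.≟ F.punchIn a y
... | yes a≡ = ⊥-elim (FP.punchInᵢ≢i a y (sym a≡))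
... | no  _  = trans (FP.punchOut-cong a refl) (FP.punchOut-punchIn a)

punchOutOr-self : ∀ {n} (a : Fin (suc n)) d → punchOutOr a a d ≡ d
punchOutOr-self a d with a F.≟ a
... | yes _   = refl
... | no a≢a = ⊥-elim (a≢a refl)

dropZero : ∀ {n} → (Fin (suc n) → Fin (suc n)) → Fin n → Fin n
dropZero f x = punchOutOr F.zero (f (F.suc x)) x

addZero : ∀ {n} → (Fin n → Fin n) → Fin (suc n) → Fin (suc n)
addZero g F.zero    = F.zero
addZero g (F.suc x) = F.suc (g x)

module _ {n} {f : Fin (suc n) → Fin (suc n)} (injf : IsInjective f) (f0≡0 : f F.zero ≡ F.zero) where

  f∘suc≗suc∘dropZero : ∀ x → f (F.suc x) ≡ F.suc (dropZero f x)
  f∘suc≗suc∘dropZero x = sym (punchIn-punchOutOr x (λ 0≡f[1+x] → case injf _ _ (trans f0≡0 0≡f[1+x]) of λ ()))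

  dropZero-injective : IsInjective (dropZero f)
  dropZero-injective a b e = FP.suc-injective (injf _ _ (trans (f∘suc≗suc∘dropZero a) (trans (cong F.suc e) (sym (f∘suc≗suc∘dropZero b)))))

  addZero-dropZero : ∀ x → addZero (dropZero f) x ≡ f x
  addZero-dropZero F.zero    = sym f0≡0
  addZero-dropZero (F.suc x) = sym (f∘suc≗suc∘dropZero x)

addZero-injective : ∀ {n} {g : Fin n → Fin n} → IsInjective g → IsInjective (addZero g)
addZero-injective injg F.zero    F.zero    _ = refl
addZero-injective injg (F.suc a) (F.suc b) e = cong F.suc (injg _ _ (FP.suc-injective e))

dropZero-addZero : ∀ {n} (g : Fin n → Fin n) x → dropZero (addZero g) x ≡ g x
dropZero-addZero g x = punchOutOr-punchIn F.zero (g x) x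

-- Removing a = suc s from the cycle of 0 (for f with f 0 = a), and putting it back.
module _ {m} (s : Fin (suc m)) where

  private
    ι : Fin (suc m) → Fin (suc (suc m))
    ι = F.punchIn (F.suc s)

  spliceOut : (Fin (suc (suc m)) → Fin (suc (suc m))) → Fin (suc m) → Fin (suc m)
  spliceOut f F.zero    = punchOutOr (F.suc s) (f (F.suc s)) F.zero
  spliceOut f (F.suc y) = punchOutOr (F.suc s) (f (ι (F.suc y))) (F.suc y)

  spliceIn : (Fin (suc m) → Fin (suc m)) → Fin (suc (suc m)) → Fin (suc (suc m))
  spliceIn g F.zero    = F.suc s
  spliceIn g (F.suc x) = ι (g (punchOutOr (F.suc s) (F.suc x) F.zero))

  private
    -- ι (spliceOut f y) = f (κ y): the point 0 of the smaller set stands for a.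
    κ : Fin (suc m) → Fin (suc (suc m))
    κ F.zero    = F.suc s
    κ (F.suc y) = ι (F.suc y)

    κ-injective : IsInjective κ
    κ-injective F.zero    F.zero    _ = refl
    κ-injective F.zero    (F.suc b) e = ⊥-elim (FP.punchInᵢ≢i (F.suc s) (F.suc b) (sym e))
    κ-injective (F.suc a) F.zero    e = ⊥-elim (FP.punchInᵢ≢i (F.suc s) (F.suc a) e)
    κ-injective (F.suc a) (F.suc b) e = FP.punchIn-injective (F.suc s) _ _ e

    κ-punchOutOr : ∀ x → κ (punchOutOr (F.suc s) (F.suc x) F.zero) ≡ F.suc x
    κ-punchOutOr x with F.suc s F.≟ F.suc x
    ... | yes a≡ = a≡
    ... | no a≢ = lemma (F.punchOut a≢) (FP.punchIn-punchOut a≢)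
      where
      lemma : ∀ y → ι y ≡ F.suc x → κ y ≡ F.suc x
      lemma (F.suc y) e = e

  module _ {f : Fin (suc (suc m)) → Fin (suc (suc m))} (injf : IsInjective f) (f0≡a : f F.zero ≡ F.suc s) where

    private
      a≢f∘κ : ∀ y → F.suc s ≢ f (κ y)
      a≢f∘κ F.zero    a≡ = case injf _ _ (trans f0≡a a≡) of λ ()
      a≢f∘κ (F.suc y) a≡ = case injf _ _ (trans f0≡a a≡) of λ ()

    ι∘spliceOut≗f∘κ : ∀ y → ι (spliceOut f y) ≡ f (κ y)
    ι∘spliceOut≗f∘κ F.zero    = punchIn-punchOutOr F.zero (a≢f∘κ F.zero)
    ι∘spliceOut≗f∘κ (F.suc y) = punchIn-punchOutOr (F.suc y) (a≢f∘κ (F.suc y))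


    spliceOut-injective : IsInjective (spliceOut f)
    spliceOut-injective a b e = κ-injective a b (injf _ _ (trans (sym (ι∘spliceOut≗f∘κ a)) (trans (cong ι e) (ι∘spliceOut≗f∘κ b))))

    spliceIn-spliceOut : ∀ x → spliceIn (spliceOut f) x ≡ f x
    spliceIn-spliceOut F.zero    = sym f0≡a
    spliceIn-spliceOut (F.suc x) = trans (ι∘spliceOut≗f∘κ (punchOutOr (F.suc s) (F.suc x) F.zero)) (cong f (κ-punchOutOr x))

  spliceIn-injective : ∀ {g} → IsInjective g → IsInjective (spliceIn g)
  spliceIn-injective injg F.zero    F.zero    _ = refl
  spliceIn-injective injg F.zero    (F.suc b) e = ⊥-elim (FP.punchInᵢ≢i (F.suc s) _ (sym e))
  spliceIn-injective injg (F.suc a) F.zero    e = ⊥-elim (FP.punchInᵢ≢i (F.suc s) _ e)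
  spliceIn-injective injg (F.suc a) (F.suc b) e =
    trans (sym (κ-punchOutOr a)) (trans (cong κ (injg _ _ (FP.punchIn-injective (F.suc s) _ _ e))) (κ-punchOutOr b))

  spliceOut-spliceIn : ∀ g y → spliceOut (spliceIn g) y ≡ g y
  spliceOut-spliceIn g F.zero =
    trans (cong (λ z → punchOutOr (F.suc s) (ι (g z)) F.zero) (punchOutOr-self (F.suc s) F.zero)) (punchOutOr-punchIn (F.suc s) _ _)
  spliceOut-spliceIn g (F.suc y) =
    trans (cong (λ z → punchOutOr (F.suc s) (ι (g z)) (F.suc y)) (punchOutOr-punchIn (F.suc s) (F.suc y) F.zero)) (punchOutOr-punchIn (F.suc s) _ _)

vec-ext : ∀ {A : Set} {n} {v w : Vec A n} → (∀ i → V.lookup v i ≡ V.lookup w i) → v ≡ w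
vec-ext {v = v} {w} v≗w = trans (sym (VP.tabulate∘lookup v)) (trans (VP.tabulate-cong v≗w) (VP.tabulate∘lookup w))

Respects≗ : ∀ {n k} → ((Fin n → Fin n) → Fin k → Fin k) → Set
Respects≗ D = ∀ {h h′} → (∀ i → h i ≡ h′ i) → ∀ i → D h i ≡ D h′ i

tabulate-inverse : ∀ {n k} {D : (Fin n → Fin n) → Fin k → Fin k} → Respects≗ D →
  ∀ h {σ} → (∀ i → D h i ≡ V.lookup σ i) → V.tabulate (D (V.lookup (V.tabulate h))) ≡ σ
tabulate-inverse D-resp h D-h≗σ = vec-ext λ i →
  trans (VP.lookup∘tabulate _ i) (trans (D-resp (VP.lookup∘tabulate h) i) (D-h≗σ i))

dropZero-resp : ∀ {n} → Respects≗ (dropZero {n})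
dropZero-resp h≗h′ i = cong (λ v → punchOutOr F.zero v i) (h≗h′ (F.suc i))

addZero-resp : ∀ {n} → Respects≗ (addZero {n})
addZero-resp h≗h′ F.zero    = refl
addZero-resp h≗h′ (F.suc i) = cong F.suc (h≗h′ i)

spliceOut-resp : ∀ {m} (s : Fin (suc m)) → Respects≗ (spliceOut s)
spliceOut-resp s h≗h′ F.zero    = cong (λ v → punchOutOr (F.suc s) v F.zero) (h≗h′ _)
spliceOut-resp s h≗h′ (F.suc y) = cong (λ v → punchOutOr (F.suc s) v (F.suc y)) (h≗h′ _)

spliceIn-resp : ∀ {m} (s : Fin (suc m)) → Respects≗ (spliceIn s)
spliceIn-resp s h≗h′ F.zero    = refl
spliceIn-resp s h≗h′ (F.suc x) = cong (F.punchIn (F.suc s)) (h≗h′ _)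

IsPerm-tabulate : ∀ {n} {g : Fin n → Fin n} → IsInjective g → IsPerm n (V.tabulate g)
IsPerm-tabulate {g = g} injg a b e = injg a b (trans (sym (VP.lookup∘tabulate g a)) (trans e (VP.lookup∘tabulate g b)))

Perm : ℕ → Set
Perm n = Sub (Vec (Fin n) n) (IsPerm n)

HasLastCycle : ∀ {n} → ℕ → Vec (Fin n) n → Set
HasLastCycle {n} b σ = IsPerm n σ × Σ (List ℕ) λ γ → cycC σ ≡ γ ∷ʳ b

-- Cycles are listed by decreasing minimum, so the last cycle of cycC σ is the cycle of 0.
PermLastCycle : ℕ → ℕ → Set
PermLastCycle n b = Sub (Vec (Fin n) n) (HasLastCycle b)

dropZeroᵛ : ∀ {n} → Vec (Fin (suc n)) (suc n) → Vec (Fin n) n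
dropZeroᵛ σ = V.tabulate (dropZero (V.lookup σ))

spliceOutᵛ : ∀ {m} → Fin (suc m) → Vec (Fin (suc (suc m))) (suc (suc m)) → Vec (Fin (suc m)) (suc m)
spliceOutᵛ s σ = V.tabulate (spliceOut s (V.lookup σ))

cycC-fixesZero : ∀ {n} (σ : Vec (Fin (suc n)) (suc n)) → IsPerm (suc n) σ → V.lookup σ F.zero ≡ F.zero → cycC σ ≡ cycC (dropZeroᵛ σ) ∷ʳ 1
cycC-fixesZero σ ip σ0≡0 = cycType-fixesZero ip (IsPerm-tabulate (dropZero-injective ip σ0≡0)) σ0≡0
  (λ x → trans (f∘suc≗suc∘dropZero ip σ0≡0 x) (cong F.suc (sym (VP.lookup∘tabulate _ x))))

∷ʳ-shift⇔ : ∀ {xs ys γ′ : List ℕ} {ℓ} → xs ≡ γ′ ∷ʳ ℓ → ys ≡ γ′ ∷ʳ suc ℓ → ∀ γ c → (xs ≡ γ ∷ʳ c) ⇔ (ys ≡ γ ∷ʳ suc c)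
∷ʳ-shift⇔ {γ′ = γ′} xs≡ ys≡ γ c = mk⇔
  (λ e → case LP.∷ʳ-injective γ′ γ (trans (sym xs≡) e) of λ { (refl , refl) → ys≡ })
  (λ e → case LP.∷ʳ-injective γ′ γ (trans (sym ys≡) e) of λ { (refl , refl) → xs≡ })

module _ {m} (σ : Vec (Fin (suc (suc m))) (suc (suc m))) (ip : IsPerm _ σ) {s : Fin (suc m)} (σ0≡a : V.lookup σ F.zero ≡ F.suc s) where

  private
    g : Fin (suc m) → Fin (suc m)
    g = spliceOut s (V.lookup σ)

    splice : Σ (List ℕ) λ γ → cycType g ≡ γ ∷ʳ cycLen g F.zero × cycC σ ≡ γ ∷ʳ suc (cycLen g F.zero)
    splice = cycType-splice ip (spliceOut-injective s ip σ0≡a) σ0≡a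
      (ι∘spliceOut≗f∘κ s ip σ0≡a F.zero) (λ y → ι∘spliceOut≗f∘κ s ip σ0≡a (F.suc y))

  cycC-spliceOut : Σ (List ℕ) λ γ → Σ ℕ λ ℓ → cycC (spliceOutᵛ s σ) ≡ γ ∷ʳ suc ℓ × cycC σ ≡ γ ∷ʳ suc (suc ℓ)
  cycC-spliceOut = proj₁ splice , cycLenPred g F.zero , trans (cycType-cong (VP.lookup∘tabulate g)) (proj₁ (proj₂ splice)) , proj₂ (proj₂ splice)

  cycC-spliceOut⇔ : ∀ γ c → (cycC (spliceOutᵛ s σ) ≡ γ ∷ʳ c) ⇔ (cycC σ ≡ γ ∷ʳ suc c)
  cycC-spliceOut⇔ = ∷ʳ-shift⇔ (proj₁ (proj₂ (proj₂ cycC-spliceOut))) (proj₂ (proj₂ (proj₂ cycC-spliceOut)))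

lastCycle1⇒fixesZero : ∀ {m} (σ : Vec (Fin (suc m)) (suc m)) → HasLastCycle 1 σ → V.lookup σ F.zero ≡ F.zero
lastCycle1⇒fixesZero {zero} σ _ with V.lookup σ F.zero
... | F.zero = refl
lastCycle1⇒fixesZero {suc m} σ (ip , γ , e) with V.lookup σ F.zero in σ0≡
... | F.zero = refl
... | F.suc s = case LP.∷ʳ-injectiveʳ γ _ (trans (sym e) (proj₂ (proj₂ (proj₂ (cycC-spliceOut σ ip σ0≡))))) of λ ()

lastCycle≥2⇒movesZero : ∀ {m c} (σ : Vec (Fin (suc m)) (suc m)) → HasLastCycle (suc (suc c)) σ → V.lookup σ F.zero ≢ F.zero
lastCycle≥2⇒movesZero σ (ip , γ , e) σ0≡0 = case LP.∷ʳ-injectiveʳ γ _ (trans (sym e) (cycC-fixesZero σ ip σ0≡0)) of λ ()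

decEqPerm : ∀ {n} → DecidableEquality (Vec (Fin n) n)
decEqPerm = VP.≡-dec FP._≟_

record LastCycleSplitting (n b k : ℕ) (A : Set) : Set where
  field
    iso        : PermLastCycle n b ↔ (A × Perm k)
    cycC-split : ∀ z → cycC (val z) ≡ cycC (val (proj₂ (Inverse.to iso z))) ∷ʳ b

dropZero↔ : ∀ m → LastCycleSplitting (suc m) 1 m (Fin 1)
dropZero↔ m = record { iso = mk↔ₛ′ to from to∘from from∘to ; cycC-split = split }
  where
  to : PermLastCycle (suc m) 1 → Fin 1 × Perm m
  to ⟨ σ , p ⟩ = F.zero , ⟨ dropZeroᵛ σ , IsPerm-tabulate (dropZero-injective (proj₁ p) (lastCycle1⇒fixesZero σ p)) ⟩
  dropZero-addZeroᵛ : ∀ τ → dropZeroᵛ (V.tabulate (addZero (V.lookup τ))) ≡ τ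
  dropZero-addZeroᵛ τ = tabulate-inverse dropZero-resp (addZero (V.lookup τ)) (dropZero-addZero (V.lookup τ))
  addZeroHasLast : ∀ τ → IsPerm m τ → HasLastCycle 1 (V.tabulate (addZero (V.lookup τ)))
  addZeroHasLast τ q = ip , cycC τ , trans (cycC-fixesZero (V.tabulate (addZero (V.lookup τ))) ip refl) (cong (λ v → cycC v ∷ʳ 1) (dropZero-addZeroᵛ τ))
    where ip = IsPerm-tabulate (addZero-injective q)
  from : Fin 1 × Perm m → PermLastCycle (suc m) 1
  from (_ , ⟨ τ , q ⟩) = ⟨ V.tabulate (addZero (V.lookup τ)) , addZeroHasLast τ q ⟩
  to∘from : ∀ w → to (from w) ≡ w
  to∘from (F.zero , ⟨ τ , q ⟩) = cong (F.zero ,_) (Sub≡ (dropZero-addZeroᵛ τ))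
  from∘to : ∀ z → from (to z) ≡ z
  from∘to ⟨ σ , p ⟩ = Sub≡ (irrEq decEqPerm (tabulate-inverse addZero-resp (dropZero (V.lookup σ)) (addZero-dropZero (proj₁ p) (lastCycle1⇒fixesZero σ p))))
  split : ∀ z → cycC (val z) ≡ cycC (val (proj₂ (to z))) ∷ʳ 1
  split ⟨ σ , p ⟩ = irrEq (LP.≡-dec Data.Nat._≟_) (cycC-fixesZero σ (proj₁ p) (lastCycle1⇒fixesZero σ p))

module _ (k c : ℕ) where

  private
    Big Small : Set
    Big   = Vec (Fin (suc (suc k))) (suc (suc k))
    Small = Vec (Fin (suc k)) (suc k)

    spliceOutHasLast : ∀ (σ : Big) → HasLastCycle (suc (suc c)) σ → ∀ s (σ0≡a : V.lookup σ F.zero ≡ F.suc s) → HasLastCycle (suc c) (spliceOutᵛ s σ)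
    spliceOutHasLast σ (ip , γ , e) s σ0≡a = IsPerm-tabulate (spliceOut-injective s ip σ0≡a) , γ , Equivalence.from (cycC-spliceOut⇔ σ ip σ0≡a γ (suc c)) e

    toAt : ∀ (σ : Big) → .(HasLastCycle (suc (suc c)) σ) → ∀ a → V.lookup σ F.zero ≡ a → Fin (suc k) × PermLastCycle (suc k) (suc c)
    toAt σ p F.zero    σ0≡0 = ⊥-elim-irr (lastCycle≥2⇒movesZero σ p σ0≡0)
    toAt σ p (F.suc s) σ0≡a = s , ⟨ spliceOutᵛ s σ , spliceOutHasLast σ p s σ0≡a ⟩

    to : PermLastCycle (suc (suc k)) (suc (suc c)) → Fin (suc k) × PermLastCycle (suc k) (suc c)
    to ⟨ σ , p ⟩ = toAt σ p (V.lookup σ F.zero) refl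

    spliceInᵛ : Fin (suc k) → Small → Big
    spliceInᵛ s τ = V.tabulate (spliceIn s (V.lookup τ))

    spliceOut-spliceInᵛ : ∀ s (τ : Small) → spliceOutᵛ s (spliceInᵛ s τ) ≡ τ
    spliceOut-spliceInᵛ s τ = tabulate-inverse (spliceOut-resp s) (spliceIn s (V.lookup τ)) (spliceOut-spliceIn s (V.lookup τ))

    spliceInHasLast : ∀ s (τ : Small) → HasLastCycle (suc c) τ → HasLastCycle (suc (suc c)) (spliceInᵛ s τ)
    spliceInHasLast s τ (q , γ , e) = ip , γ ,
      Equivalence.to (cycC-spliceOut⇔ (spliceInᵛ s τ) ip refl γ (suc c)) (trans (cong cycC (spliceOut-spliceInᵛ s τ)) e)
      where ip = IsPerm-tabulate (spliceIn-injective s q)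

    from : Fin (suc k) × PermLastCycle (suc k) (suc c) → PermLastCycle (suc (suc k)) (suc (suc c))
    from (s , ⟨ τ , q ⟩) = ⟨ spliceInᵛ s τ , spliceInHasLast s τ q ⟩

    to∘from : ∀ w → to (from w) ≡ w
    to∘from (s , ⟨ τ , q ⟩) = cong (s ,_) (Sub≡ (spliceOut-spliceInᵛ s τ))

    from∘toAt : ∀ (σ : Big) .(p : HasLastCycle (suc (suc c)) σ) a (σ0≡a : V.lookup σ F.zero ≡ a) → from (toAt σ p a σ0≡a) ≡ ⟨ σ , p ⟩
    from∘toAt σ p F.zero    σ0≡0 = ⊥-elim-irr (lastCycle≥2⇒movesZero σ p σ0≡0)
    from∘toAt σ p (F.suc s) σ0≡a = Sub≡ (irrEq decEqPerm (tabulate-inverse (spliceIn-resp s) (spliceOut s (V.lookup σ)) (spliceIn-spliceOut s (proj₁ p) σ0≡a)))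

    cycC-toAt : ∀ (σ : Big) .(p : HasLastCycle (suc (suc c)) σ) a (σ0≡a : V.lookup σ F.zero ≡ a) γ →
      cycC (val (proj₂ (toAt σ p a σ0≡a))) ≡ γ ∷ʳ suc c → cycC σ ≡ γ ∷ʳ suc (suc c)
    cycC-toAt σ p F.zero    σ0≡0 = ⊥-elim-irr (lastCycle≥2⇒movesZero σ p σ0≡0)
    cycC-toAt σ p (F.suc s) σ0≡a γ e = irrEq (LP.≡-dec Data.Nat._≟_) (Equivalence.to (cycC-spliceOut⇔ σ (proj₁ p) σ0≡a γ (suc c)) e)

  spliceOut↔ : PermLastCycle (suc (suc k)) (suc (suc c)) ↔ (Fin (suc k) × PermLastCycle (suc k) (suc c))
  spliceOut↔ = mk↔ₛ′ to from to∘from (λ { ⟨ σ , p ⟩ → from∘toAt σ p (V.lookup σ F.zero) refl })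

  cycC-spliceOut↔ : ∀ z γ → cycC (val (proj₂ (Inverse.to spliceOut↔ z))) ≡ γ ∷ʳ suc c → cycC (val z) ≡ γ ∷ʳ suc (suc c)
  cycC-spliceOut↔ ⟨ σ , p ⟩ = cycC-toAt σ p (V.lookup σ F.zero) refl

fallingFactorial : ℕ → ℕ → ℕ
fallingFactorial x zero    = 1
fallingFactorial x (suc k) = x * fallingFactorial (pred x) k

fallingFactorial-* : ∀ c m → fallingFactorial (c + m) c * m ! ≡ (c + m) !
fallingFactorial-* zero    m = +-identityʳ (m !)
fallingFactorial-* (suc c) m = trans (*-assoc (suc (c + m)) (fallingFactorial (c + m) c) (m !)) (cong (suc (c + m) *_) (fallingFactorial-* c m))

-- Choosing the c elements following 0 in its cycle one at a time.
lastCycle↔ : ∀ c m → LastCycleSplitting (suc (c + m)) (suc c) m (Fin (fallingFactorial (c + m) c))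
lastCycle↔ zero    m = dropZero↔ m
lastCycle↔ (suc c) m = record { iso = iso ; cycC-split = split }
  where
  module IH = LastCycleSplitting (lastCycle↔ c m)
  ×-assoc : ∀ {A B C : Set} → (A × (B × C)) ↔ ((A × B) × C)
  ×-assoc = mk↔ₛ′ (λ { (a , b , c) → (a , b) , c }) (λ { ((a , b) , c) → a , b , c }) (λ _ → refl) (λ _ → refl)
  iso = ↔-trans (spliceOut↔ (c + m) c) (↔-trans (↔-refl ×-↔ IH.iso) (↔-trans ×-assoc (↔-sym FP.*↔× ×-↔ ↔-refl)))
  split : ∀ z → cycC (val z) ≡ cycC (val (proj₂ (Inverse.to iso z))) ∷ʳ suc (suc c)
  split z = cycC-spliceOut↔ (c + m) c z _ (IH.cycC-split (proj₂ (Inverse.to (spliceOut↔ (c + m) c) z)))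

sum-∷ʳ : ∀ γ c → sum (γ ∷ʳ c) ≡ sum γ + c
sum-∷ʳ γ c = trans (SumP.sum-++ γ L.[ c ]) (cong (sum γ +_) (+-identityʳ c))

IsComposition-∷ʳ1 : ∀ {n γ} → IsComposition n γ → IsComposition (suc n) (γ ∷ʳ 1)
IsComposition-∷ʳ1 {n} {γ} (pos , sum≡) = AllP.++⁺ pos (s≤s z≤n ∷ []) , trans (sum-∷ʳ γ 1) (trans (+-comm _ 1) (cong suc sum≡))

IsComposition-∷ʳsuc : ∀ {n γ c} → IsComposition n (γ ∷ʳ c) → IsComposition (suc n) (γ ∷ʳ suc c)
IsComposition-∷ʳsuc {n} {γ} {c} (pos , sum≡) =
  AllP.++⁺ (AllP.++⁻ˡ γ pos) (s≤s z≤n ∷ []) , trans (sum-∷ʳ γ (suc c)) (trans (+-suc _ _) (cong suc (trans (sym (sum-∷ʳ γ c)) sum≡)))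

cycC-isComposition : ∀ n (σ : Vec (Fin n) n) → IsPerm n σ → IsComposition n (cycC σ)
cycC-isComposition zero    V.[] ip = [] , refl
cycC-isComposition (suc n) σ ip with V.lookup σ F.zero in σ0≡
... | F.zero = subst (IsComposition (suc n)) (sym (cycC-fixesZero σ ip σ0≡))
      (IsComposition-∷ʳ1 (cycC-isComposition n (dropZeroᵛ σ) (IsPerm-tabulate (dropZero-injective ip σ0≡))))
cycC-isComposition (suc (suc m)) σ ip | F.suc s = subst (IsComposition (suc (suc m))) (sym σ≡)
      (IsComposition-∷ʳsuc (subst (IsComposition (suc m)) σ′≡
        (cycC-isComposition (suc m) (spliceOutᵛ s σ) (IsPerm-tabulate (spliceOut-injective s ip σ0≡)))))
  where
  σ′≡ = proj₁ (proj₂ (proj₂ (cycC-spliceOut σ ip σ0≡)))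
  σ≡  = proj₂ (proj₂ (proj₂ (cycC-spliceOut σ ip σ0≡)))


-- Partitions and fillings

partAt : List ℕ → ℕ → ℕ
partAt [] _ = 0
partAt (x ∷ xs) zero = x
partAt (x ∷ xs) (suc i) = partAt xs i

InDg⇒<partAt : ∀ μ i j → InDg μ (i , j) → j < partAt μ i
InDg⇒<partAt [] i j (r , () , _)
InDg⇒<partAt (x ∷ μ) zero j (r , refl , lt) = lt
InDg⇒<partAt (x ∷ μ) (suc i) j h = InDg⇒<partAt μ i j h

<partAt⇒InDg : ∀ μ i j → j < partAt μ i → InDg μ (i , j)
<partAt⇒InDg [] i j ()
<partAt⇒InDg (x ∷ μ) zero j lt = x , refl , lt
<partAt⇒InDg (x ∷ μ) (suc i) j lt = <partAt⇒InDg μ i j lt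

partAt-≥length : ∀ μ i → length μ ≤ i → partAt μ i ≡ 0
partAt-≥length [] i _ = refl
partAt-≥length (x ∷ μ) (suc i) (s≤s le) = partAt-≥length μ i le

partAt-antitone : ∀ μ → Linked _≥_ μ → ∀ i i' → i ≤ i' → partAt μ i' ≤ partAt μ i
partAt-antitone [] _ i i' _ = z≤n
partAt-antitone (x ∷ []) _ zero zero _ = ≤-refl
partAt-antitone (x ∷ []) _ zero (suc i') _ = z≤n
partAt-antitone (x ∷ []) _ (suc i) (suc i') _ = z≤n
partAt-antitone (x ∷ y ∷ μ) (h ∷ l) zero zero _ = ≤-refl
partAt-antitone (x ∷ y ∷ μ) (h ∷ l) zero (suc i') _ = ≤-trans (partAt-antitone (y ∷ μ) l zero i' z≤n) h
partAt-antitone (x ∷ y ∷ μ) (h ∷ l) (suc i) (suc i') (s≤s le) = partAt-antitone (y ∷ μ) l i i' le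

partAt-positive : ∀ μ → All (λ b → 1 ≤ b) μ → ∀ i → i < length μ → 1 ≤ partAt μ i
partAt-positive (x ∷ μ) (p ∷ _) zero _ = p
partAt-positive (x ∷ μ) (_ ∷ ps) (suc i) (s≤s lt) = partAt-positive μ ps i lt

partAt-positive⇒<length : ∀ μ i → 1 ≤ partAt μ i → i < length μ
partAt-positive⇒<length [] i ()
partAt-positive⇒<length (x ∷ μ) zero _ = s≤s z≤n
partAt-positive⇒<length (x ∷ μ) (suc i) h = s≤s (partAt-positive⇒<length μ i h)

rowOf : List (List ℕ) → ℕ → List ℕ
rowOf [] _ = []
rowOf (r ∷ T) zero = r
rowOf (r ∷ T) (suc i) = rowOf T i

entry-rowOf : ∀ T i j → entry T (i , j) ≡ lookupM (rowOf T i) j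
entry-rowOf [] i j = refl
entry-rowOf (r ∷ T) zero j = refl
entry-rowOf (r ∷ T) (suc i) j = trans (lem T i j) (entry-rowOf T i j)
  where
  lem : ∀ T i j → entry (r ∷ T) (suc i , j) ≡ entry T (i , j)
  lem T i j with lookupM T i
  ... | nothing = refl
  ... | just proj₁ = refl

length-rowOf : ∀ T i → length (rowOf T i) ≡ partAt (map length T) i
length-rowOf [] i = refl
length-rowOf (r ∷ T) zero = refl
length-rowOf (r ∷ T) (suc i) = length-rowOf T i

lookupM-ext : ∀ (r s : List ℕ) → (∀ j → lookupM r j ≡ lookupM s j) → r ≡ s
lookupM-ext [] [] h = refl
lookupM-ext [] (x ∷ s) h with h 0
... | ()
lookupM-ext (x ∷ r) [] h with h 0
... | ()
lookupM-ext (x ∷ r) (y ∷ s) h with h 0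
... | refl = cong (x ∷_) (lookupM-ext r s (h ∘ suc))

rowOf-ext : ∀ (T U : List (List ℕ)) → length T ≡ length U → (∀ i → rowOf T i ≡ rowOf U i) → T ≡ U
rowOf-ext [] [] _ _ = refl
rowOf-ext (r ∷ T) (s ∷ U) e h = cong₂ _∷_ (h 0) (rowOf-ext T U (suc-injective e) (h ∘ suc))

lookupM-++ˡ : ∀ (xs ys : List ℕ) j → j < length xs → lookupM (xs ++ ys) j ≡ lookupM xs j
lookupM-++ˡ (x ∷ xs) ys zero _ = refl
lookupM-++ˡ (x ∷ xs) ys (suc j) (s≤s lt) = lookupM-++ˡ xs ys j lt

lookupM-++ʳ : ∀ (xs ys : List ℕ) j → length xs ≤ j → lookupM (xs ++ ys) j ≡ lookupM ys (j ∸ length xs)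
lookupM-++ʳ [] ys j _ = refl
lookupM-++ʳ (x ∷ xs) ys (suc j) (s≤s le) = lookupM-++ʳ xs ys j le

lookupM-replicate-< : ∀ k (l : ℕ) j → j < k → lookupM (replicate k l) j ≡ just l
lookupM-replicate-< (suc k) l zero _ = refl
lookupM-replicate-< (suc k) l (suc j) (s≤s lt) = lookupM-replicate-< k l j lt

lookupM-replicate-≥ : ∀ k (l : ℕ) j → k ≤ j → lookupM (replicate k l) j ≡ nothing
lookupM-replicate-≥ zero l j _ = refl
lookupM-replicate-≥ (suc k) l (suc j) (s≤s le) = lookupM-replicate-≥ k l j le

lookupM-≥length : ∀ (xs : List ℕ) j → length xs ≤ j → lookupM xs j ≡ nothing
lookupM-≥length [] j _ = refl
lookupM-≥length (x ∷ xs) (suc j) (s≤s le) = lookupM-≥length xs j le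

lookupM-take-< : ∀ k (xs : List ℕ) j → j < k → lookupM (take k xs) j ≡ lookupM xs j
lookupM-take-< (suc k) [] j _ = refl
lookupM-take-< (suc k) (x ∷ xs) zero _ = refl
lookupM-take-< (suc k) (x ∷ xs) (suc j) (s≤s lt) = lookupM-take-< k xs j lt

lookupM-take-≥ : ∀ k (xs : List ℕ) j → k ≤ j → lookupM (take k xs) j ≡ nothing
lookupM-take-≥ zero xs j _ = refl
lookupM-take-≥ (suc k) [] j _ = refl
lookupM-take-≥ (suc k) (x ∷ xs) (suc j) (s≤s le) = lookupM-take-≥ k xs j le

lookupM-just⇒<length : ∀ (xs : List ℕ) j v → lookupM xs j ≡ just v → j < length xs
lookupM-just⇒<length (x ∷ xs) zero v _ = s≤s z≤n
lookupM-just⇒<length (x ∷ xs) (suc j) v e = s≤s (lookupM-just⇒<length xs j v e)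

restrict : List ℕ → List (List ℕ) → List (List ℕ)
restrict [] T = []
restrict (k ∷ ν) [] = []
restrict (k ∷ ν) (r ∷ T) = take k r ∷ restrict ν T

rowOf-restrict : ∀ ν T i → rowOf (restrict ν T) i ≡ take (partAt ν i) (rowOf T i)
rowOf-restrict [] T i = refl
rowOf-restrict (k ∷ ν) [] zero = sym (LP.take-[] k)
rowOf-restrict (k ∷ ν) [] (suc i) = sym (LP.take-[] (partAt ν i))
rowOf-restrict (k ∷ ν) (r ∷ T) zero = refl
rowOf-restrict (k ∷ ν) (r ∷ T) (suc i) = rowOf-restrict ν T i

shape-restrict : ∀ ν T → All (λ b → 1 ≤ b) ν → (∀ i → partAt ν i ≤ partAt (map length T) i) → map length (restrict ν T) ≡ ν
shape-restrict [] T _ _ = refl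
shape-restrict (k ∷ ν) [] (p ∷ _) h = ⊥-elim (<⇒≱ p (h 0))
shape-restrict (k ∷ ν) (r ∷ T) (p ∷ ps) h = cong₂ _∷_ (trans (LP.length-take k r) (m≤n⇒m⊓n≡m (h 0))) (shape-restrict ν T ps (h ∘ suc))

extend : List ℕ → List (List ℕ) → ℕ → List ℕ → List (List ℕ)
extend ν T l [] = []
extend ν T l (k ∷ la) = (rowOf T 0 ++ replicate (k ∸ partAt ν 0) l) ∷ extend (L.drop 1 ν) (L.drop 1 T) l la

partAt-drop1 : ∀ ν i → partAt (L.drop 1 ν) i ≡ partAt ν (suc i)
partAt-drop1 [] i = refl
partAt-drop1 (x ∷ ν) i = refl

rowOf-extend : ∀ ν T l la i → length T ≤ length la → rowOf (extend ν T l la) i ≡ rowOf T i ++ replicate (partAt la i ∸ partAt ν i) l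
rowOf-extend ν [] l [] i le = cong (λ z → replicate z l) (sym (0∸n≡0 (partAt ν i)))
rowOf-extend ν [] l (k ∷ la) zero le = refl
rowOf-extend ν [] l (k ∷ la) (suc i) le = trans (rowOf-extend (L.drop 1 ν) [] l la i z≤n) (cong (λ z → replicate (partAt la i ∸ z) l) (partAt-drop1 ν i))
rowOf-extend ν (r ∷ T) l (k ∷ la) zero le = refl
rowOf-extend ν (r ∷ T) l (k ∷ la) (suc i) (s≤s le) = trans (rowOf-extend (L.drop 1 ν) T l la i le) (cong (λ z → rowOf T i ++ replicate (partAt la i ∸ z) l) (partAt-drop1 ν i))

shape-extend : ∀ ν T l la → (∀ i → partAt ν i ≤ partAt la i) → map length T ≡ ν → map length (extend ν T l la) ≡ la
shape-extend ν T l [] h e = refl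
shape-extend ν T l (k ∷ la) h e = cong₂ _∷_ rowlen (shape-extend (L.drop 1 ν) (L.drop 1 T) l la (λ i → subst (_≤ partAt la i) (sym (partAt-drop1 ν i)) (h (suc i))) (lemT T ν e))
  where
  lemT : ∀ T ν → map length T ≡ ν → map length (L.drop 1 T) ≡ L.drop 1 ν
  lemT [] .[] refl = refl
  lemT (r ∷ T) .(length r ∷ map length T) refl = refl
  hdlen : ∀ T ν → map length T ≡ ν → length (rowOf T 0) ≡ partAt ν 0
  hdlen [] .[] refl = refl
  hdlen (r ∷ T) .(length r ∷ map length T) refl = refl
  rowlen : length (rowOf T 0 ++ replicate (k ∸ partAt ν 0) l) ≡ k
  rowlen = trans (LP.length-++ (rowOf T 0)) (trans (cong₂ _+_ (hdlen T ν e) (LP.length-replicate (k ∸ partAt ν 0))) (m+[n∸m]≡n (h 0)))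


-- Rim-hook paths

-- d lies weakly to the north-east of c; every step of a rim-hook path moves this way.
_⊑_ : Cell → Cell → Set
c ⊑ d = proj₁ d ≤ proj₁ c × proj₂ c ≤ proj₂ d

⊑-refl : ∀ c → c ⊑ c
⊑-refl c = ≤-refl , ≤-refl

⊑-trans : ∀ {c d e} → c ⊑ d → d ⊑ e → c ⊑ e
⊑-trans (a , b) (a′ , b′) = ≤-trans a′ a , ≤-trans b b′

Step⇒⊑ : ∀ {c d} → Step c d → c ⊑ d
Step⇒⊑ (inj₁ (refl , refl)) = ≤-refl , n≤1+n _
Step⇒⊑ (inj₂ (refl , refl)) = n≤1+n _ , ≤-refl

_≺_ : Cell → Cell → Set
c ≺ d = proj₁ d < proj₁ c ⊎ (proj₁ d ≡ proj₁ c × proj₂ c < proj₂ d)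

Step⇒≺ : ∀ {c d} → Step c d → c ≺ d
Step⇒≺ (inj₁ (refl , refl)) = inj₂ (refl , n<1+n _)
Step⇒≺ (inj₂ (refl , refl)) = inj₁ (n<1+n _)

≺-trans : ∀ {c d e} → c ≺ d → d ≺ e → c ≺ e
≺-trans (inj₁ a)       (inj₁ b)       = inj₁ (<-trans b a)
≺-trans (inj₁ a)       (inj₂ (b , _)) = inj₁ (subst (_< _) (sym b) a)
≺-trans (inj₂ (a , _)) (inj₁ b)       = inj₁ (subst (_ <_) a b)
≺-trans (inj₂ (a , a′)) (inj₂ (b , b′)) = inj₂ (trans b a , <-trans a′ b′)

≺-irrefl : ∀ {c} → c ≺ c → ⊥
≺-irrefl (inj₁ a)       = <-irrefl refl a
≺-irrefl (inj₂ (_ , a)) = <-irrefl refl a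

path-≺-later : ∀ {x xs} → Linked Step (x ∷ xs) → ∀ {c} → c ∈ xs → x ≺ c
path-≺-later l = All.lookup (AllPairs.head (LinkedP.Linked⇒AllPairs ≺-trans (Linked.map Step⇒≺ l)))

path-⊑-later : ∀ {x xs} → Linked Step (x ∷ xs) → ∀ {c} → c ∈ xs → x ⊑ c
path-⊑-later l = All.lookup (AllPairs.head (LinkedP.Linked⇒AllPairs ⊑-trans (Linked.map Step⇒⊑ l)))

path-unique : ∀ p q → Linked Step p → Linked Step q → (∀ c → c ∈ p → c ∈ q) → (∀ c → c ∈ q → c ∈ p) → p ≡ q
path-unique [] [] _ _ _ _ = refl
path-unique [] (y ∷ q) _ _ _ h with h y (here refl)
... | ()
path-unique (x ∷ p) [] _ _ h _ with h x (here refl)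
... | ()
path-unique (x ∷ p) (y ∷ q) lp lq h1 h2 with h1 x (here refl) | h2 y (here refl)
... | here refl | _ = cong (x ∷_) (path-unique p q (Linked.tail lp) (Linked.tail lq) g1 g2)
  where
  g1 : ∀ c → c ∈ p → c ∈ q
  g1 c m with h1 c (there m)
  ... | here refl = ⊥-elim (≺-irrefl (path-≺-later lp m))
  ... | there m' = m'
  g2 : ∀ c → c ∈ q → c ∈ p
  g2 c m with h2 c (there m)
  ... | here refl = ⊥-elim (≺-irrefl (path-≺-later lq m))
  ... | there m' = m'
... | there mx | here refl = ⊥-elim (≺-irrefl (path-≺-later lq mx))
... | there mx | there my = ⊥-elim (≺-irrefl (≺-trans (path-≺-later lq mx) (path-≺-later lp my)))

LabelAtMost : List (List ℕ) → ℕ → Cell → Set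
LabelAtMost T k c = Σ ℕ λ v → entry T c ≡ just v × 1 ≤ v × v ≤ k

IsRimHookOfSize-resp : ∀ {P Q : Cell → Set} {m} → (∀ c → P c ⇔ Q c) → IsRimHookOfSize P m → IsRimHookOfSize Q m
IsRimHookOfSize-resp h (p , (len , lk , sup) , e) = p , (len , lk , λ c → mk⇔ (λ q → Equivalence.to (sup c) (Equivalence.from (h c) q)) (λ m → Equivalence.to (h c) (Equivalence.from (sup c) m))) , e

IsPartitionDiagram-resp : ∀ {P Q : Cell → Set} → (∀ c → P c ⇔ Q c) → IsPartitionDiagram P → IsPartitionDiagram Q
IsPartitionDiagram-resp h (ν , sh , sup) = ν , sh , λ c → mk⇔ (λ q → Equivalence.to (sup c) (Equivalence.from (h c) q)) (λ m → Equivalence.to (h c) (Equivalence.from (sup c) m))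

lookup-∷ʳ-cases : ∀ (γ : List ℕ) b (k : Fin (length (γ ∷ʳ b))) →
  (Σ (Fin (length γ)) λ k' → toℕ k ≡ toℕ k' × L.lookup (γ ∷ʳ b) k ≡ L.lookup γ k')
  ⊎ (toℕ k ≡ length γ × L.lookup (γ ∷ʳ b) k ≡ b)
lookup-∷ʳ-cases [] b F.zero = inj₂ (refl , refl)
lookup-∷ʳ-cases (x ∷ γ) b F.zero = inj₁ (F.zero , refl , refl)
lookup-∷ʳ-cases (x ∷ γ) b (F.suc k) with lookup-∷ʳ-cases γ b k
... | inj₁ (k' , e1 , e2) = inj₁ (F.suc k' , cong suc e1 , e2)
... | inj₂ (e1 , e2) = inj₂ (cong suc e1 , e2)

lookup-∷ʳ-inject : ∀ (γ : List ℕ) b (k' : Fin (length γ)) → Σ (Fin (length (γ ∷ʳ b))) λ k → toℕ k ≡ toℕ k' × L.lookup (γ ∷ʳ b) k ≡ L.lookup γ k'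
lookup-∷ʳ-inject (x ∷ γ) b F.zero = F.zero , refl , refl
lookup-∷ʳ-inject (x ∷ γ) b (F.suc k') with lookup-∷ʳ-inject γ b k'
... | k , e1 , e2 = F.suc k , cong suc e1 , e2

lookup-∷ʳ-last : ∀ (γ : List ℕ) b → Σ (Fin (length (γ ∷ʳ b))) λ k → toℕ k ≡ length γ × L.lookup (γ ∷ʳ b) k ≡ b
lookup-∷ʳ-last [] b = F.zero , refl , refl
lookup-∷ʳ-last (x ∷ γ) b with lookup-∷ʳ-last γ b
... | k , e1 , e2 = F.suc k , cong suc e1 , e2

length-∷ʳ : ∀ (γ : List ℕ) b → length (γ ∷ʳ b) ≡ suc (length γ)
length-∷ʳ γ b = trans (LP.length-++ γ) (+-comm (length γ) 1)

take-length-++ : ∀ (xs ys : List ℕ) k → k ≡ length xs → take k (xs ++ ys) ≡ xs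
take-length-++ [] ys .0 refl = refl
take-length-++ (x ∷ xs) ys .(suc (length xs)) refl = cong (x ∷_) (take-length-++ xs ys _ refl)

<length⇒lookupM-just : ∀ (xs : List ℕ) j → j < length xs → Σ ℕ λ v → lookupM xs j ≡ just v
<length⇒lookupM-just (x ∷ xs) zero _ = x , refl
<length⇒lookupM-just (x ∷ xs) (suc j) (s≤s lt) = <length⇒lookupM-just xs j lt

nothing≢just : ∀ {a : ℕ} → nothing ≢ just a
nothing≢just ()

record RimHookRemoval (la ν : List ℕ) (R : Cell → Set) : Set where
  field
    la-shape : IsPartitionShape la
    ν-shape : IsPartitionShape ν
    ν-cells : ∀ c → InDg ν c ⇔ (InDg la c × ¬ R c)
    removed⊆la : ∀ c → R c → InDg la c
    path : List Cell
    isPath : RimHookPath R path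


-- Removing the last rim hook of a tableau

_≟C_ : DecidableEquality Cell
_≟C_ = ProdP.≡-dec Data.Nat._≟_ Data.Nat._≟_

module RemovedRimHook {la ν : List ℕ} {R : Cell → Set} (H : RimHookRemoval la ν R) where
  open RimHookRemoval H

  hookSize : ℕ
  hookSize = length path

  R⇔∈path : ∀ c → R c ⇔ (c ∈ path)
  R⇔∈path = proj₂ (proj₂ isPath)

  R? : ∀ c → Dec (R c)
  R? c with _∈?_ _≟C_ c path
  ... | yes m = yes (Equivalence.from (R⇔∈path c) m)
  ... | no nm = no (λ r → nm (Equivalence.to (R⇔∈path c) r))

  ν⊆la : ∀ i → partAt ν i ≤ partAt la i
  ν⊆la i with partAt la i <? partAt ν i
  ... | no nlt = ≮⇒≥ nlt
  ... | yes lt = ⊥-elim (<-irrefl refl (InDg⇒<partAt la i (partAt la i) (proj₁ (Equivalence.to (ν-cells (i , partAt la i)) (<partAt⇒InDg ν i (partAt la i) lt)))))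

  length-ν≤la : length ν ≤ length la
  length-ν≤la with length la <? length ν
  ... | no nlt = ≮⇒≥ nlt
  ... | yes lt = ⊥-elim (<⇒≱ (partAt-positive ν (proj₁ ν-shape) (length la) lt) (subst (partAt ν (length la) ≤_) (partAt-≥length la (length la) ≤-refl) (ν⊆la (length la))))

  R⇒between : ∀ i j → R (i , j) → partAt ν i ≤ j × j < partAt la i
  R⇒between i j r = (≮⇒≥ λ lt → proj₂ (Equivalence.to (ν-cells (i , j)) (<partAt⇒InDg ν i j lt)) r) , InDg⇒<partAt la i j (removed⊆la _ r)

  la-cell-cases : ∀ i j → j < partAt la i → (j < partAt ν i) ⊎ (partAt ν i ≤ j × R (i , j))
  la-cell-cases i j lt with j <? partAt ν i
  ... | yes l = inj₁ l
  ... | no nl with R? (i , j)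
  ...   | yes r = inj₂ (≮⇒≥ nl , r)
  ...   | no nr = ⊥-elim (nl (InDg⇒<partAt ν i j (Equivalence.from (ν-cells (i , j)) (<partAt⇒InDg la i j lt , nr))))

  ν⇒¬R : ∀ i j → j < partAt ν i → ¬ R (i , j)
  ν⇒¬R i j lt = proj₂ (Equivalence.to (ν-cells (i , j)) (<partAt⇒InDg ν i j lt))

  -- Writing the new largest label on R turns a tableau of shape ν into one of shape la; Restrict undoes this.
  module Extend (γ : List ℕ) (T′ : List (List ℕ)) (HT : IsRHT ν γ T′) where
    l : ℕ
    l = suc (length γ)
    U : List (List ℕ)
    U = extend ν T′ l la

    shape-T : map length T′ ≡ ν
    shape-T = proj₁ HT

    length-T′≤ : length T′ ≤ length la
    length-T′≤ = subst (_≤ length la) (trans (cong length (sym shape-T)) (LP.length-map length T′)) length-ν≤la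

    length-rowOf-T′ : ∀ i → length (rowOf T′ i) ≡ partAt ν i
    length-rowOf-T′ i = trans (length-rowOf T′ i) (cong (λ z → partAt z i) shape-T)

    rowOf-U : ∀ i → rowOf U i ≡ rowOf T′ i ++ replicate (partAt la i ∸ partAt ν i) l
    rowOf-U i = rowOf-extend ν T′ l la i length-T′≤

    entryU : ∀ i j → entry U (i , j) ≡ lookupM (rowOf T′ i ++ replicate (partAt la i ∸ partAt ν i) l) j
    entryU i j = trans (entry-rowOf U i j) (cong (λ r → lookupM r j) (rowOf-U i))

    entryU-ν : ∀ i j → j < partAt ν i → entry U (i , j) ≡ entry T′ (i , j)
    entryU-ν i j lt = trans (entryU i j) (trans (lookupM-++ˡ (rowOf T′ i) _ j (subst (j <_) (sym (length-rowOf-T′ i)) lt)) (sym (entry-rowOf T′ i j)))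

    entryU-≥ν : ∀ i j → partAt ν i ≤ j → entry U (i , j) ≡ lookupM (replicate (partAt la i ∸ partAt ν i) l) (j ∸ partAt ν i)
    entryU-≥ν i j le = trans (entryU i j) (trans (lookupM-++ʳ (rowOf T′ i) _ j (subst (_≤ j) (sym (length-rowOf-T′ i)) le)) (cong (λ z → lookupM (replicate (partAt la i ∸ partAt ν i) l) (j ∸ z)) (length-rowOf-T′ i)))

    entryU-R : ∀ i j → partAt ν i ≤ j → j < partAt la i → entry U (i , j) ≡ just l
    entryU-R i j le lt = trans (entryU-≥ν i j le) (lookupM-replicate-< _ l _ (∸-monoˡ-< lt le))

    entryU-≥la : ∀ i j → partAt la i ≤ j → entry U (i , j) ≡ nothing
    entryU-≥la i j le = trans (entryU-≥ν i j (≤-trans (ν⊆la i) le)) (lookupM-replicate-≥ _ l _ (∸-monoˡ-≤ (partAt ν i) le))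

    entryT′-ν : ∀ i j v → entry T′ (i , j) ≡ just v → j < partAt ν i
    entryT′-ν i j v e = subst (j <_) (length-rowOf-T′ i) (lookupM-just⇒<length (rowOf T′ i) j v (trans (sym (entry-rowOf T′ i j)) e))

    labels-T′ : ∀ c v → entry T′ c ≡ just v → 1 ≤ v × v ≤ length γ
    labels-T′ = proj₁ (proj₂ HT)

    entryU-cases : ∀ i j v → entry U (i , j) ≡ just v → (j < partAt ν i × entry T′ (i , j) ≡ just v) ⊎ (partAt ν i ≤ j × j < partAt la i × v ≡ l)
    entryU-cases i j v e with j <? partAt ν i
    ... | yes lt = inj₁ (lt , trans (sym (entryU-ν i j lt)) e)
    ... | no nlt with j <? partAt la i
    ...   | yes lt2 = inj₂ (≮⇒≥ nlt , lt2 , MP.just-injective (trans (sym e) (entryU-R i j (≮⇒≥ nlt) lt2)))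
    ...   | no nlt2 = ⊥-elim (nothing≢just (trans (sym (entryU-≥la i j (≮⇒≥ nlt2))) e))

    length-β : length (γ ∷ʳ hookSize) ≡ l
    length-β = length-∷ʳ γ hookSize

    labels-bounded : ∀ c v → entry U c ≡ just v → 1 ≤ v × v ≤ length (γ ∷ʳ hookSize)
    labels-bounded (i , j) v e with entryU-cases i j v e
    ... | inj₁ (_ , e') = proj₁ (labels-T′ _ v e') , subst (v ≤_) (sym length-β) (m≤n⇒m≤1+n (proj₂ (labels-T′ _ v e')))
    ... | inj₂ (_ , _ , refl) = s≤s z≤n , ≤-reflexive (sym length-β)

    lastLabel⇔R : ∀ c → (entry U c ≡ just l) ⇔ R c
    lastLabel⇔R (i , j) = mk⇔ fw bw
      where
      fw : entry U (i , j) ≡ just l → R (i , j)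
      fw e with entryU-cases i j l e
      ... | inj₁ (_ , e') = ⊥-elim (<-irrefl refl (proj₂ (labels-T′ _ l e')))
      ... | inj₂ (le , lt , _) with la-cell-cases i j lt
      ...   | inj₁ lt' = ⊥-elim (<⇒≱ lt' le)
      ...   | inj₂ (_ , r) = r
      bw : R (i , j) → entry U (i , j) ≡ just l
      bw r = entryU-R i j (proj₁ (R⇒between i j r)) (proj₂ (R⇒between i j r))

    label⇔ : ∀ (k' : Fin (length γ)) c → (entry U c ≡ just (suc (toℕ k'))) ⇔ (entry T′ c ≡ just (suc (toℕ k')))
    label⇔ k' (i , j) = mk⇔ fw bw
      where
      fw : entry U (i , j) ≡ just (suc (toℕ k')) → entry T′ (i , j) ≡ just (suc (toℕ k'))
      fw e with entryU-cases i j _ e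
      ... | inj₁ (_ , e') = e'
      ... | inj₂ (_ , _ , eq) = ⊥-elim (<-irrefl (suc-injective eq) (FP.toℕ<n k'))
      bw : entry T′ (i , j) ≡ just (suc (toℕ k')) → entry U (i , j) ≡ just (suc (toℕ k'))
      bw e = trans (entryU-ν i j (entryT′-ν i j _ e)) e

    labels≤⇔ : ∀ (k' : Fin (length γ)) c → LabelAtMost U (suc (toℕ k')) c ⇔ LabelAtMost T′ (suc (toℕ k')) c
    labels≤⇔ k' (i , j) = mk⇔ fw bw
      where
      fw : LabelAtMost U (suc (toℕ k')) (i , j) → LabelAtMost T′ (suc (toℕ k')) (i , j)
      fw (v , e , a , c) with entryU-cases i j v e
      ... | inj₁ (_ , e') = v , e' , a , c
      ... | inj₂ (_ , _ , refl) = ⊥-elim (<-irrefl refl (≤-trans (s≤s c) (s≤s (FP.toℕ<n k'))))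
      bw : LabelAtMost T′ (suc (toℕ k')) (i , j) → LabelAtMost U (suc (toℕ k')) (i , j)
      bw (v , e , a , c) = v , trans (entryU-ν i j (entryT′-ν i j v e)) e , a , c

    allLabels⇔la : ∀ c → LabelAtMost U l c ⇔ InDg la c
    allLabels⇔la (i , j) = mk⇔ fw bw
      where
      fw : LabelAtMost U l (i , j) → InDg la (i , j)
      fw (v , e , _) with entryU-cases i j v e
      ... | inj₁ (lt , _) = <partAt⇒InDg la i j (≤-trans lt (ν⊆la i))
      ... | inj₂ (_ , lt , _) = <partAt⇒InDg la i j lt
      bw : InDg la (i , j) → LabelAtMost U l (i , j)
      bw d with la-cell-cases i j (InDg⇒<partAt la i j d)
      ... | inj₁ lt with <length⇒lookupM-just (rowOf T′ i) j (subst (j <_) (sym (length-rowOf-T′ i)) lt)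
      ...   | v , e = v , trans (entryU-ν i j lt) (trans (entry-rowOf T′ i j) e) , proj₁ (labels-T′ _ v (trans (entry-rowOf T′ i j) e)) , m≤n⇒m≤1+n (proj₂ (labels-T′ _ v (trans (entry-rowOf T′ i j) e)))
      bw d | inj₂ (le , r) = l , entryU-R i j le (InDg⇒<partAt la i j d) , s≤s z≤n , ≤-refl

    isRHT : IsRHT la (γ ∷ʳ hookSize) U
    isRHT = shape-extend ν T′ l la ν⊆la shape-T , labels-bounded , rimHooks , diagrams
      where
      rimHooks : ∀ k → IsRimHookOfSize (λ c → entry U c ≡ just (suc (toℕ k))) (L.lookup (γ ∷ʳ hookSize) k)
      rimHooks k with lookup-∷ʳ-cases γ hookSize k
      ... | inj₁ (k' , e1 , e2) rewrite e1 | e2 = IsRimHookOfSize-resp (λ c → ⇔-sym (label⇔ k' c)) (proj₁ (proj₂ (proj₂ HT)) k')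
      ... | inj₂ (e1 , e2) rewrite e1 | e2 = IsRimHookOfSize-resp (λ c → ⇔-sym (lastLabel⇔R c)) (path , isPath , refl)
      diagrams : ∀ k → IsPartitionDiagram (LabelAtMost U (suc (toℕ k)))
      diagrams k with lookup-∷ʳ-cases γ hookSize k
      ... | inj₁ (k' , e1 , e2) rewrite e1 = IsPartitionDiagram-resp (λ c → ⇔-sym (labels≤⇔ k' c)) (proj₂ (proj₂ (proj₂ HT)) k')
      ... | inj₂ (e1 , e2) rewrite e1 = la , la-shape , allLabels⇔la

    restrict-extend : restrict ν U ≡ T′
    restrict-extend = rowOf-ext (restrict ν U) T′ same-length same-rows
      where
      mlU : map length U ≡ la
      mlU = shape-extend ν T′ l la ν⊆la shape-T
      same-length : length (restrict ν U) ≡ length T′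
      same-length = trans (sym (LP.length-map length (restrict ν U))) (trans (cong length (shape-restrict ν U (proj₁ ν-shape) (λ i → subst (λ z → partAt ν i ≤ partAt z i) (sym mlU) (ν⊆la i)))) (trans (cong length (sym shape-T)) (LP.length-map length T′)))
      same-rows : ∀ i → rowOf (restrict ν U) i ≡ rowOf T′ i
      same-rows i = trans (rowOf-restrict ν U i) (trans (cong (take (partAt ν i)) (rowOf-U i)) (take-length-++ (rowOf T′ i) _ (partAt ν i) (sym (length-rowOf-T′ i))))

  module Restrict (γ : List ℕ) (b′ : ℕ) (T : List (List ℕ)) (HT : IsRHT la (γ ∷ʳ b′) T)
                (hl : ∀ c → (entry T c ≡ just (suc (length γ))) ⇔ R c) where
    l : ℕ
    l = suc (length γ)
    T′ : List (List ℕ)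
    T′ = restrict ν T

    shape-T : map length T ≡ la
    shape-T = proj₁ HT

    length-rowOf-T : ∀ i → length (rowOf T i) ≡ partAt la i
    length-rowOf-T i = trans (length-rowOf T i) (cong (λ z → partAt z i) shape-T)

    entryT′-ν : ∀ i j → j < partAt ν i → entry T′ (i , j) ≡ entry T (i , j)
    entryT′-ν i j lt = trans (entry-rowOf T′ i j) (trans (cong (λ r → lookupM r j) (rowOf-restrict ν T i)) (trans (lookupM-take-< (partAt ν i) (rowOf T i) j lt) (sym (entry-rowOf T i j))))

    entryT′-≥ν : ∀ i j → partAt ν i ≤ j → entry T′ (i , j) ≡ nothing
    entryT′-≥ν i j le = trans (entry-rowOf T′ i j) (trans (cong (λ r → lookupM r j) (rowOf-restrict ν T i)) (lookupM-take-≥ (partAt ν i) (rowOf T i) j le))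

    entryT′-just : ∀ i j v → entry T′ (i , j) ≡ just v → j < partAt ν i × entry T (i , j) ≡ just v
    entryT′-just i j v e with j <? partAt ν i
    ... | yes lt = lt , trans (sym (entryT′-ν i j lt)) e
    ... | no nlt = ⊥-elim (nothing≢just (trans (sym (entryT′-≥ν i j (≮⇒≥ nlt))) e))

    entryT⇒la : ∀ i j v → entry T (i , j) ≡ just v → j < partAt la i
    entryT⇒la i j v e = subst (j <_) (length-rowOf-T i) (lookupM-just⇒<length (rowOf T i) j v (trans (sym (entry-rowOf T i j)) e))

    labels-T : ∀ c v → entry T c ≡ just v → 1 ≤ v × v ≤ length (γ ∷ʳ b′)
    labels-T = proj₁ (proj₂ HT)

    labels-T≤l : ∀ c v → entry T c ≡ just v → 1 ≤ v × v ≤ l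
    labels-T≤l c v e = proj₁ (labels-T c v e) , subst (v ≤_) (length-∷ʳ γ b′) (proj₂ (labels-T c v e))

    ν⇒label<l : ∀ i j v → j < partAt ν i → entry T (i , j) ≡ just v → v ≤ length γ
    ν⇒label<l i j v lt e with m≤n⇒m<n∨m≡n (proj₂ (labels-T≤l _ v e))
    ... | inj₁ (s≤s le) = le
    ... | inj₂ refl = ⊥-elim (ν⇒¬R i j lt (Equivalence.to (hl (i , j)) e))

    labels-bounded : ∀ c v → entry T′ c ≡ just v → 1 ≤ v × v ≤ length γ
    labels-bounded (i , j) v e with entryT′-just i j v e
    ... | lt , e' = proj₁ (labels-T≤l _ v e') , ν⇒label<l i j v lt e'

    label⇔ : ∀ (k' : Fin (length γ)) c → (entry T′ c ≡ just (suc (toℕ k'))) ⇔ (entry T c ≡ just (suc (toℕ k')))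
    label⇔ k' (i , j) = mk⇔ fw bw
      where
      fw : entry T′ (i , j) ≡ just (suc (toℕ k')) → entry T (i , j) ≡ just (suc (toℕ k'))
      fw e = proj₂ (entryT′-just i j _ e)
      bw : entry T (i , j) ≡ just (suc (toℕ k')) → entry T′ (i , j) ≡ just (suc (toℕ k'))
      bw e with la-cell-cases i j (entryT⇒la i j _ e)
      ... | inj₁ lt = trans (entryT′-ν i j lt) e
      ... | inj₂ (_ , r) = ⊥-elim (<-irrefl (suc-injective (MP.just-injective (trans (sym e) (Equivalence.from (hl (i , j)) r)))) (FP.toℕ<n k'))

    labels≤⇔ : ∀ (k' : Fin (length γ)) c → LabelAtMost T′ (suc (toℕ k')) c ⇔ LabelAtMost T (suc (toℕ k')) c
    labels≤⇔ k' (i , j) = mk⇔ fw bw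
      where
      fw : LabelAtMost T′ (suc (toℕ k')) (i , j) → LabelAtMost T (suc (toℕ k')) (i , j)
      fw (v , e , a , c) = v , proj₂ (entryT′-just i j v e) , a , c
      bw : LabelAtMost T (suc (toℕ k')) (i , j) → LabelAtMost T′ (suc (toℕ k')) (i , j)
      bw (v , e , a , c) with la-cell-cases i j (entryT⇒la i j v e)
      ... | inj₁ lt = v , trans (entryT′-ν i j lt) e , a , c
      ... | inj₂ (_ , r) with MP.just-injective (trans (sym e) (Equivalence.from (hl (i , j)) r))
      ...   | refl = ⊥-elim (<-irrefl refl (≤-trans (s≤s c) (s≤s (FP.toℕ<n k'))))

    isRHT : IsRHT ν γ T′
    isRHT = shape-restrict ν T (proj₁ ν-shape) (λ i → subst (λ z → partAt ν i ≤ partAt z i) (sym shape-T) (ν⊆la i)) , labels-bounded , rimHooks , diagrams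
      where
      rimHooks : ∀ k' → IsRimHookOfSize (λ c → entry T′ c ≡ just (suc (toℕ k'))) (L.lookup γ k')
      rimHooks k' with lookup-∷ʳ-inject γ b′ k'
      ... | k , e1 , e2 = subst (IsRimHookOfSize (λ c → entry T′ c ≡ just (suc (toℕ k')))) e2 (IsRimHookOfSize-resp h (proj₁ (proj₂ (proj₂ HT)) k))
        where
        h : ∀ c → (entry T c ≡ just (suc (toℕ k))) ⇔ (entry T′ c ≡ just (suc (toℕ k')))
        h c = mk⇔ (λ e → Equivalence.from (label⇔ k' c) (subst (λ z → entry T c ≡ just (suc z)) e1 e)) (λ e → subst (λ z → entry T c ≡ just (suc z)) (sym e1) (Equivalence.to (label⇔ k' c) e))
      diagrams : ∀ k' → IsPartitionDiagram (LabelAtMost T′ (suc (toℕ k')))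
      diagrams k' with lookup-∷ʳ-inject γ b′ k'
      ... | k , e1 , e2 = IsPartitionDiagram-resp h (proj₂ (proj₂ (proj₂ HT)) k)
        where
        h : ∀ c → LabelAtMost T (suc (toℕ k)) c ⇔ LabelAtMost T′ (suc (toℕ k')) c
        h c = mk⇔ (λ { (v , e , a , q) → Equivalence.from (labels≤⇔ k' c) (v , e , a , subst (λ z → v ≤ suc z) e1 q) })
                  (λ e → case Equivalence.to (labels≤⇔ k' c) e of λ { (v , e , a , q) → v , e , a , subst (λ z → v ≤ suc z) (sym e1) q })

    lastPart≡hookSize : b′ ≡ hookSize
    lastPart≡hookSize with lookup-∷ʳ-last γ b′
    ... | k , e1 , e2 with proj₁ (proj₂ (proj₂ HT)) k
    ...   | q , (_ , lq , supq) , lenq = trans (sym e2) (trans (sym lenq) (cong length (path-unique q path lq (proj₁ (proj₂ isPath)) q⊆path path⊆q)))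
      where
      q⊆path : ∀ c → c ∈ q → c ∈ path
      q⊆path c m = Equivalence.to (R⇔∈path c) (Equivalence.to (hl c) (subst (λ z → entry T c ≡ just (suc z)) e1 (Equivalence.from (supq c) m)))
      path⊆q : ∀ c → c ∈ path → c ∈ q
      path⊆q c m = Equivalence.to (supq c) (subst (λ z → entry T c ≡ just (suc z)) (sym e1) (Equivalence.from (hl c) (Equivalence.from (R⇔∈path c) m)))

    extend-restrict : T ≡ extend ν T′ l la
    extend-restrict = rowOf-ext T (extend ν T′ l la) same-length same-rows
      where
      length-T′≤ : length T′ ≤ length la
      length-T′≤ = subst (_≤ length la) (trans (cong length (sym (proj₁ isRHT))) (LP.length-map length T′)) length-ν≤la
      same-length : length T ≡ length (extend ν T′ l la)
      same-length = trans (sym (LP.length-map length T)) (trans (cong length (trans shape-T (sym (shape-extend ν T′ l la ν⊆la (proj₁ isRHT))))) (LP.length-map length (extend ν T′ l la)))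
      length-rowOf-T′ : ∀ i → length (rowOf T′ i) ≡ partAt ν i
      length-rowOf-T′ i = trans (length-rowOf T′ i) (cong (λ z → partAt z i) (proj₁ isRHT))
      same-rows : ∀ i → rowOf T i ≡ rowOf (extend ν T′ l la) i
      same-rows i = trans (lookupM-ext _ _ pt) (sym (rowOf-extend ν T′ l la i length-T′≤))
        where
        pt : ∀ j → lookupM (rowOf T i) j ≡ lookupM (rowOf T′ i ++ replicate (partAt la i ∸ partAt ν i) l) j
        pt j with j <? partAt ν i
        ... | yes lt = trans (sym (entry-rowOf T i j)) (trans (sym (entryT′-ν i j lt)) (trans (entry-rowOf T′ i j) (sym (lookupM-++ˡ (rowOf T′ i) _ j (subst (j <_) (sym (length-rowOf-T′ i)) lt)))))
        ... | no nlt with j <? partAt la i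
        ...   | yes lt2 with la-cell-cases i j lt2
        ...     | inj₁ lt = ⊥-elim (nlt lt)
        ...     | inj₂ (le , r) = trans (sym (entry-rowOf T i j)) (trans (Equivalence.from (hl (i , j)) r) (sym (trans (lookupM-++ʳ (rowOf T′ i) _ j (subst (_≤ j) (sym (length-rowOf-T′ i)) le)) (trans (cong (λ z → lookupM (replicate (partAt la i ∸ partAt ν i) l) (j ∸ z)) (length-rowOf-T′ i)) (lookupM-replicate-< _ l _ (∸-monoˡ-< lt2 le))))))
        pt j | no nlt | no nlt2 = trans (lookupM-≥length (rowOf T i) j (subst (_≤ j) (sym (length-rowOf-T i)) (≮⇒≥ nlt2)))
             (sym (trans (lookupM-++ʳ (rowOf T′ i) _ j (subst (_≤ j) (sym (length-rowOf-T′ i)) (≮⇒≥ nlt))) (trans (cong (λ z → lookupM (replicate (partAt la i ∸ partAt ν i) l) (j ∸ z)) (length-rowOf-T′ i)) (lookupM-replicate-≥ _ l _ (∸-monoˡ-≤ (partAt ν i) (≮⇒≥ nlt2))))))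


-- Counting cells

Cells : List ℕ → Set
Cells la = Sub Cell (λ c → proj₂ c < partAt la (proj₁ c))

Cells↔Fin : ∀ la → Cells la ↔ Fin (sum la)
Cells↔Fin [] = mk↔ₛ′ (λ { ⟨ (i , j) , () ⟩ }) (λ ()) (λ ()) (λ { ⟨ (i , j) , () ⟩ })
Cells↔Fin (k ∷ la) = ↔-trans byRow (↔-trans (↔-refl ⊎-↔ Cells↔Fin la) (↔-sym FP.+↔⊎))
  where
  to : Cells (k ∷ la) → Fin k ⊎ Cells la
  to ⟨ (zero , j) , j< ⟩ = inj₁ (F.fromℕ< j<)
  to ⟨ (suc i , j) , j< ⟩ = inj₂ ⟨ (i , j) , j< ⟩
  from : Fin k ⊎ Cells la → Cells (k ∷ la)
  from (inj₁ j) = ⟨ (zero , toℕ j) , FP.toℕ<n j ⟩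
  from (inj₂ ⟨ (i , j) , j< ⟩) = ⟨ (suc i , j) , j< ⟩
  byRow : Cells (k ∷ la) ↔ (Fin k ⊎ Cells la)
  byRow = mk↔ₛ′ to from
    (λ { (inj₁ j) → cong inj₁ (FP.fromℕ<-toℕ j _) ; (inj₂ _) → refl })
    (λ { ⟨ (zero , j) , j< ⟩ → Sub≡ (cong (zero ,_) (FP.toℕ-fromℕ< j<)) ; ⟨ (suc i , j) , _ ⟩ → refl })

Members : {A : Set} → List A → Set
Members {A} xs = Sub A (_∈ xs)

Members↔Fin : ∀ {A : Set} → DecidableEquality A → ∀ (xs : List A) → AllPairs _≢_ xs → Members xs ↔ Fin (length xs)
Members↔Fin _≟_ [] _ = mk↔ₛ′ (λ { ⟨ _ , () ⟩ }) (λ ()) (λ ()) (λ { ⟨ _ , () ⟩ })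
Members↔Fin {A} _≟_ (x ∷ xs) (x∉xs ∷ distinct) = ↔-trans headOrTail (↔-trans (↔-refl ⊎-↔ Members↔Fin _≟_ xs distinct) (↔-sym (FP.+↔⊎ {1})))
  where
  toAt : ∀ c → .(c ∈ x ∷ xs) → Dec (c ≡ x) → Fin 1 ⊎ Members xs
  toAt c _ (yes _) = inj₁ F.zero
  toAt c c∈ (no c≢x) = inj₂ ⟨ c , ∈-tail c∈ c≢x ⟩
    where
    ∈-tail : ∀ {c} → c ∈ x ∷ xs → c ≢ x → c ∈ xs
    ∈-tail (here c≡x)   c≢x = ⊥-elim (c≢x c≡x)
    ∈-tail (there c∈xs) _   = c∈xs
  to : Members (x ∷ xs) → Fin 1 ⊎ Members xs
  to ⟨ c , c∈ ⟩ = toAt c c∈ (c ≟ x)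
  from : Fin 1 ⊎ Members xs → Members (x ∷ xs)
  from (inj₁ _) = ⟨ x , here refl ⟩
  from (inj₂ ⟨ c , c∈xs ⟩) = ⟨ c , there c∈xs ⟩
  to∘from : ∀ y → to (from y) ≡ y
  to∘from (inj₁ F.zero) with x ≟ x
  ... | yes _  = refl
  ... | no x≢x = ⊥-elim (x≢x refl)
  to∘from (inj₂ ⟨ c , c∈xs ⟩) with c ≟ x
  ... | yes refl = ⊥-elim-irr (All.lookup x∉xs c∈xs refl)
  ... | no _     = refl
  from∘to : ∀ y → from (to y) ≡ y
  from∘to ⟨ c , c∈ ⟩ with c ≟ x
  ... | yes refl = refl
  ... | no _     = refl
  headOrTail : Members (x ∷ xs) ↔ (Fin 1 ⊎ Members xs)
  headOrTail = mk↔ₛ′ to from to∘from from∘to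

path-distinct : ∀ {p} → Linked Step p → AllPairs _≢_ p
path-distinct l = AllPairs.map (λ c≺d c≡d → ≺-irrefl (subst (_ ≺_) (sym c≡d) c≺d)) (LinkedP.Linked⇒AllPairs ≺-trans (Linked.map Step⇒≺ l))

module _ {la ν : List ℕ} {R : Cell → Set} (H : RimHookRemoval la ν R) where
  open RimHookRemoval H
  open RemovedRimHook H

  Cells-removal↔ : Cells la ↔ (Cells ν ⊎ Members path)
  Cells-removal↔ = mk↔ₛ′ to from inv1 inv2
    where
    toH : ∀ i j → .(j < partAt la i) → Dec (j < partAt ν i) → Cells ν ⊎ Members path
    toH i j q (yes lt) = inj₁ ⟨ (i , j) , lt ⟩
    toH i j q (no nlt) = inj₂ ⟨ (i , j) , mem i j q nlt ⟩
      where
      mem : ∀ i j → j < partAt la i → ¬ (j < partAt ν i) → (i , j) ∈ path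
      mem i j q nlt with la-cell-cases i j q
      ... | inj₁ lt = ⊥-elim (nlt lt)
      ... | inj₂ (_ , r) = Equivalence.to (R⇔∈path (i , j)) r
    to : Cells la → Cells ν ⊎ Members path
    to ⟨ (i , j) , q ⟩ = toH i j q (j <? partAt ν i)
    from : Cells ν ⊎ Members path → Cells la
    from (inj₁ ⟨ (i , j) , q ⟩) = ⟨ (i , j) , ≤-trans q (ν⊆la i) ⟩
    from (inj₂ ⟨ (i , j) , m ⟩) = ⟨ (i , j) , proj₂ (R⇒between i j (Equivalence.from (R⇔∈path (i , j)) m)) ⟩
    inv1 : ∀ y → to (from y) ≡ y
    inv1 (inj₁ ⟨ (i , j) , q ⟩) with j <? partAt ν i
    ... | yes _ = refl
    ... | no nlt = ⊥-elim-irr (nlt q)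
    inv1 (inj₂ ⟨ (i , j) , m ⟩) with j <? partAt ν i
    ... | yes lt = ⊥-elim-irr (ν⇒¬R i j lt (Equivalence.from (R⇔∈path (i , j)) m))
    ... | no nlt = refl
    inv2 : ∀ y → from (to y) ≡ y
    inv2 ⟨ (i , j) , q ⟩ with j <? partAt ν i
    ... | yes _ = refl
    ... | no _ = refl

  sum-removal : sum la ≡ sum ν + length path
  sum-removal = ↔⇒≡ (↔-trans (↔-sym (Cells↔Fin la)) (↔-trans Cells-removal↔ (↔-trans (Cells↔Fin ν ⊎-↔ Members↔Fin _≟C_ path (path-distinct (proj₁ (proj₂ isPath)))) (↔-sym FP.+↔⊎))))


-- The hook rim path of a cell

<ᵇ-cases : ∀ m n → ((m <ᵇ n) ≡ true × m < n) ⊎ ((m <ᵇ n) ≡ false × ¬ m < n)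
<ᵇ-cases m n with m <ᵇ n in eq
... | true = inj₁ (refl , <ᵇ⇒< m n (subst T (sym eq) _))
... | false = inj₂ (refl , λ lt → subst T eq (<⇒<ᵇ lt))

-- Row r of la with hookRimPath la i j removed.
hookRemovedPart : List ℕ → ℕ → ℕ → ℕ → ℕ
hookRemovedPart la i j r = if r <ᵇ i then partAt la r else (if j <ᵇ partAt la (suc r) then partAt la (suc r) ∸ 1 else j ⊓ partAt la r)

hookRemovedPart-above : ∀ la i j r → r < i → hookRemovedPart la i j r ≡ partAt la r
hookRemovedPart-above la i j r lt with <ᵇ-cases r i
... | inj₁ (e , _) rewrite e = refl
... | inj₂ (_ , n) = ⊥-elim (n lt)

hookRemovedPart-inside : ∀ la i j r → i ≤ r → j < partAt la (suc r) → hookRemovedPart la i j r ≡ partAt la (suc r) ∸ 1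
hookRemovedPart-inside la i j r le lt with <ᵇ-cases r i | <ᵇ-cases j (partAt la (suc r))
... | inj₁ (_ , l) | _ = ⊥-elim (<⇒≱ l le)
... | inj₂ (e , _) | inj₁ (e' , _) rewrite e | e' = refl
... | inj₂ _ | inj₂ (_ , n) = ⊥-elim (n lt)

hookRemovedPart-outside : ∀ la i j r → i ≤ r → ¬ (j < partAt la (suc r)) → hookRemovedPart la i j r ≡ j ⊓ partAt la r
hookRemovedPart-outside la i j r le nlt with <ᵇ-cases r i | <ᵇ-cases j (partAt la (suc r))
... | inj₁ (_ , l) | _ = ⊥-elim (<⇒≱ l le)
... | inj₂ (e , _) | inj₂ (e' , _) rewrite e | e' = refl
... | inj₂ _ | inj₁ (_ , l) = ⊥-elim (nlt l)

rowSegmentN : ℕ → ℕ → ℕ → List Cell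
rowSegmentN r s zero = []
rowSegmentN r s (suc k) = (r , s) ∷ rowSegmentN r (suc s) k

rowSegment : ℕ → ℕ → ℕ → List Cell
rowSegment r s e = rowSegmentN r s (e ∸ s)

rowSegmentN-isPath : ∀ r s k → Linked Step (rowSegmentN r s k)
rowSegmentN-isPath r s zero = []
rowSegmentN-isPath r s (suc zero) = [-]
rowSegmentN-isPath r s (suc (suc k)) = inj₁ (refl , refl) ∷ rowSegmentN-isPath r (suc s) (suc k)

∈-rowSegmentN⇔ : ∀ r s k r' c → ((r' , c) ∈ rowSegmentN r s k) ⇔ (r' ≡ r × s ≤ c × c < s + k)
∈-rowSegmentN⇔ r s k r' c = mk⇔ (fw s k) (bw s k)
  where
  fw : ∀ s k → (r' , c) ∈ rowSegmentN r s k → r' ≡ r × s ≤ c × c < s + k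
  fw s (suc k) (here refl) = refl , ≤-refl , subst (s <_) (sym (+-suc s k)) (s≤s (m≤m+n s k))
  fw s (suc k) (there m) with fw (suc s) k m
  ... | e , a , b = e , ≤-trans (n≤1+n s) a , subst (c <_) (sym (+-suc s k)) b
  bw : ∀ s k → r' ≡ r × s ≤ c × c < s + k → (r' , c) ∈ rowSegmentN r s k
  bw s zero (e , a , b) = ⊥-elim (<⇒≱ (subst (c <_) (+-identityʳ s) b) a)
  bw s (suc k) (refl , a , b) with m≤n⇒m<n∨m≡n a
  ... | inj₂ refl = here refl
  ... | inj₁ lt = there (bw (suc s) k (refl , lt , subst (c <_) (+-suc s k) b))

∈-rowSegment⇔ : ∀ r s e r' c → s ≤ e → ((r' , c) ∈ rowSegment r s e) ⇔ (r' ≡ r × s ≤ c × c < e)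
∈-rowSegment⇔ r s e r' c le = mk⇔ (λ m → case₁ (Equivalence.to (∈-rowSegmentN⇔ r s (e ∸ s) r' c) m)) (λ h → Equivalence.from (∈-rowSegmentN⇔ r s (e ∸ s) r' c) (case₂ h))
  where
  case₁ : r' ≡ r × s ≤ c × c < s + (e ∸ s) → r' ≡ r × s ≤ c × c < e
  case₁ (a , b , d) = a , b , subst (c <_) (m+[n∸m]≡n le) d
  case₂ : r' ≡ r × s ≤ c × c < e → r' ≡ r × s ≤ c × c < s + (e ∸ s)
  case₂ (a , b , d) = a , b , subst (c <_) (sym (m+[n∸m]≡n le)) d

shiftDown : List Cell → List Cell
shiftDown = map (λ { (r , c) → (suc r , c) })

shiftDown-isPath : ∀ p → Linked Step p → Linked Step (shiftDown p)
shiftDown-isPath [] _ = []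
shiftDown-isPath (x ∷ []) _ = [-]
shiftDown-isPath ((r , c) ∷ (r' , c') ∷ p) (s ∷ l) = st s ∷ shiftDown-isPath ((r' , c') ∷ p) l
  where
  st : Step (r , c) (r' , c') → Step (suc r , c) (suc r' , c')
  st (inj₁ (a , b)) = inj₁ (cong suc a , b)
  st (inj₂ (a , b)) = inj₂ (cong suc a , b)

∈-shiftDown⇔ : ∀ p r c → ((suc r , c) ∈ shiftDown p) ⇔ ((r , c) ∈ p)
∈-shiftDown⇔ p r c = mk⇔ (fw p) (bw p)
  where
  fw : ∀ p → (suc r , c) ∈ shiftDown p → (r , c) ∈ p
  fw ((r' , c') ∷ p) (here refl) = here refl
  fw (x ∷ p) (there m) = there (fw p m)
  bw : ∀ p → (r , c) ∈ p → (suc r , c) ∈ shiftDown p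
  bw ((r' , c') ∷ p) (here refl) = here refl
  bw (x ∷ p) (there m) = there (bw p m)

∉-shiftDown-row0 : ∀ p c → (0 , c) ∈ shiftDown p → ⊥
∉-shiftDown-row0 ((r , c') ∷ p) c (here ())
∉-shiftDown-row0 (x ∷ p) c (there m) = ∉-shiftDown-row0 p c m

-- The border cells of la from the foot of column j to the end of row i, from the south-west end:
-- the rim hook cut out by the hook of cell (i , j).
hookRimPath : List ℕ → ℕ → ℕ → List Cell
hookRimPath [] i j = []
hookRimPath (x ∷ la) (suc i) j = shiftDown (hookRimPath la i j)
hookRimPath (x ∷ la) zero j = if j <ᵇ partAt la 0 then shiftDown (hookRimPath la zero j) ++ rowSegment 0 (partAt la 0 ∸ 1) x else rowSegment 0 j x

lastCell : Cell → List Cell → Cell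
lastCell c [] = c
lastCell c (d ∷ ds) = lastCell d ds

lastCell-shiftDown : ∀ r c tl → lastCell (suc r , c) (shiftDown tl) ≡ (suc (proj₁ (lastCell (r , c) tl)) , proj₂ (lastCell (r , c) tl))
lastCell-shiftDown r c [] = refl
lastCell-shiftDown r c ((r' , c') ∷ tl) = lastCell-shiftDown r' c' tl

lastCell-++ : ∀ hd tl hd' tl' → lastCell hd (tl ++ hd' ∷ tl') ≡ lastCell hd' tl'
lastCell-++ hd [] hd' tl' = refl
lastCell-++ hd (x ∷ tl) hd' tl' = lastCell-++ x tl hd' tl'

lastCell-rowSegmentN : ∀ r s k → lastCell (r , s) (rowSegmentN r (suc s) k) ≡ (r , s + k)
lastCell-rowSegmentN r s zero = cong (r ,_) (sym (+-identityʳ s))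
lastCell-rowSegmentN r s (suc k) = trans (lastCell-rowSegmentN r (suc s) k) (cong (r ,_) (sym (+-suc s k)))

path-++ : ∀ hd tl hd' tl' → Linked Step (hd ∷ tl) → Linked Step (hd' ∷ tl') → Step (lastCell hd tl) hd' → Linked Step ((hd ∷ tl) ++ (hd' ∷ tl'))
path-++ hd [] hd' tl' l1 l2 s = s ∷ l2
path-++ hd (x ∷ tl) hd' tl' (s1 ∷ l1) l2 s = s1 ∷ path-++ x tl hd' tl' l1 l2 s

rowSegment-ends : ∀ r s e → s < e → rowSegment r s e ≡ (r , s) ∷ rowSegmentN r (suc s) (e ∸ suc s) × lastCell (r , s) (rowSegmentN r (suc s) (e ∸ suc s)) ≡ (r , e ∸ 1)
rowSegment-ends r s (suc e) (s≤s le) = cong (λ k → rowSegmentN r s k) (+-∸-assoc 1 le) , trans (lastCell-rowSegmentN r s (e ∸ s)) (cong (r ,_) (m+[n∸m]≡n le))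

record PathEnds (p : List Cell) (i j e : ℕ) : Set where
  field
    hd : Cell
    tl : List Cell
    eq : p ≡ hd ∷ tl
    hdcol : proj₂ hd ≡ j
    lastc : lastCell hd tl ≡ (i , e)

partAt0≤head : ∀ {x la} → Linked _≥_ (x ∷ la) → partAt la 0 ≤ x
partAt0≤head [-] = z≤n
partAt0≤head (h ∷ _) = h

pred< : ∀ {x y j} → j < y → y ≤ x → y ∸ 1 < x
pred< {x} {suc y} _ le = ≤-trans (s≤s ≤-refl) le

hookRimPath-ends : ∀ la i j → Linked _≥_ la → j < partAt la i → PathEnds (hookRimPath la i j) i j (partAt la i ∸ 1)
hookRimPath-ends (x ∷ la) (suc i) j ld lt with hookRimPath-ends la i j (Linked.tail ld) lt
... | record { hd = (r , c) ; tl = tl ; eq = eq ; hdcol = hc ; lastc = lc } =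
  record { hd = (suc r , c) ; tl = shiftDown tl ; eq = cong shiftDown eq ; hdcol = hc ; lastc = trans (lastCell-shiftDown r c tl) (cong (λ z → (suc (proj₁ z) , proj₂ z)) lc) }
hookRimPath-ends (x ∷ la) zero j ld lt with <ᵇ-cases j (partAt la 0)
... | inj₁ (e , lt') rewrite e with hookRimPath-ends la zero j (Linked.tail ld) lt' | rowSegment-ends 0 (partAt la 0 ∸ 1) x (pred< lt' (partAt0≤head ld))
...   | record { hd = (r , c) ; tl = tl ; eq = eq ; hdcol = hc ; lastc = lc } | se , sl =
  record { hd = (suc r , c) ; tl = shiftDown tl ++ _ ; eq = trans (cong (λ z → shiftDown z ++ rowSegment 0 (partAt la 0 ∸ 1) x) eq) (cong ((suc r , c) ∷_) (cong (shiftDown tl ++_) se)) ; hdcol = hc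
         ; lastc = trans (lastCell-++ (suc r , c) (shiftDown tl) _ _) sl }
hookRimPath-ends (x ∷ la) zero j ld lt | inj₂ (e , _) rewrite e with rowSegment-ends 0 j x lt
... | se , sl = record { hd = (0 , j) ; tl = _ ; eq = se ; hdcol = refl ; lastc = sl }

hookRimPath-isPath : ∀ la i j → Linked _≥_ la → j < partAt la i → Linked Step (hookRimPath la i j)
hookRimPath-isPath (x ∷ la) (suc i) j ld lt = shiftDown-isPath _ (hookRimPath-isPath la i j (Linked.tail ld) lt)
hookRimPath-isPath (x ∷ la) zero j ld lt with <ᵇ-cases j (partAt la 0)
... | inj₁ (e , lt') rewrite e with hookRimPath-ends la zero j (Linked.tail ld) lt' | rowSegment-ends 0 (partAt la 0 ∸ 1) x (pred< lt' (partAt0≤head ld)) | hookRimPath-isPath la zero j (Linked.tail ld) lt'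
...   | record { hd = (r , c) ; tl = tl ; eq = eq ; hdcol = hc ; lastc = lc } | se , sl | lk rewrite eq | se =
  path-++ (suc r , c) (shiftDown tl) _ _ (shiftDown-isPath ((r , c) ∷ tl) lk) (subst (Linked Step) se (rowSegmentN-isPath 0 (partAt la 0 ∸ 1) _))
    (subst (λ z → Step z (0 , partAt la 0 ∸ 1)) (sym (trans (lastCell-shiftDown r c tl) (cong (λ z → (suc (proj₁ z) , proj₂ z)) lc))) (inj₂ (refl , refl)))
hookRimPath-isPath (x ∷ la) zero j ld lt | inj₂ (e , _) rewrite e = rowSegmentN-isPath 0 j (x ∸ j)

∈-hookRimPath⇔ : ∀ la i j → Linked _≥_ la → j < partAt la i → ∀ r c → ((r , c) ∈ hookRimPath la i j) ⇔ (hookRemovedPart la i j r ≤ c × c < partAt la r)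
∈-hookRimPath⇔ (x ∷ la) (suc i) j ld lt zero c = mk⇔ (λ m → ⊥-elim (∉-shiftDown-row0 _ c m)) (λ { (a , b) → ⊥-elim (<⇒≱ b a) })
∈-hookRimPath⇔ (x ∷ la) (suc i) j ld lt (suc r) c = mk⇔ (λ m → Equivalence.to (∈-hookRimPath⇔ la i j (Linked.tail ld) lt r c) (Equivalence.to (∈-shiftDown⇔ _ r c) m))
                                                 (λ h → Equivalence.from (∈-shiftDown⇔ _ r c) (Equivalence.from (∈-hookRimPath⇔ la i j (Linked.tail ld) lt r c) h))
∈-hookRimPath⇔ (x ∷ la) zero j ld lt r c with <ᵇ-cases j (partAt la 0)
... | inj₁ (e , lt') rewrite e = go r
  where
  sm = λ r' c' → ∈-rowSegment⇔ 0 (partAt la 0 ∸ 1) x r' c' (<⇒≤ (pred< lt' (partAt0≤head ld)))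
  OnPath Between : ℕ → Set
  OnPath r  = (r , c) ∈ (shiftDown (hookRimPath la zero j) ++ rowSegment 0 (partAt la 0 ∸ 1) x)
  Between r = hookRemovedPart (x ∷ la) zero j r ≤ c × c < partAt (x ∷ la) r
  go : ∀ r → OnPath r ⇔ Between r
  go zero = mk⇔ fw bw
    where
    nz : hookRemovedPart (x ∷ la) zero j zero ≡ partAt la 0 ∸ 1
    nz = hookRemovedPart-inside (x ∷ la) zero j zero z≤n lt'
    fw : OnPath zero → Between zero
    fw m with AnyP.++⁻ (shiftDown (hookRimPath la zero j)) m
    ... | inj₁ m' = ⊥-elim (∉-shiftDown-row0 _ c m')
    ... | inj₂ m' with Equivalence.to (sm 0 c) m'
    ...   | _ , a , b = subst (_≤ c) (sym nz) a , b
    bw : Between zero → OnPath zero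
    bw (a , b) = AnyP.++⁺ʳ (shiftDown (hookRimPath la zero j)) (Equivalence.from (sm 0 c) (refl , subst (_≤ c) nz a , b))
  go (suc r) = mk⇔ fw bw
    where
    fw : OnPath (suc r) → Between (suc r)
    fw m with AnyP.++⁻ (shiftDown (hookRimPath la zero j)) m
    ... | inj₁ m' = Equivalence.to (∈-hookRimPath⇔ la zero j (Linked.tail ld) lt' r c) (Equivalence.to (∈-shiftDown⇔ _ r c) m')
    ... | inj₂ m' with Equivalence.to (sm (suc r) c) m'
    ...   | () , _
    bw : Between (suc r) → OnPath (suc r)
    bw h = AnyP.++⁺ˡ (Equivalence.from (∈-shiftDown⇔ _ r c) (Equivalence.from (∈-hookRimPath⇔ la zero j (Linked.tail ld) lt' r c) h))
... | inj₂ (e , nlt) rewrite e = go r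
  where
  sm = λ r' c' → ∈-rowSegment⇔ 0 j x r' c' (<⇒≤ lt)
  Between : ℕ → Set
  Between r = hookRemovedPart (x ∷ la) zero j r ≤ c × c < partAt (x ∷ la) r
  go : ∀ r → ((r , c) ∈ rowSegment 0 j x) ⇔ Between r
  go zero = mk⇔ (λ m → case (Equivalence.to (sm 0 c) m)) (λ { (a , b) → Equivalence.from (sm 0 c) (refl , subst (_≤ c) nz a , b) })
    where
    nz : hookRemovedPart (x ∷ la) zero j zero ≡ j
    nz = trans (hookRemovedPart-outside (x ∷ la) zero j zero z≤n nlt) (m≤n⇒m⊓n≡m (<⇒≤ lt))
    case : zero ≡ 0 × j ≤ c × c < x → Between zero
    case (_ , a , b) = subst (_≤ c) (sym nz) a , b
  go (suc r) = mk⇔ (λ m → case (Equivalence.to (sm (suc r) c) m)) (λ { (a , b) → ⊥-elim (<⇒≱ b (subst (_≤ c) nz a)) })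
    where
    yle : partAt la 0 ≤ j
    yle = ≮⇒≥ nlt
    nz : hookRemovedPart (x ∷ la) zero j (suc r) ≡ partAt la r
    nz = trans (hookRemovedPart-outside la zero j r z≤n (λ l2 → <⇒≱ l2 (≤-trans (partAt-antitone la (Linked.tail ld) 0 (suc r) z≤n) yle))) (m≥n⇒m⊓n≡n (≤-trans (partAt-antitone la (Linked.tail ld) 0 r z≤n) yle))
    case : suc r ≡ 0 × j ≤ c × c < x → Between (suc r)
    case (() , _)

hookRemovedPart≤ : ∀ la i j → Linked _≥_ la → ∀ r → hookRemovedPart la i j r ≤ partAt la r
hookRemovedPart≤ la i j ld r with r <? i
... | yes lt = ≤-reflexive (hookRemovedPart-above la i j r lt)
... | no nlt with j <? partAt la (suc r)
...   | yes l2 = subst (_≤ partAt la r) (sym (hookRemovedPart-inside la i j r (≮⇒≥ nlt) l2)) (≤-trans (m∸n≤m _ 1) (partAt-antitone la ld r (suc r) (n≤1+n r)))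
...   | no nl2 = subst (_≤ partAt la r) (sym (hookRemovedPart-outside la i j r (≮⇒≥ nlt) nl2)) (m⊓n≤n j (partAt la r))

hookRemovedPart-antitone : ∀ la i j → Linked _≥_ la → ∀ r → hookRemovedPart la i j (suc r) ≤ hookRemovedPart la i j r
hookRemovedPart-antitone la i j ld r with suc r <? i
... | yes lt = subst₂ _≤_ (sym (hookRemovedPart-above la i j (suc r) lt)) (sym (hookRemovedPart-above la i j r (<-trans (n<1+n r) lt))) (partAt-antitone la ld r (suc r) (n≤1+n r))
... | no nlt with r <? i
...   | yes lt = subst (hookRemovedPart la i j (suc r) ≤_) (sym (hookRemovedPart-above la i j r lt)) (≤-trans (hookRemovedPart≤ la i j ld (suc r)) (partAt-antitone la ld r (suc r) (n≤1+n r)))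
...   | no nlt' with j <? partAt la (suc (suc r)) | j <? partAt la (suc r)
...     | yes a | yes b = subst₂ _≤_ (sym (hookRemovedPart-inside la i j (suc r) (≮⇒≥ nlt) a)) (sym (hookRemovedPart-inside la i j r (≮⇒≥ nlt') b)) (∸-monoˡ-≤ 1 (partAt-antitone la ld (suc r) (suc (suc r)) (n≤1+n _)))
...     | yes a | no b = ⊥-elim (b (<-≤-trans a (partAt-antitone la ld (suc r) (suc (suc r)) (n≤1+n _))))
...     | no a | yes b = subst₂ _≤_ (sym (hookRemovedPart-outside la i j (suc r) (≮⇒≥ nlt) a)) (sym (hookRemovedPart-inside la i j r (≮⇒≥ nlt') b)) (≤-trans (m⊓n≤m j _) (pred-mono-≤ b))
...     | no a | no b = subst₂ _≤_ (sym (hookRemovedPart-outside la i j (suc r) (≮⇒≥ nlt) a)) (sym (hookRemovedPart-outside la i j r (≮⇒≥ nlt') b)) (⊓-monoʳ-≤ j (partAt-antitone la ld r (suc r) (n≤1+n r)))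

hookRemovedPart-≥length : ∀ la i j → j < partAt la i → ∀ r → length la ≤ r → hookRemovedPart la i j r ≡ 0
hookRemovedPart-≥length la i j lt r le = trans (hookRemovedPart-outside la i j r ile (λ l2 → <⇒≱ l2 (subst (_≤ j) (sym (partAt-≥length la (suc r) (m≤n⇒m≤1+n le))) z≤n)))
                                  (trans (cong (j ⊓_) (partAt-≥length la r le)) (⊓-zeroʳ j))
  where
  ile : i ≤ r
  ile = ≤-trans (<⇒≤ (partAt-positive⇒<length la i (≤-trans (s≤s z≤n) lt))) le

positivePrefix : (ℕ → ℕ) → ℕ → List ℕ
positivePrefix g zero = []
positivePrefix g (suc L) = if 0 <ᵇ g 0 then g 0 ∷ positivePrefix (g ∘ suc) L else []

antitone : ∀ (g : ℕ → ℕ) → (∀ r → g (suc r) ≤ g r) → ∀ r r' → r ≤ r' → g r' ≤ g r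
antitone g d r r' le with m≤n⇒m<n∨m≡n le
... | inj₂ refl = ≤-refl
... | inj₁ lt = go r r' lt
  where
  go : ∀ r r' → r < r' → g r' ≤ g r
  go r (suc r') (s≤s le') with m≤n⇒m<n∨m≡n le'
  ... | inj₂ refl = d r
  ... | inj₁ lt' = ≤-trans (d r') (go r r' lt')

partAt-positivePrefix : ∀ g L → (∀ r → g (suc r) ≤ g r) → (∀ r → L ≤ r → g r ≡ 0) → ∀ r → partAt (positivePrefix g L) r ≡ g r
partAt-positivePrefix g zero d v r = sym (v r z≤n)
partAt-positivePrefix g (suc L) d v r with <ᵇ-cases 0 (g 0)
... | inj₁ (e , _) rewrite e = go r
  where
  go : ∀ r → partAt (g 0 ∷ positivePrefix (g ∘ suc) L) r ≡ g r
  go zero = refl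
  go (suc r) = partAt-positivePrefix (g ∘ suc) L (d ∘ suc) (λ r' le → v (suc r') (s≤s le)) r
... | inj₂ (e , n) rewrite e = sym (n≤0⇒n≡0 (≤-trans (antitone g d 0 r z≤n) (≮⇒≥ n)))

partAt0-positivePrefix : ∀ g L → partAt (positivePrefix g L) 0 ≤ g 0
partAt0-positivePrefix g zero = z≤n
partAt0-positivePrefix g (suc L) with <ᵇ-cases 0 (g 0)
... | inj₁ (e , _) rewrite e = ≤-refl
... | inj₂ (e , _) rewrite e = z≤n

Linked-∷≥ : ∀ x xs → partAt xs 0 ≤ x → Linked _≥_ xs → Linked _≥_ (x ∷ xs)
Linked-∷≥ x [] _ _ = [-]
Linked-∷≥ x (y ∷ xs) le l = le ∷ l

positivePrefix-shape : ∀ g L → (∀ r → g (suc r) ≤ g r) → IsPartitionShape (positivePrefix g L)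
positivePrefix-shape g zero d = [] , []
positivePrefix-shape g (suc L) d with <ᵇ-cases 0 (g 0)
... | inj₁ (e , lt) rewrite e with positivePrefix-shape (g ∘ suc) L (d ∘ suc)
...   | a , l = (lt ∷ a) , Linked-∷≥ (g 0) _ (≤-trans (partAt0-positivePrefix (g ∘ suc) L) (d 0)) l
positivePrefix-shape g (suc L) d | inj₂ (e , _) rewrite e = [] , []


hookRemoved : List ℕ → ℕ → ℕ → List ℕ
hookRemoved la i j = positivePrefix (hookRemovedPart la i j) (length la)

partAt-hookRemoved : ∀ la i j → Linked _≥_ la → j < partAt la i → ∀ r → partAt (hookRemoved la i j) r ≡ hookRemovedPart la i j r
partAt-hookRemoved la i j ld lt = partAt-positivePrefix (hookRemovedPart la i j) (length la) (hookRemovedPart-antitone la i j ld) (hookRemovedPart-≥length la i j lt)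

hookRemoval : ∀ la → IsPartitionShape la → ∀ i j → j < partAt la i → RimHookRemoval la (hookRemoved la i j) (λ c → c ∈ hookRimPath la i j)
hookRemoval la la-shape i j lt = record
  { la-shape = la-shape
  ; ν-shape = positivePrefix-shape (hookRemovedPart la i j) (length la) (hookRemovedPart-antitone la i j ld)
  ; ν-cells = ν-cells
  ; removed⊆la = removed⊆la
  ; path = hookRimPath la i j
  ; isPath = len , hookRimPath-isPath la i j ld lt , (λ c → mk⇔ id id)
  }
  where
  ld = proj₂ la-shape
  mem = ∈-hookRimPath⇔ la i j ld lt
  atν = partAt-hookRemoved la i j ld lt
  removed⊆la : ∀ c → c ∈ hookRimPath la i j → InDg la c
  removed⊆la (r , c) m = <partAt⇒InDg la r c (proj₂ (Equivalence.to (mem r c) m))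
  ν-cells : ∀ c → InDg (hookRemoved la i j) c ⇔ (InDg la c × ¬ (c ∈ hookRimPath la i j))
  ν-cells (r , c) = mk⇔ fw bw
    where
    fw : InDg (hookRemoved la i j) (r , c) → InDg la (r , c) × ¬ ((r , c) ∈ hookRimPath la i j)
    fw d = <partAt⇒InDg la r c (≤-trans lt' (hookRemovedPart≤ la i j ld r)) , λ m → <⇒≱ lt' (proj₁ (Equivalence.to (mem r c) m))
      where lt' = subst (c <_) (atν r) (InDg⇒<partAt (hookRemoved la i j) r c d)
    bw : InDg la (r , c) × ¬ ((r , c) ∈ hookRimPath la i j) → InDg (hookRemoved la i j) (r , c)
    bw (d , nm) with c <? hookRemovedPart la i j r
    ... | yes l = <partAt⇒InDg (hookRemoved la i j) r c (subst (c <_) (sym (atν r)) l)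
    ... | no nl = ⊥-elim (nm (Equivalence.from (mem r c) (≮⇒≥ nl , InDg⇒<partAt la r c d)))
  len : 1 ≤ length (hookRimPath la i j)
  len with hookRimPath-ends la i j ld lt
  ... | record { hd = hd ; tl = tl ; eq = eq } = subst (λ p → 1 ≤ length p) (sym eq) (s≤s z≤n)


-- Removable rim hooks are hook rim paths

lastCell-∈ : ∀ h qs → lastCell h qs ∈ (h ∷ qs)
lastCell-∈ h [] = here refl
lastCell-∈ h (h' ∷ qs) = there (lastCell-∈ h' qs)

⊑-lastCell : ∀ h qs → Linked Step (h ∷ qs) → ∀ {c} → c ∈ (h ∷ qs) → c ⊑ lastCell h qs
⊑-lastCell h [] _ (here refl) = ⊑-refl h
⊑-lastCell h (h' ∷ qs) (s ∷ l) (here refl) = ⊑-trans (Step⇒⊑ s) (⊑-lastCell h' qs l (here refl))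
⊑-lastCell h (h' ∷ qs) (s ∷ l) (there m) = ⊑-lastCell h' qs l m

head-⊑ : ∀ h qs → Linked Step (h ∷ qs) → ∀ {c} → c ∈ (h ∷ qs) → h ⊑ c
head-⊑ h qs l (here refl) = ⊑-refl h
head-⊑ h qs l (there m) = path-⊑-later l m

path-++ʳ : ∀ xs {zs} → Linked Step (xs ++ zs) → Linked Step zs
path-++ʳ [] l = l
path-++ʳ (x ∷ xs) l = path-++ʳ xs (Linked.tail l)

path-++-⊑ : ∀ xs {zs} → Linked Step (xs ++ zs) → ∀ {u v} → u ∈ xs → v ∈ zs → u ⊑ v
path-++-⊑ (x ∷ xs) l (here refl) mv = path-⊑-later l (AnyP.++⁺ʳ xs mv)
path-++-⊑ (x ∷ xs) l (there mu) mv = path-++-⊑ xs (Linked.tail l) mu mv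

path-crosses-row : ∀ h qs → Linked Step (h ∷ qs) → ∀ r → r < proj₁ h → proj₁ (lastCell h qs) ≤ r →
     Σ (List Cell) λ xs → Σ ℕ λ x → Σ (List Cell) λ ys → h ∷ qs ≡ xs ++ ((suc r , x) ∷ (r , x) ∷ ys)
path-crosses-row h [] _ r lt le = ⊥-elim (<⇒≱ lt le)
path-crosses-row (a , b) ((a' , b') ∷ qs) (inj₁ (refl , refl) ∷ l) r lt le with path-crosses-row (a , suc b) qs l r lt le
... | xs , x , ys , e = (a , b) ∷ xs , x , ys , cong ((a , b) ∷_) e
path-crosses-row (.(suc a') , b) ((a' , .b) ∷ qs) (inj₂ (refl , refl) ∷ l) r lt le with a' Data.Nat.≟ r
... | yes refl = [] , b , qs , refl
... | no ne with path-crosses-row (a' , b) qs l r (≤∧≢⇒< (≤-pred lt) (ne ∘ sym)) le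
...   | xs , x , ys , e = (suc a' , b) ∷ xs , x , ys , cong ((suc a' , b) ∷_) e

∈-++-∷-∷ : ∀ (xs : List Cell) (A B : Cell) (ys : List Cell) {c : Cell} → c ∈ (xs ++ (A ∷ B ∷ ys)) → c ∈ xs ⊎ c ≡ A ⊎ c ≡ B ⊎ c ∈ ys
∈-++-∷-∷ xs A B ys m with AnyP.++⁻ xs m
... | inj₁ m' = inj₁ m'
... | inj₂ (here e) = inj₂ (inj₁ e)
... | inj₂ (there (here e)) = inj₂ (inj₂ (inj₁ e))
... | inj₂ (there (there m')) = inj₂ (inj₂ (inj₂ m'))

-- A path whose cells are exactly those of la ∖ ν, for partitions ν ⊆ la, is the hook rim path of the cell
-- (i0 , j1) in its top row and leftmost column: ν is forced row by row (ν≡hookRemovedPart).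
module RemovableRimHook (la ν : List ℕ) (laD : Linked _≥_ la) (νD : Linked _≥_ ν)
           (ν⊆la : ∀ r → partAt ν r ≤ partAt la r)
           (h : Cell) (qs : List Cell) (lk : Linked Step (h ∷ qs))
           (sup : ∀ r x → (partAt ν r ≤ x × x < partAt la r) ⇔ ((r , x) ∈ (h ∷ qs))) where
  q : List Cell
  q = h ∷ qs
  i1 j1 i0 : ℕ
  i1 = proj₁ h
  j1 = proj₂ h
  i0 = proj₁ (lastCell h qs)

  inS : ∀ {r x} → (r , x) ∈ q → partAt ν r ≤ x × x < partAt la r
  inS {r} {x} m = Equivalence.from (sup r x) m

  toQ : ∀ {r x} → partAt ν r ≤ x → x < partAt la r → (r , x) ∈ q
  toQ {r} {x} a b = Equivalence.to (sup r x) (a , b)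

  rows : ∀ {r x} → (r , x) ∈ q → i0 ≤ r × r ≤ i1
  rows m = proj₁ (⊑-lastCell h qs lk m) , proj₁ (head-⊑ h qs lk m)

  cols : ∀ {r x} → (r , x) ∈ q → j1 ≤ x
  cols m = proj₂ (head-⊑ h qs lk m)

  j1<la-i0 : j1 < partAt la i0
  j1<la-i0 = ≤-<-trans (proj₂ (⊑-lastCell h qs lk (here refl))) (proj₂ (inS (lastCell-∈ h qs)))

  j1<la-i1 : j1 < partAt la i1
  j1<la-i1 = proj₂ (inS (here refl))

  ν≡la-outside : ∀ r → (r < i0 ⊎ i1 < r) → partAt ν r ≡ partAt la r
  ν≡la-outside r out with m≤n⇒m<n∨m≡n (ν⊆la r)
  ... | inj₂ e = e
  ... | inj₁ lt with rows (toQ ≤-refl lt) | out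
  ...   | a , _ | inj₁ o = ⊥-elim (<⇒≱ o a)
  ...   | _ , b | inj₂ o = ⊥-elim (<⇒≱ o b)

  ν-at-headRow : partAt ν i1 ≡ j1
  ν-at-headRow with m≤n⇒m<n∨m≡n (proj₁ (inS (here refl)))
  ... | inj₂ e = e
  ... | inj₁ lt = ⊥-elim (<⇒≱ lt (cols (toQ ≤-refl (<-trans lt j1<la-i1))))

  ν-inside : ∀ r → i0 ≤ r → r < i1 → partAt ν r ≡ partAt la (suc r) ∸ 1
  ν-inside r le lt with path-crosses-row h qs lk r lt le
  ... | xs , x , ys , e = trans νr≡x x≡
    where
    A = (suc r , x)
    B = (r , x)
    lk' : Linked Step (xs ++ (A ∷ B ∷ ys))
    lk' = subst (Linked Step) e lk
    mq : ∀ {c} → c ∈ (xs ++ (A ∷ B ∷ ys)) → c ∈ q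
    mq m = subst (_ ∈_) (sym e) m
    qm : ∀ {c} → c ∈ q → c ∈ (xs ++ (A ∷ B ∷ ys))
    qm m = subst (_ ∈_) e m
    mA : A ∈ q
    mA = mq (AnyP.++⁺ʳ xs (here refl))
    mB : B ∈ q
    mB = mq (AnyP.++⁺ʳ xs (there (here refl)))
    befA : ∀ {u} → u ∈ xs → u ⊑ A
    befA m = path-++-⊑ xs lk' m (here refl)
    aftB : ∀ {v} → v ∈ ys → B ⊑ v
    aftB m = path-⊑-later (Linked.tail (path-++ʳ xs lk')) m
    x<laSr : x < partAt la (suc r)
    x<laSr = proj₂ (inS mA)
    absA : (suc r , suc x) ∈ xs ⊎ (suc r , suc x) ≡ A ⊎ (suc r , suc x) ≡ B ⊎ (suc r , suc x) ∈ ys → ⊥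
    absA (inj₁ m) = <-irrefl refl (proj₂ (befA m))
    absA (inj₂ (inj₁ ()))
    absA (inj₂ (inj₂ (inj₁ ())))
    absA (inj₂ (inj₂ (inj₂ m))) = <-irrefl refl (proj₁ (aftB m))
    x≡ : x ≡ partAt la (suc r) ∸ 1
    x≡ with suc x <? partAt la (suc r)
    ... | no n = sym (cong (_∸ 1) (≤-antisym (≮⇒≥ n) x<laSr))
    ... | yes y = ⊥-elim (absA (∈-++-∷-∷ xs A B ys (qm {c = (suc r , suc x)} (toQ (≤-trans (proj₁ (inS mA)) (n≤1+n x)) y))))
    absB : ∀ {z} → z < x → (r , z) ∈ xs ⊎ (r , z) ≡ A ⊎ (r , z) ≡ B ⊎ (r , z) ∈ ys → ⊥
    absB l2 (inj₁ m) = <-irrefl refl (proj₁ (befA m))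
    absB l2 (inj₂ (inj₁ ()))
    absB l2 (inj₂ (inj₂ (inj₁ refl))) = <-irrefl refl l2
    absB l2 (inj₂ (inj₂ (inj₂ m))) = <⇒≱ l2 (proj₂ (aftB m))
    νr≡x : partAt ν r ≡ x
    νr≡x with m≤n⇒m<n∨m≡n (proj₁ (inS mB))
    ... | inj₂ e' = e'
    ... | inj₁ l2 = ⊥-elim (absB l2 (∈-++-∷-∷ xs A B ys (qm {c = (r , partAt ν r)} (toQ ≤-refl (<-trans l2 (proj₂ (inS mB)))))))

  ν≡hookRemovedPart : ∀ r → partAt ν r ≡ hookRemovedPart la i0 j1 r
  ν≡hookRemovedPart r with r <? i0
  ... | yes lt = trans (ν≡la-outside r (inj₁ lt)) (sym (hookRemovedPart-above la i0 j1 r lt))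
  ... | no nlt with <-cmp r i1
  ...   | tri< a _ _ = trans (ν-inside r (≮⇒≥ nlt) a) (sym (hookRemovedPart-inside la i0 j1 r (≮⇒≥ nlt) (<-≤-trans j1<la-i1 (partAt-antitone la laD (suc r) i1 a))))
  ...   | tri≈ _ refl _ = trans ν-at-headRow (sym (trans (hookRemovedPart-outside la i0 j1 i1 (≮⇒≥ nlt) nope) (m≤n⇒m⊓n≡m (<⇒≤ j1<la-i1))))
    where
    nope : ¬ (j1 < partAt la (suc i1))
    nope l = <⇒≱ l (subst (_≤ j1) (ν≡la-outside (suc i1) (inj₂ ≤-refl)) (subst (partAt ν (suc i1) ≤_) ν-at-headRow (partAt-antitone ν νD i1 (suc i1) (n≤1+n i1))))
  ...   | tri> _ _ c = trans (ν≡la-outside r (inj₂ c)) (sym (trans (hookRemovedPart-outside la i0 j1 r (≮⇒≥ nlt) nope) (m≥n⇒m⊓n≡n (≤-trans (partAt-antitone la laD (suc i1) r c) bound))))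
    where
    bound : partAt la (suc i1) ≤ j1
    bound = subst (_≤ j1) (ν≡la-outside (suc i1) (inj₂ ≤-refl)) (subst (partAt ν (suc i1) ≤_) ν-at-headRow (partAt-antitone ν νD i1 (suc i1) (n≤1+n i1)))
    nope : ¬ (j1 < partAt la (suc r))
    nope l = <⇒≱ l (≤-trans (partAt-antitone la laD (suc i1) (suc r) (≤-trans c (n≤1+n r))) bound)


-- Splitting off the last rim hook together with the last cycle

-- Surv and SurvR without the duplicated tableau and with the content β replaced by cycC σ.
Surv′ : ℕ → List ℕ → Set
Surv′ n la = Sub (List (List ℕ) × Vec (Fin n) n) (λ { (T , σ) → IsPerm n σ × IsRHT la (cycC σ) T })

SurvR′ : ℕ → List ℕ → (Cell → Set) → Set
SurvR′ n la R = Sub (List (List ℕ) × Vec (Fin n) n)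
  (λ { (T , σ) → IsPerm n σ × IsRHT la (cycC σ) T × (∀ c → (entry T c ≡ just (length (cycC σ))) ⇔ R c) })

∷ʳ-view : ∀ (xs : List ℕ) n → sum xs ≡ suc n → Σ (List ℕ) λ γ → Σ ℕ λ b → xs ≡ γ ∷ʳ b
∷ʳ-view xs n sum≡ with L.initLast xs
... | []       = case sum≡ of λ ()
... | γ L.∷ʳ′ b = γ , b , refl

module SplitLastRimHook {la ν : List ℕ} {R : Cell → Set} (H : RimHookRemoval la ν R) (c m : ℕ)
              (eb : length (RimHookRemoval.path H) ≡ suc c) where
  open RimHookRemoval H
  open RemovedRimHook H

  n : ℕ
  n = suc (c + m)
  open LastCycleSplitting (lastCycle↔ c m) renaming (iso to cycle↔; cycC-split to cycC-cycle↔)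

  IsSurvR′ : List (List ℕ) × Vec (Fin n) n → Set
  IsSurvR′ (T , σ) = IsPerm n σ × IsRHT la (cycC σ) T × (∀ c → (entry T c ≡ just (length (cycC σ))) ⇔ R c)

  record LastPart (T : List (List ℕ)) (σ : Vec (Fin n) n) : Set where
    field
      γ : List ℕ
      eσ : cycC σ ≡ γ ∷ʳ suc c
      HT : IsRHT la (γ ∷ʳ suc c) T
      hl : ∀ c → (entry T c ≡ just (suc (length γ))) ⇔ R c

  lastPart : ∀ T σ → IsSurvR′ (T , σ) → LastPart T σ
  lastPart T σ (ip , hT , hl) with ∷ʳ-view (cycC σ) (c + m) (proj₂ (cycC-isComposition n σ ip))
  ... | γ , b′ , e = record { γ = γ ; eσ = eσ ; HT = subst (λ β → IsRHT la β T) eσ hT ; hl = hl' }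
    where
    hl' : ∀ c → (entry T c ≡ just (suc (length γ))) ⇔ R c
    hl' c = subst (λ z → (entry T c ≡ just z) ⇔ R c) (trans (cong length e) (length-∷ʳ γ b′)) (hl c)
    b′≡ : b′ ≡ suc c
    b′≡ = trans (Restrict.lastPart≡hookSize γ b′ T (subst (λ β → IsRHT la β T) e hT) hl') eb
    eσ : cycC σ ≡ γ ∷ʳ suc c
    eσ = trans e (cong (γ ∷ʳ_) b′≡)

  permOf : ∀ T σ → .(IsSurvR′ (T , σ)) → PermLastCycle n (suc c)
  permOf T σ p = ⟨ σ , (proj₁ p , LastPart.γ (lastPart T σ p) , LastPart.eσ (lastPart T σ p)) ⟩

  restrict-isRHT : ∀ T σ (p : IsSurvR′ (T , σ)) → IsRHT ν (cycC (val (proj₂ (Inverse.to cycle↔ (permOf T σ p))))) (restrict ν T)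
  restrict-isRHT T σ p = subst (λ β → IsRHT ν β (restrict ν T)) γ≡ (Restrict.isRHT γ (suc c) T HT hl)
    where
    open LastPart (lastPart T σ p)
    γ≡ : γ ≡ cycC (val (proj₂ (Inverse.to cycle↔ (permOf T σ p))))
    γ≡ = LP.∷ʳ-injectiveˡ γ _ (trans (sym eσ) (cycC-cycle↔ (permOf T σ p)))

  mkSurv′ : (s : Perm m) (T′ : List (List ℕ)) → .(IsRHT ν (cycC (val s)) T′) → Surv′ m ν
  mkSurv′ ⟨ τ , q ⟩ T′ h = ⟨ (T′ , τ) , (q , h) ⟩

  to : SurvR′ n la R → Fin (fallingFactorial (c + m) c) × Surv′ m ν
  to ⟨ (T , σ) , p ⟩ = proj₁ (Inverse.to cycle↔ (permOf T σ p)) , mkSurv′ (proj₂ (Inverse.to cycle↔ (permOf T σ p))) (restrict ν T) (restrict-isRHT T σ p)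

  cycC-from : ∀ w → cycC (val (Inverse.from cycle↔ w)) ≡ cycC (val (proj₂ w)) ∷ʳ suc c
  cycC-from w = trans (cycC-cycle↔ (Inverse.from cycle↔ w)) (cong (λ z → cycC (val (proj₂ z)) ∷ʳ suc c) (Inverse.strictlyInverseˡ cycle↔ w))

  extend-isSurvR′ : ∀ f τ .q T′ (rht′ : IsRHT ν (cycC τ) T′) → IsRHT la (cycC (val (Inverse.from cycle↔ (f , ⟨ τ , q ⟩)))) (extend ν T′ (suc (length (cycC τ))) la)
                × (∀ c' → (entry (extend ν T′ (suc (length (cycC τ))) la) c' ≡ just (length (cycC (val (Inverse.from cycle↔ (f , ⟨ τ , q ⟩)))))) ⇔ R c')
  extend-isSurvR′ f τ q T′ rht′ =
      subst (λ β → IsRHT la β U) (sym eσ) (subst (λ z → IsRHT la (cycC τ ∷ʳ z) U) eb (Extend.isRHT (cycC τ) T′ rht′)) ,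
      λ c' → subst (λ z → (entry U c' ≡ just z) ⇔ R c') (sym (trans (cong length eσ) (length-∷ʳ (cycC τ) (suc c)))) (Extend.lastLabel⇔R (cycC τ) T′ rht′ c')
    where
    U = extend ν T′ (suc (length (cycC τ))) la
    eσ = cycC-from (f , ⟨ τ , q ⟩)

  mkSurvR′ : (z : PermLastCycle n (suc c)) (T : List (List ℕ)) → .(IsRHT la (cycC (val z)) T × (∀ c' → (entry T c' ≡ just (length (cycC (val z)))) ⇔ R c')) → SurvR′ n la R
  mkSurvR′ ⟨ σ , q ⟩ T h = ⟨ (T , σ) , (proj₁ q , proj₁ h , proj₂ h) ⟩

  from : Fin (fallingFactorial (c + m) c) × Surv′ m ν → SurvR′ n la R
  from (f , ⟨ (T′ , τ) , pr ⟩) = mkSurvR′ (Inverse.from cycle↔ (f , ⟨ τ , proj₁ pr ⟩)) (extend ν T′ (suc (length (cycC τ))) la) (extend-isSurvR′ f τ (proj₁ pr) T′ (proj₂ pr))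

  ×-Sub≡ : ∀ {A B : Set} {P : B → Set} (u v : A × Sub B P) → proj₁ u ≡ proj₁ v → val (proj₂ u) ≡ val (proj₂ v) → u ≡ v
  ×-Sub≡ (a , ⟨ x , _ ⟩) (.a , ⟨ .x , _ ⟩) refl refl = refl

  to∘from : ∀ w → to (from w) ≡ w
  to∘from (f , ⟨ (T′ , τ) , pr ⟩) = ×-Sub≡ (to (from (f , ⟨ (T′ , τ) , pr ⟩))) (f , ⟨ (T′ , τ) , pr ⟩)
     (cong proj₁ e)
     (cong₂ _,_ (irrEq (LP.≡-dec (LP.≡-dec Data.Nat._≟_)) (Extend.restrict-extend (cycC τ) T′ (proj₂ pr))) (cong (λ y → val (proj₂ y)) e))
    where
    e = Inverse.strictlyInverseˡ cycle↔ (f , ⟨ τ , proj₁ pr ⟩)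

  extend-restrict′ : ∀ T σ (p : IsSurvR′ (T , σ)) → extend ν (restrict ν T) (suc (length (cycC (val (proj₂ (Inverse.to cycle↔ (permOf T σ p))))))) la ≡ T
  extend-restrict′ T σ p = sym (trans (Restrict.extend-restrict γ (suc c) T HT hl) (cong (λ g → extend ν (restrict ν T) (suc (length g)) la) γ≡))
    where
    open LastPart (lastPart T σ p)
    γ≡ : γ ≡ cycC (val (proj₂ (Inverse.to cycle↔ (permOf T σ p))))
    γ≡ = LP.∷ʳ-injectiveˡ γ _ (trans (sym eσ) (cycC-cycle↔ (permOf T σ p)))

  from∘to : ∀ z → from (to z) ≡ z
  from∘to ⟨ (T , σ) , p ⟩ = Sub≡ (cong₂ _,_ (irrEq (LP.≡-dec (LP.≡-dec Data.Nat._≟_)) (extend-restrict′ T σ p)) (cong val (Inverse.strictlyInverseʳ cycle↔ (permOf T σ p))))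

  iso : SurvR′ n la R ↔ (Fin (fallingFactorial (c + m) c) × Surv′ m ν)
  iso = mk↔ₛ′ to from to∘from from∘to


-- Sorting tableaux by their last rim hook

_⇔-dec_ : ∀ {A B : Set} → Dec A → Dec B → Dec (A ⇔ B)
a ⇔-dec b with a →-dec b | b →-dec a
... | yes f | yes g = yes (mk⇔ f g)
... | no nf | _ = no (λ e → nf (Equivalence.to e))
... | _ | no ng = no (λ e → ng (Equivalence.from e))

module HookCells (la : List ℕ) (la-shape : IsPartitionShape la) where
  laD : Linked _≥_ la
  laD = proj₂ la-shape

  hookAt : Cell → List Cell
  hookAt c = hookRimPath la (proj₁ c) (proj₂ c)

  module LastRimHook (γ : List ℕ) (b' : ℕ) (T : List (List ℕ)) (HT : IsRHT la (γ ∷ʳ b') T) where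
    l : ℕ
    l = suc (length γ)
    LastLabel : Cell → Set
    LastLabel c = entry T c ≡ just l

    shape-T : map length T ≡ la
    shape-T = proj₁ HT
    length-rowOf-T : ∀ i → length (rowOf T i) ≡ partAt la i
    length-rowOf-T i = trans (length-rowOf T i) (cong (λ z → partAt z i) shape-T)

    entry⇒inla : ∀ i j v → entry T (i , j) ≡ just v → j < partAt la i
    entry⇒inla i j v e = subst (j <_) (length-rowOf-T i) (lookupM-just⇒<length (rowOf T i) j v (trans (sym (entry-rowOf T i j)) e))

    inla⇒entry : ∀ i j → j < partAt la i → Σ ℕ λ v → entry T (i , j) ≡ just v
    inla⇒entry i j lt with <length⇒lookupM-just (rowOf T i) j (subst (j <_) (sym (length-rowOf-T i)) lt)
    ... | v , e = v , trans (entry-rowOf T i j) e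

    labels-bounded : ∀ c v → entry T c ≡ just v → 1 ≤ v × v ≤ l
    labels-bounded c v e = proj₁ (proj₁ (proj₂ HT) c v e) , subst (v ≤_) (length-∷ʳ γ b') (proj₂ (proj₁ (proj₂ HT) c v e))

    lowerLabels⇔ : ∀ c → LabelAtMost T (length γ) c ⇔ (InDg la c × ¬ LastLabel c)
    lowerLabels⇔ (i , j) = mk⇔ fw bw
      where
      fw : LabelAtMost T (length γ) (i , j) → InDg la (i , j) × ¬ LastLabel (i , j)
      fw (v , e , a , b) = <partAt⇒InDg la i j (entry⇒inla i j v e) , λ e' → <-irrefl (MP.just-injective (trans (sym e) e')) (s≤s b)
      bw : InDg la (i , j) × ¬ LastLabel (i , j) → LabelAtMost T (length γ) (i , j)
      bw (d , nl) with inla⇒entry i j (InDg⇒<partAt la i j d)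
      ... | v , e with m≤n⇒m<n∨m≡n (proj₂ (labels-bounded _ v e))
      ...   | inj₁ (s≤s le) = v , e , proj₁ (labels-bounded _ v e) , le
      ...   | inj₂ refl = ⊥-elim (nl e)

    lowerShape : Σ (List ℕ) λ ν → IsPartitionShape ν × (∀ c → InDg ν c ⇔ (InDg la c × ¬ LastLabel c))
    lowerShape = go γ refl
     where
     go : ∀ g → γ ≡ g → Σ (List ℕ) λ ν → IsPartitionShape ν × (∀ c → InDg ν c ⇔ (InDg la c × ¬ LastLabel c))
     go [] eqγ = [] , ([] , []) , λ c → mk⇔ (λ { (r , () , _) }) (λ d → ⊥-elim (proj₂ d (all-l d)))
      where
      all-l : ∀ {c} → InDg la c × ¬ LastLabel c → LastLabel c
      all-l {(i , j)} (d , nl) with inla⇒entry i j (InDg⇒<partAt la i j d)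
      ... | v , e with labels-bounded _ v e
      ...   | a , b = subst (λ z → entry T (i , j) ≡ just z) (≤-antisym b (subst (_≤ v) (cong (λ g → suc (length g)) (sym eqγ)) a)) e
     go (x ∷ γ') eqγ with lookup-∷ʳ-inject γ b' (subst (λ g → Fin (length g)) (sym eqγ) (F.fromℕ (length γ')))
     ...   | k , e1 , e2 with proj₂ (proj₂ (proj₂ HT)) k
     ...     | ν , sh , ν⇔labels≤ = ν , sh , λ c → mk⇔ (λ d → Equivalence.to (lowerLabels⇔ c) (fix c (Equivalence.from (ν⇔labels≤ c) d))) (λ h → Equivalence.to (ν⇔labels≤ c) (unfix c (Equivalence.from (lowerLabels⇔ c) h)))
       where
       tk : suc (toℕ k) ≡ length γ
       tk = trans (cong suc e1) (trans (cong suc (lem (sym eqγ))) (cong length (sym eqγ)))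
         where
         lem : ∀ {g} (p : x ∷ γ' ≡ g) → toℕ (subst (λ g → Fin (length g)) p (F.fromℕ (length γ'))) ≡ length γ'
         lem refl = FP.toℕ-fromℕ (length γ')
       fix : ∀ c → LabelAtMost T (suc (toℕ k)) c → LabelAtMost T (length γ) c
       fix c (v , e , a , b) = v , e , a , subst (v ≤_) tk b
       unfix : ∀ c → LabelAtMost T (length γ) c → LabelAtMost T (suc (toℕ k)) c
       unfix c (v , e , a , b) = v , e , a , subst (v ≤_) (sym tk) b

    ν : List ℕ
    ν = proj₁ lowerShape
    ν-shape : IsPartitionShape ν
    ν-shape = proj₁ (proj₂ lowerShape)
    ν-cells : ∀ c → InDg ν c ⇔ (InDg la c × ¬ LastLabel c)
    ν-cells = proj₂ (proj₂ lowerShape)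

    LastLabel? : ∀ c → Dec (LastLabel c)
    LastLabel? c = MP.≡-dec Data.Nat._≟_ (entry T c) (just l)

    ν⊆la : ∀ r → partAt ν r ≤ partAt la r
    ν⊆la r with partAt la r <? partAt ν r
    ... | no n = ≮⇒≥ n
    ... | yes lt = ⊥-elim (<-irrefl refl (InDg⇒<partAt la r _ (proj₁ (Equivalence.to (ν-cells (r , partAt la r)) (<partAt⇒InDg ν r _ lt)))))

    isHookRimPath : Σ Cell λ c → (proj₂ c < partAt la (proj₁ c)) × (∀ c' → LastLabel c' ⇔ (c' ∈ hookAt c))
    isHookRimPath with lookup-∷ʳ-last γ b'
    ... | k , e1 , e2 with proj₁ (proj₂ (proj₂ HT)) k
    ...   | [] , (() , _) , _
    ...   | (h ∷ qs) , (_ , lk , suppq) , _ = (Removable.i0 , Removable.j1) , Removable.j1<la-i0 , LastLabel⇔hook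
      where
      LastLabel⇔path : ∀ c → LastLabel c ⇔ (c ∈ (h ∷ qs))
      LastLabel⇔path c = mk⇔ (λ e → Equivalence.to (suppq c) (subst (λ z → entry T c ≡ just (suc z)) (sym e1) e))
                    (λ m → subst (λ z → entry T c ≡ just (suc z)) e1 (Equivalence.from (suppq c) m))
      between⇔path : ∀ r x → (partAt ν r ≤ x × x < partAt la r) ⇔ ((r , x) ∈ (h ∷ qs))
      between⇔path r x = mk⇔ fw bw
        where
        fw : partAt ν r ≤ x × x < partAt la r → (r , x) ∈ (h ∷ qs)
        fw (a , b) with LastLabel? (r , x)
        ... | yes e = Equivalence.to (LastLabel⇔path _) e
        ... | no ne = ⊥-elim (<⇒≱ (InDg⇒<partAt ν r x (Equivalence.from (ν-cells (r , x)) (<partAt⇒InDg la r x b , ne))) a)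
        bw : (r , x) ∈ (h ∷ qs) → partAt ν r ≤ x × x < partAt la r
        bw m = ≮⇒≥ (λ lt → proj₂ (Equivalence.to (ν-cells (r , x)) (<partAt⇒InDg ν r x lt)) e) , entry⇒inla r x l e
          where e = Equivalence.from (LastLabel⇔path _) m
      module Removable = RemovableRimHook la ν laD (proj₂ ν-shape) ν⊆la h qs lk between⇔path
      LastLabel⇔hook : ∀ c' → LastLabel c' ⇔ (c' ∈ hookAt (Removable.i0 , Removable.j1))
      LastLabel⇔hook (r , x) = mk⇔ (λ e → Equivalence.from (∈-hookRimPath⇔ la Removable.i0 Removable.j1 laD Removable.j1<la-i0 r x) (conv (Equivalence.from (between⇔path r x) (Equivalence.to (LastLabel⇔path _) e))))
                        (λ m → Equivalence.from (LastLabel⇔path _) (Equivalence.to (between⇔path r x) (unconv (Equivalence.to (∈-hookRimPath⇔ la Removable.i0 Removable.j1 laD Removable.j1<la-i0 r x) m))))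
        where
        conv : partAt ν r ≤ x × x < partAt la r → hookRemovedPart la Removable.i0 Removable.j1 r ≤ x × x < partAt la r
        conv (a , b) = subst (_≤ x) (Removable.ν≡hookRemovedPart r) a , b
        unconv : hookRemovedPart la Removable.i0 Removable.j1 r ≤ x × x < partAt la r → partAt ν r ≤ x × x < partAt la r
        unconv (a , b) = subst (_≤ x) (sym (Removable.ν≡hookRemovedPart r)) a , b

  hookAt⊆la : ∀ c → proj₂ c < partAt la (proj₁ c) → ∀ c' → c' ∈ hookAt c → proj₂ c' < partAt la (proj₁ c')
  hookAt⊆la (i , j) lt (r , x) m = proj₂ (Equivalence.to (∈-hookRimPath⇔ la i j laD lt r x) m)

  hookAt-injective : ∀ c1 c2 → proj₂ c1 < partAt la (proj₁ c1) → proj₂ c2 < partAt la (proj₁ c2) → (∀ c' → (c' ∈ hookAt c1) ⇔ (c' ∈ hookAt c2)) → c1 ≡ c2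
  hookAt-injective (i1 , j1) (i2 , j2) lt1 lt2 h with hookRimPath-ends la i1 j1 laD lt1 | hookRimPath-ends la i2 j2 laD lt2
                                           | path-unique (hookAt (i1 , j1)) (hookAt (i2 , j2)) (hookRimPath-isPath la i1 j1 laD lt1) (hookRimPath-isPath la i2 j2 laD lt2) (λ c m → Equivalence.to (h c) m) (λ c m → Equivalence.from (h c) m)
  ... | record { hd = hd1 ; tl = tl1 ; eq = eq1 ; hdcol = hc1 ; lastc = lc1 } | record { hd = hd2 ; tl = tl2 ; eq = eq2 ; hdcol = hc2 ; lastc = lc2 } | e
    with trans (sym eq1) (trans e eq2)
  ... | refl = cong₂ _,_ (cong proj₁ (trans (sym lc1) lc2)) (trans (sym hc1) hc2)

  cellAt : Fin (sum la) → Cells la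
  cellAt g = Inverse.from (Cells↔Fin la) g

  LastLabelAt : List (List ℕ) → ℕ → Cell → Set
  LastLabelAt T l c = ∀ g → (entry T (val (cellAt g)) ≡ just l) ⇔ (val (cellAt g) ∈ hookAt c)

  LastLabelAt? : ∀ T l c → Dec (LastLabelAt T l c)
  LastLabelAt? T l c = FP.all? (λ g → MP.≡-dec Data.Nat._≟_ (entry T (val (cellAt g))) (just l) ⇔-dec _∈?_ _≟C_ (val (cellAt g)) (hookAt c))

  -- Checking the cells of la suffices: the entries of a filling of shape la lie in la.
  LastLabelAt⇒⇔ : ∀ T l c → map length T ≡ la → .(proj₂ c < partAt la (proj₁ c)) → LastLabelAt T l c → ∀ c' → (entry T c' ≡ just l) ⇔ (c' ∈ hookAt c)
  LastLabelAt⇒⇔ T l c shape-T ltc M (r , x) with x <? partAt la r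
  ... | yes lt = subst (λ z → (entry T z ≡ just l) ⇔ (z ∈ hookAt c)) eqc (M g)
    where
    g = Inverse.to (Cells↔Fin la) ⟨ (r , x) , lt ⟩
    eqc : val (cellAt g) ≡ (r , x)
    eqc = cong val (Inverse.strictlyInverseʳ (Cells↔Fin la) ⟨ (r , x) , lt ⟩)
  ... | no nlt = mk⇔ (λ e → ⊥-elim (nlt (subst (x <_) (trans (length-rowOf T r) (cong (λ z → partAt z r) shape-T)) (lookupM-just⇒<length (rowOf T r) x l (trans (sym (entry-rowOf T r x)) e)))))
                     (λ m → ⊥-elim-irr (nlt (hookAt⊆la c ltc (r , x) m)))

  lastLabel-hook : ∀ γ b' T → IsRHT la (γ ∷ʳ b') T → Σ (Fin (sum la)) λ g → LastLabelAt T (suc (length γ)) (val (cellAt g))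
  lastLabel-hook γ b' T HT with LastRimHook.isHookRimPath γ b' T HT
  ... | c , lt , full = g , subst (LastLabelAt T (suc (length γ))) (sym eqc) (λ g' → full (val (cellAt g')))
    where
    g = Inverse.to (Cells↔Fin la) ⟨ c , lt ⟩
    eqc : val (cellAt g) ≡ c
    eqc = cong val (Inverse.strictlyInverseʳ (Cells↔Fin la) ⟨ c , lt ⟩)

  -- The existence proof is irrelevant (it comes from the proof field of a Sub), so the cell is recomputed by findHook.
  findHook : ∀ T l → .(Σ (Fin (sum la)) λ g → LastLabelAt T l (val (cellAt g))) → Σ (Fin (sum la)) λ g → LastLabelAt T l (val (cellAt g))
  findHook T l found with FP.any? (λ g → LastLabelAt? T l (val (cellAt g)))
  ... | yes r = r
  ... | no nr = ⊥-elim-irr (nr found)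

  module ByLastRimHook (n' : ℕ) where
    n : ℕ
    n = suc n'
    R : Cells la → Cell → Set
    R cs c' = c' ∈ hookAt (val cs)

    lastHook-exists : ∀ T (σ : Vec (Fin n) n) → IsPerm n σ × IsRHT la (cycC σ) T → Σ (Fin (sum la)) λ g → LastLabelAt T (length (cycC σ)) (val (cellAt g))
    lastHook-exists T σ (ip , hT) with ∷ʳ-view (cycC σ) n' (proj₂ (cycC-isComposition n σ ip))
    ... | γ , b' , e = subst (λ z → Σ (Fin (sum la)) λ g → LastLabelAt T z (val (cellAt g))) (sym (trans (cong length e) (length-∷ʳ γ b')))
                         (lastLabel-hook γ b' T (subst (λ β → IsRHT la β T) e hT))

    withLastHook : (cs : Cells la) (T : List (List ℕ)) (σ : Vec (Fin n) n) → .(IsPerm n σ) → .(IsRHT la (cycC σ) T) → .(LastLabelAt T (length (cycC σ)) (val cs)) → SurvR′ n la (R cs)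
    withLastHook ⟨ c , lt ⟩ T σ ip hT M = ⟨ (T , σ) , (ip , hT , LastLabelAt⇒⇔ T _ c (proj₁ hT) lt M) ⟩

    to : Surv′ n la → Σ (Cells la) (λ cs → SurvR′ n la (R cs))
    to ⟨ (T , σ) , p ⟩ = cellAt (proj₁ s) , withLastHook (cellAt (proj₁ s)) T σ (proj₁ p) (proj₂ p) (proj₂ s)
      where s = findHook T (length (cycC σ)) (lastHook-exists T σ p)

    from : Σ (Cells la) (λ cs → SurvR′ n la (R cs)) → Surv′ n la
    from (cs , ⟨ (T , σ) , pr ⟩) = ⟨ (T , σ) , (proj₁ pr , proj₁ (proj₂ pr)) ⟩

    sameHook⇒sameCell : (c1 c2 : Cells la) → .(∀ c' → (c' ∈ hookAt (val c1)) ⇔ (c' ∈ hookAt (val c2))) → val c1 ≡ val c2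
    sameHook⇒sameCell ⟨ a , p1 ⟩ ⟨ b , p2 ⟩ h = irrEq _≟C_ (hookAt-injective a b p1 p2 h)

    LastLabelAt⇒⇔′ : (cs : Cells la) → ∀ T l → map length T ≡ la → LastLabelAt T l (val cs) → ∀ c' → (entry T c' ≡ just l) ⇔ (c' ∈ hookAt (val cs))
    LastLabelAt⇒⇔′ ⟨ c , lt ⟩ T l shape-T M = LastLabelAt⇒⇔ T l c shape-T lt M

    ΣSub≡ : ∀ (c1 c2 : Cells la) {v} .{p1 p2} → val c1 ≡ val c2 → _≡_ {A = Σ (Cells la) (λ cs → SurvR′ n la (R cs))} (c1 , ⟨ v , p1 ⟩) (c2 , ⟨ v , p2 ⟩)
    ΣSub≡ ⟨ a , _ ⟩ ⟨ .a , _ ⟩ refl = refl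

    to∘from : ∀ w → to (from w) ≡ w
    to∘from (cs , ⟨ (T , σ) , pr ⟩) = ΣSub≡ (cellAt (proj₁ s)) cs (sameHook⇒sameCell (cellAt (proj₁ s)) cs (h pr))
      where
      s = findHook T (length (cycC σ)) (lastHook-exists T σ (proj₁ pr , proj₁ (proj₂ pr)))
      h : (pr : IsPerm n σ × IsRHT la (cycC σ) T × (∀ c' → (entry T c' ≡ just (length (cycC σ))) ⇔ R cs c')) → ∀ c' → (c' ∈ hookAt (val (cellAt (proj₁ s)))) ⇔ (c' ∈ hookAt (val cs))
      h pr c' = mk⇔ (λ m → Equivalence.to (proj₂ (proj₂ pr) c') (Equivalence.from (LastLabelAt⇒⇔′ (cellAt (proj₁ s)) T _ (proj₁ (proj₁ (proj₂ pr))) (proj₂ s) c') m))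
                 (λ m → Equivalence.to (LastLabelAt⇒⇔′ (cellAt (proj₁ s)) T _ (proj₁ (proj₁ (proj₂ pr))) (proj₂ s) c') (Equivalence.from (proj₂ (proj₂ pr) c') m))

    iso : Surv′ n la ↔ Σ (Cells la) (λ cs → SurvR′ n la (R cs))
    iso = mk↔ₛ′ to from to∘from (λ _ → refl)


-- The count

Σ-const↔ : ∀ {A : Set} {B : A → Set} {C : Set} → (∀ a → B a ↔ C) → Σ A B ↔ (A × C)
Σ-const↔ {A} {B} {C} B↔C = mk↔ₛ′ to from
  (λ { (a , c) → cong (a ,_) (Inverse.strictlyInverseˡ (B↔C a) c) })
  (λ { (a , b) → cong (a ,_) (Inverse.strictlyInverseʳ (B↔C a) b) })
  where
  to : Σ A B → A × C
  to (a , b) = a , Inverse.to (B↔C a) b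
  from : A × C → Σ A B
  from (a , c) = a , Inverse.from (B↔C a) c

Fin-cong : ∀ {a b} → a ≡ b → Fin a ↔ Fin b
Fin-cong refl = ↔-refl

IsPartition⇒shape : ∀ {n la} → IsPartition n la → IsPartitionShape la
IsPartition⇒shape ((positive , _) , decreasing) = positive , decreasing

Surv′-zero↔ : ∀ la → IsPartition 0 la → Surv′ 0 la ↔ Fin (0 !)
Surv′-zero↔ [] _ = mk↔ₛ′ (λ _ → F.zero) (λ _ → empty) (λ { F.zero → refl ; (F.suc ()) }) empty-unique
  where
  empty : Surv′ 0 []
  empty = ⟨ ([] , V.[]) , ((λ ()) , refl , (λ { _ _ () }) , (λ ()) , (λ ())) ⟩
  shape-[] : ∀ (T : List (List ℕ)) → map length T ≡ [] → [] ≡ T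
  shape-[] [] _ = refl
  empty-unique : ∀ z → empty ≡ z
  empty-unique ⟨ (T , V.[]) , p ⟩ = Sub≡ (cong (_, V.[]) (irrEq (LP.≡-dec (LP.≡-dec Data.Nat._≟_)) (shape-[] T (proj₁ (proj₂ p)))))
Surv′-zero↔ (x ∷ la) ((x≥1 ∷ _ , sum≡0) , _) = ⊥-elim (<⇒≱ (≤-trans x≥1 (m≤m+n x (sum la))) (≤-reflexive sum≡0))

-- The inductive step, for sizes up to N: removing the last rim hook R (of size c + 1) leaves
-- fallingFactorial (c + m) c choices for the cycle of 0 times the m! survivors of the smaller shape.
module _ (N : ℕ) (IH : ∀ m → m ≤ N → ∀ ν → IsPartition m ν → Surv′ m ν ↔ Fin (m !)) where

  SurvR′↔Fin : ∀ {n la ν R} → RimHookRemoval la ν R → sum la ≡ suc n → n ≤ N → SurvR′ (suc n) la R ↔ Fin (n !)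
  SurvR′↔Fin {n} {la} {ν} {R} H sum≡ n≤N = subst (λ k → SurvR′ (suc k) la R ↔ Fin (k !)) (sym n≡c+m) split
    where
    open RimHookRemoval H
    m = sum ν
    c = length path ∸ 1
    |R|≡ : length path ≡ suc c
    |R|≡ = sym (m+[n∸m]≡n (proj₁ isPath))
    n≡c+m : n ≡ c + m
    n≡c+m = suc-injective (begin
      suc n            ≡⟨ sym sum≡ ⟩
      sum la           ≡⟨ sum-removal H ⟩
      m + length path  ≡⟨ cong (m +_) |R|≡ ⟩
      m + suc c        ≡⟨ +-suc m c ⟩
      suc (m + c)      ≡⟨ cong suc (+-comm m c) ⟩
      suc (c + m)      ∎)
      where open ≡-Reasoning
    m≤N : m ≤ N
    m≤N = ≤-trans (subst (m ≤_) (sym n≡c+m) (m≤n+m m c)) n≤N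
    split : SurvR′ (suc (c + m)) la R ↔ Fin ((c + m) !)
    split = ↔-trans (SplitLastRimHook.iso H c m |R|≡)
           (↔-trans (↔-refl ×-↔ IH m m≤N ν ((proj₁ ν-shape , refl) , proj₂ ν-shape))
           (↔-trans (↔-sym FP.*↔×) (Fin-cong (fallingFactorial-* c m))))

-- Each cell of la contributes (n - 1)! survivors: those whose last rim hook is the hook rim path of that cell.
Surv′↔Fin : ∀ N n → n ≤ N → ∀ la → IsPartition n la → Surv′ n la ↔ Fin (n !)
Surv′↔Fin N       zero    _         la la⊢0 = Surv′-zero↔ la la⊢0
Surv′↔Fin (suc N) (suc n) (s≤s n≤N) la la⊢n =
  ↔-trans (HookCells.ByLastRimHook.iso la la-shape n)
  (↔-trans (Σ-const↔ fibre)
  (↔-trans (Cells↔Fin la ×-↔ ↔-refl)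
  (↔-trans (Fin-cong (proj₂ (proj₁ la⊢n)) ×-↔ ↔-refl)
  (↔-sym FP.*↔×))))
  where
  la-shape = IsPartition⇒shape la⊢n
  fibre : ∀ cs → SurvR′ (suc n) la (HookCells.ByLastRimHook.R la la-shape n cs) ↔ Fin (n !)
  fibre ⟨ (i , j) , j< ⟩ = SurvR′↔Fin N (Surv′↔Fin N) (hookRemoval la la-shape i j (recompute (j <? partAt la i) j<)) (proj₂ (proj₁ la⊢n)) n≤N

CS↔Fin : ∀ n → CS n ↔ Fin (n !)
CS↔Fin zero    = mk↔ₛ′ (λ _ → F.zero) (λ _ → ⟨ V.[] , (λ ()) ⟩) (λ { F.zero → refl ; (F.suc ()) }) (λ { ⟨ V.[] , _ ⟩ → refl })
CS↔Fin (suc n) = ↔-trans headTail (↔-trans (↔-refl ×-↔ CS↔Fin n) (↔-sym FP.*↔×))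
  where
  InRange : ∀ k → Vec ℕ k → Set
  InRange k v = ∀ (i : Fin k) → 1 ≤ V.lookup v i × V.lookup v i ≤ k ∸ toℕ i
  x∸1<1+n : ∀ x → 1 ≤ x → x ≤ suc n → x ∸ 1 < suc n
  x∸1<1+n (suc x) _ x≤ = x≤
  to : CS (suc n) → Fin (suc n) × CS n
  to ⟨ x V.∷ v , p ⟩ = F.fromℕ< (x∸1<1+n x (proj₁ (p F.zero)) (proj₂ (p F.zero))) , ⟨ v , (λ i → p (F.suc i)) ⟩
  cons-inRange : ∀ (f : Fin (suc n)) v → InRange n v → InRange (suc n) (suc (toℕ f) V.∷ v)
  cons-inRange f v p F.zero    = s≤s z≤n , FP.toℕ<n f
  cons-inRange f v p (F.suc i) = p i
  from : Fin (suc n) × CS n → CS (suc n)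
  from (f , ⟨ v , p ⟩) = ⟨ suc (toℕ f) V.∷ v , cons-inRange f v p ⟩
  to∘from : ∀ w → to (from w) ≡ w
  to∘from (f , ⟨ v , p ⟩) = cong (_, ⟨ v , p ⟩) (FP.fromℕ<-toℕ f (FP.toℕ<n f))
  suc-pred′ : ∀ x → 1 ≤ x → suc (x ∸ 1) ≡ x
  suc-pred′ (suc x) _ = refl
  from∘to : ∀ z → from (to z) ≡ z
  from∘to ⟨ x V.∷ v , p ⟩ = Sub≡ (cong (V._∷ v) (trans (cong suc (FP.toℕ-fromℕ< _)) (irrEq Data.Nat._≟_ (suc-pred′ x (proj₁ (p F.zero))))))
  headTail : CS (suc n) ↔ (Fin (suc n) × CS n)
  headTail = mk↔ₛ′ to from to∘from from∘to

Surv↔Surv′ : ∀ n la → Surv n la ↔ Surv′ n la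
Surv↔Surv′ n la = mk↔ₛ′ to from (λ _ → refl) from∘to
  where
  forget : ∀ {S₁ S₂ σ} → S₁ ≡ S₂ × IsPerm n σ × (Σ (List ℕ) λ β → IsComposition n β × IsRHT la β S₁ × cycC σ ≡ β) → IsPerm n σ × IsRHT la (cycC σ) S₁
  forget (_ , ip , _ , _ , rht , refl) = ip , rht
  to : Surv n la → Surv′ n la
  to ⟨ (S₁ , S₂ , σ) , p ⟩ = ⟨ (S₁ , σ) , forget {S₁} {S₂} {σ} p ⟩
  from : Surv′ n la → Surv n la
  from ⟨ (T , σ) , p ⟩ = ⟨ (T , T , σ) , (refl , proj₁ p , cycC σ , cycC-isComposition n σ (proj₁ p) , proj₂ p , refl) ⟩
  from∘to : ∀ z → from (to z) ≡ z
  from∘to ⟨ (S₁ , S₂ , σ) , p ⟩ = Sub≡ (cong (λ S → (S₁ , S , σ)) (irrEq (LP.≡-dec (LP.≡-dec Data.Nat._≟_)) (proj₁ p)))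

SurvR↔SurvR′ : ∀ n mu rho → SurvR n mu rho ↔ SurvR′ n mu (_∈ rho)
SurvR↔SurvR′ n mu rho = mk↔ₛ′ to from (λ _ → refl) (λ _ → refl)
  where
  forget : ∀ {T σ} → IsPerm n σ × (Σ (List ℕ) λ β → IsComposition n β × IsRHT mu β T × (∀ c → (entry T c ≡ just (length β)) ⇔ (c ∈ rho)) × cycC σ ≡ β)
         → IsPerm n σ × IsRHT mu (cycC σ) T × (∀ c → (entry T c ≡ just (length (cycC σ))) ⇔ (c ∈ rho))
  forget (ip , _ , _ , rht , last⇔ρ , refl) = ip , rht , last⇔ρ
  to : SurvR n mu rho → SurvR′ n mu (_∈ rho)
  to ⟨ (T , σ) , p ⟩ = ⟨ (T , σ) , forget {T} {σ} p ⟩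
  from : SurvR′ n mu (_∈ rho) → SurvR n mu rho
  from ⟨ (T , σ) , p ⟩ = ⟨ (T , σ) , (proj₁ p , cycC σ , cycC-isComposition n σ (proj₁ p) , proj₁ (proj₂ p) , proj₂ (proj₂ p) , refl) ⟩

theorem7p4 : (n : ℕ) → 1 ≤ n →
    ((la : List ℕ) → IsPartition n la → CS n ⤖ Surv n la)
    × ((mu : List ℕ) (rho : List Cell) → IsPartition n mu
         → IsRimHook (λ c → c ∈ rho)
         → (∀ c → c ∈ rho → InDg mu c)
         → IsPartitionDiagram (λ c → InDg mu c × ¬ (c ∈ rho))
         → CS (n ∸ 1) ⤖ SurvR n mu rho)
theorem7p4 (suc n) _ = partA , partB
  where
  partA : (la : List ℕ) → IsPartition (suc n) la → CS (suc n) ⤖ Surv (suc n) la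
  partA la la⊢n = ↔⇒⤖ (↔-trans (CS↔Fin (suc n)) (↔-sym (↔-trans (Surv↔Surv′ (suc n) la) (Surv′↔Fin (suc n) (suc n) ≤-refl la la⊢n))))
  partB : (mu : List ℕ) (rho : List Cell) → IsPartition (suc n) mu → IsRimHook (_∈ rho) → (∀ c → c ∈ rho → InDg mu c)
          → IsPartitionDiagram (λ c → InDg mu c × ¬ (c ∈ rho)) → CS n ⤖ SurvR (suc n) mu rho
  partB mu rho mu⊢n (path , isPath) ρ⊆μ (ν , ν-shape , ν⇔) =
    ↔⇒⤖ (↔-trans (CS↔Fin n) (↔-sym (↔-trans (SurvR↔SurvR′ (suc n) mu rho) (SurvR′↔Fin n (Surv′↔Fin n) removal (proj₂ (proj₁ mu⊢n)) ≤-refl))))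
    where
    removal : RimHookRemoval mu ν (_∈ rho)
    removal = record { la-shape = IsPartition⇒shape mu⊢n ; ν-shape = ν-shape ; ν-cells = λ c → ⇔-sym (ν⇔ c)
                     ; removed⊆la = ρ⊆μ ; path = path ; isPath = isPath }
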